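{- Let $F,G$ be RQFO sentences such that $F\models G$ and let $T$ be an ACI-tableau for $F$ and $G$. Then for every inner node $N$ of $T$, the formula $\mathrm{aipol}(N)$ is a weak access interpolant of the quadruple $\langle\mathrm{DEF}(F),\ \mathrm{branch}_{\mathrm{red}}(N),\ \neg\mathrm{DEF}(\neg G),\ \neg\mathrm{branch}_{\mathrm{blue}}(N)\rangle$.
   Context: First-order logic without equality. RQFO formulas are the relational formulas generated by $F ::= \top\mid\bot\mid F\wedge F\mid F\vee F\mid\forall\mathbf{v}(\neg R\vee F)\mid\exists\mathbf{v}(R\wedge F)$, $\mathbf{v}$ a possibly empty set of variables, $R$ an atom containing all members of $\mathbf{v}$; $\neg F$ for RQFO $F$ denotes the RQFO formula obtained by pushing negation inward (quantifier dualities $\neg\forall\mathbf{v}(\neg A\vee F)\equiv\exists\mathbf{v}(A\wedge\neg F)$ and vice versa, De Morgan). RQFOT formulas are defined by the same grammar except that atoms may also have arbitrary ground terms (with function symbols of any arity) as arguments. Binding patterns $\langle s,P,I\rangle$ ($s\in\{+,-\}$, existential iff $s=+$), covering ($\langle s,P,I\rangle$ covered by $\langle s',P',I'\rangle$ iff $s=s'$, $P=P'$, $I'\subseteq I$), and $\mathrm{bp}(F)$: $\forall\mathbf{v}(\neg r(t_1..t_n)\vee G)$ contributes $\langle -,r,\{i\mid t_i\notin\mathbf{v}\}\rangle$, $\exists\mathbf{v}(r(t_1..t_n)\wedge G)$ contributes $\langle +,r,\{i\mid t_i\notin\mathbf{v}\}\rangle$, unioned over subformulas; $\top,\bot$ contribute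 nothing. $\mathrm{pred}(F)$: set of (predicate, polarity) pairs. $\mathrm{garg}(F)$: set of ground terms occurring as direct atom arguments in $F$. Weak access interpolant: for RQFO sentences $F,G$ and quantifier-free $F',G'$ with $F\wedge F'\models G\vee G'$, a weak access interpolant of $\langle F,F',G,G'\rangle$ is an RQFOT sentence $H$ with $F\wedge F'\models H\models G\vee G'$, $\mathrm{pred}(H)\subseteq\mathrm{pred}(F)\cap\mathrm{pred}(G)$, every existential binding pattern of $H$ covered by an existential binding pattern of $G$, every universal one covered by a universal binding pattern of $F$, and $\mathrm{garg}(H)\subseteq\mathrm{garg}(F\wedge F')\cap\mathrm{garg}(G\vee G')$. Definitional clausification: positions $p$ of $F$ with subformulas $F|_p$ ($\epsilon$ root; $p1,p2$ for the conjuncts/disjuncts of $F|_p$; $p1$ for the matrix $G$ of $\forall\mathbf{v}(\neg R\vee G)$ or $\exists\mathbf{v}(R\wedge G)$, with $R_p=R$, $\mathbf{v}_p=\mathbf{v}$). $\mathbf{x}_p$: free variables of $F|_p$ in a fixed order; $D_p=d_p(\mathbf{x}_p)$ with fresh definer $d_p$; for existential positions with $\mathbf{v}_p=\{x_1..x_n\}$, fresh Skolem functions $f_{\langle p,i\rangle}$ and $\sigma_p=\{x_i\mapsto f_{\langle p,i\rangle}(\mathbf{x}_p)\}$. The clausification consists of: (form 1) $D_\epsilon$; for $F|_p=\bot$: (2) $\neg D_p$; for $\top$: nothing; for $G\wedge H$: (3) $\neg D_p\vee D_{p1}$, (4) $\neg D_p\vee D_{p2}$; for $G\vee H$: (5)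 $\neg D_p\vee D_{p1}\vee D_{p2}$; for $\forall\mathbf{v}(\neg R\vee G)$: (6) $\neg D_p\vee\neg R_p\vee D_{p1}$; for $\exists\mathbf{v}(R\wedge G)$: (7) $\neg D_p\vee R_p\sigma_p$, (8) $\neg D_p\vee D_{p1}\sigma_p$. $\mathrm{DEF}(F)=d_\epsilon(\mathbf{x}_\epsilon)\wedge\bigwedge_p\mathrm{def}_p$ with $\mathrm{def}_p$ equal to $D_p\to\top$, $D_p\to\bot$, $\forall\mathbf{x}_p(D_p\to(D_{p1}\wedge D_{p2}))$, $\forall\mathbf{x}_p(D_p\to(D_{p1}\vee D_{p2}))$, $\forall\mathbf{x}_p(D_p\to\forall\mathbf{v}(\neg R\vee D_{p1}))$, $\forall\mathbf{x}_p(D_p\to\exists\mathbf{v}(R\wedge D_{p1}))$ respectively. For $F$ use definers/Skolem functions indexed $\mathrm{L}p$, for the RQFO formula $\neg G$ disjoint ones indexed $\mathrm{R}p$. Tableaux: a clausal tableau for clausal $C$ is a finite ordered tree with literal labels $\mathrm{lit}(N)$ on non-root nodes such that each node's children's labels form (as a disjunction $\mathrm{clause}(N)$) an instance of a clause of $C$; closed node: some ancestor has the complementary label; closed tableau: all leaves closed. A two-sided tableau for $C_{\mathrm{red}},C_{\mathrm{blue}}$ additionally labels non-root nodes with sides in $\{\mathrm{red},\mathrm{blue}\}$, equal among siblings, children of side $S$ giving an instance of a clause of $C_S$. $\mathrm{branch}_S(N)$ is the conjunction of the labels of nodes of side $S$ among $N$ and its ancestors. An ACI-tableau for $F,G$ is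 a closed two-sided ground tableau for the clausification of $F$ (red) and of $\neg G$ (blue) which is regular (no node has an ancestor with the same label), leaf-only for all negative literals occurring as labels (none labels an inner node), and contiguous for every pair $\{R_{sp}\sigma_{sp}\mu,D_{sp1}\sigma_{sp}\mu\}$ ($\mu$ ground) of occurring labels (if both label nodes on one branch, one is the parent of the other). For injective ground $\theta$, $F\langle\theta^{ -1}\rangle$ replaces atom-argument occurrences of each $t\in\mathrm{rng}(\theta)$ by the variable mapped to $t$. $\mathrm{aipol}(N)$ for inner $N$ with children $N_1..N_k$: form 1: $\mathrm{aipol}(N_1)$; forms 2–5,7,8: $\bigvee_{i=2}^k\mathrm{aipol}(N_i)$ if children red, $\bigwedge_{i=2}^k\mathrm{aipol}(N_i)$ if blue; form 6 instance $\neg D\vee\neg R\vee D'$ with $\mathrm{tgt}(N_2)$ the unique ancestor labeled $\overline{\mathrm{lit}(N_2)}$: if $\mathrm{side}(\mathrm{tgt}(N_2))=\mathrm{side}(N_1)$ then $\mathrm{aipol}(N_3)$; if $N_1$ red and $\mathrm{tgt}(N_2)$ blue then $(\forall v_1..\forall v_n(\neg R\vee\mathrm{aipol}(N_3)))\langle\theta^{ -1}\rangle$ with $\{t_1..t_n\}=\mathrm{garg}(\neg R)\setminus\mathrm{garg}(\mathrm{DEF}(F)\wedge\mathrm{branch}_{\mathrm{red}}(N))$, fresh $v_i$, $\theta=\{v_i\mapsto t_i\}$; if $N_1$ blue and $\mathrm{tgt}(N_2)$ red then $(\exists v_1..\exists v_n(R\wedge\mathrm{aipol}(N_3)))\langle\theta^{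 -1}\rangle$ with $\{t_1..t_n\}=\mathrm{garg}(R)\setminus\mathrm{garg}(\mathrm{DEF}(\neg G)\wedge\mathrm{branch}_{\mathrm{blue}}(N))$. -}

module Defs where

open import Level using (0ℓ)
open import Data.Nat using (ℕ; zero; suc; _≟_)
open import Data.Bool using (Bool; true; false; if_then_else_)
open import Data.Maybe using (Maybe; just; nothing)
import Data.Maybe as Maybe
open import Data.List using (List; []; _∷_; _++_; map; concatMap; length; zip)
open import Data.List.Relation.Unary.All using (All)
open import Data.List.Relation.Unary.Any using (Any)
open import Data.List.Relation.Unary.Unique.Propositional using (Unique)
open import Data.List.Relation.Binary.Pointwise using (Pointwise)
open import Data.List.Membership.Propositional using (_∈_; _∉_)
open import Data.Product using (Σ; _×_; _,_; proj₁; proj₂)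
open import Data.Sum using (_⊎_; inj₁; inj₂)
open import Data.Unit using (⊤; tt)
open import Data.Empty using (⊥)
open import Relation.Nullary using (¬_; yes; no)
open import Relation.Binary.PropositionalEquality using (_≡_)
open import Function.Bundles using (_⇔_)

-- Signature

-- Sides of a two-sided tableau.  red ~ F (definers/Skolems indexed "L"),
-- blue ~ ¬G (definers/Skolems indexed "R").
data Side : Set where
  red blue : Side

-- Positions: words over {1,2}, read from the root.
data Dir : Set where
  one two : Dir

Pos : Set
Pos = List Dir

Var : Set
Var = ℕ

-- predicate symbols: original ones, and definers d_{Lp} / d_{Rp}
data PSym : Set where
  orig : ℕ → PSym
  dfn  : Side → Pos → PSym

-- function symbols: original ones (constants are the nullary ones) and
-- Skolem functions f_{⟨Lp,i⟩} / f_{⟨Rp,i⟩}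
data FSym : Set where
  origF : ℕ → FSym
  sk    : Side → Pos → ℕ → FSym

data Term : Set where
  var : Var → Term
  fn  : FSym → List Term → Term

Atom : Set
Atom = PSym × List Term

args : Atom → List Term
args = proj₂

data Ground : Term → Set where
  fnG : ∀ {f ts} → All Ground ts → Ground (fn f ts)

data _∈ᵥ_ (x : Var) : Term → Set where
  vhere : x ∈ᵥ var x
  vfn   : ∀ {f ts} → Any (x ∈ᵥ_) ts → x ∈ᵥ fn f ts

-- Formulas of the shape of the RQFO / RQFOT grammar
--   F ::= ⊤ | ⊥ | F ∧ F | F ∨ F | ∀v(¬R ∨ F) | ∃v(R ∧ F)
-- 'all v R F' is ∀v(¬R ∨ F), 'ex v R F' is ∃v(R ∧ F); v is a list
-- (required duplicate-free by the well-formedness predicates).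

data QF : Set where
  tt′ ff′   : QF
  _∧′_ _∨′_ : QF → QF → QF
  all′ ex′  : List Var → Atom → QF → QF

negQF : QF → QF
negQF tt′ = ff′
negQF ff′ = tt′
negQF (A ∧′ B) = negQF A ∨′ negQF B
negQF (A ∨′ B) = negQF A ∧′ negQF B
negQF (all′ v R A) = ex′ v R (negQF A)
negQF (ex′ v R A) = all′ v R (negQF A)

FreeIn : Var → QF → Set
FreeIn x tt′ = ⊥
FreeIn x ff′ = ⊥
FreeIn x (A ∧′ B) = FreeIn x A ⊎ FreeIn x B
FreeIn x (A ∨′ B) = FreeIn x A ⊎ FreeIn x B
FreeIn x (all′ v R A) = (Any (x ∈ᵥ_) (args R) ⊎ FreeIn x A) × x ∉ v
FreeIn x (ex′ v R A) = (Any (x ∈ᵥ_) (args R) ⊎ FreeIn x A) × x ∉ v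

OccIn : Var → QF → Set
OccIn x tt′ = ⊥
OccIn x ff′ = ⊥
OccIn x (A ∧′ B) = OccIn x A ⊎ OccIn x B
OccIn x (A ∨′ B) = OccIn x A ⊎ OccIn x B
OccIn x (all′ v R A) = x ∈ v ⊎ Any (x ∈ᵥ_) (args R) ⊎ OccIn x A
OccIn x (ex′ v R A) = x ∈ v ⊎ Any (x ∈ᵥ_) (args R) ⊎ OccIn x A

Sentence : QF → Set
Sentence F = ∀ x → ¬ FreeIn x F

RelArg : Term → Set
RelArg t = Σ Var (λ x → t ≡ var x) ⊎ Σ ℕ (λ c → t ≡ fn (origF c) [])

TArg : Term → Set
TArg t = Σ Var (λ x → t ≡ var x) ⊎ Ground t

IsOrig : PSym → Set
IsOrig r = Σ ℕ (λ n → r ≡ orig n)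

QuantOK : List Var → Atom → Set
QuantOK v R = Unique v × (∀ x → x ∈ v → var x ∈ args R)

RQFO : QF → Set
RQFO tt′ = ⊤
RQFO ff′ = ⊤
RQFO (A ∧′ B) = RQFO A × RQFO B
RQFO (A ∨′ B) = RQFO A × RQFO B
RQFO (all′ v R A) = IsOrig (proj₁ R) × All RelArg (args R) × QuantOK v R × RQFO A
RQFO (ex′ v R A) = IsOrig (proj₁ R) × All RelArg (args R) × QuantOK v R × RQFO A

RQFOT : QF → Set
RQFOT tt′ = ⊤
RQFOT ff′ = ⊤
RQFOT (A ∧′ B) = RQFOT A × RQFOT B
RQFOT (A ∨′ B) = RQFOT A × RQFOT B
RQFOT (all′ v R A) = All TArg (args R) × QuantOK v R × RQFOT A
RQFOT (ex′ v R A) = All TArg (args R) × QuantOK v R × RQFOT A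

-- Literals

data Lit : Set where
  pos neg : Atom → Lit

atomOf : Lit → Atom
atomOf (pos a) = a
atomOf (neg a) = a

compl : Lit → Lit
compl (pos a) = neg a
compl (neg a) = pos a

GroundLit : Lit → Set
GroundLit l = All Ground (args (atomOf l))

Clause : Set
Clause = List Lit

mutual
  substT : (Var → Term) → Term → Term
  substT μ (var x) = μ x
  substT μ (fn f ts) = fn f (substTs μ ts)

  substTs : (Var → Term) → List Term → List Term
  substTs μ [] = []
  substTs μ (t ∷ ts) = substT μ t ∷ substTs μ ts

substA : (Var → Term) → Atom → Atom
substA μ (r , ts) = r , substTs μ ts

substL : (Var → Term) → Lit → Lit
substL μ (pos a) = pos (substA μ a)
substL μ (neg a) = neg (substA μ a)

-- Binding patterns, predicates with polarity, ground arguments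

data Pol : Set where
  plus minus : Pol

-- Quant s R v F : F has a subformula ∀v(¬R ∨ _) (s = minus) or ∃v(R ∧ _)
-- (s = plus).  Such a subformula contributes the binding pattern
-- ⟨s, pred R, {i | arg_i(R) ∉ v}⟩ and the pair (pred R, s) to pred(F).
data Quant : Pol → Atom → List Var → QF → Set where
  qAll  : ∀ {v R A} → Quant minus R v (all′ v R A)
  qEx   : ∀ {v R A} → Quant plus R v (ex′ v R A)
  inAll : ∀ {s R' v' v R A} → Quant s R' v' A → Quant s R' v' (all′ v R A)
  inEx  : ∀ {s R' v' v R A} → Quant s R' v' A → Quant s R' v' (ex′ v R A)
  inAndL : ∀ {s R v A B} → Quant s R v A → Quant s R v (A ∧′ B)
  inAndR : ∀ {s R v A B} → Quant s R v B → Quant s R v (A ∧′ B)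
  inOrL  : ∀ {s R v A B} → Quant s R v A → Quant s R v (A ∨′ B)
  inOrR  : ∀ {s R v A B} → Quant s R v B → Quant s R v (A ∨′ B)

nth : {A : Set} → List A → ℕ → Maybe A
nth [] i = nothing
nth (x ∷ xs) zero = just x
nth (x ∷ xs) (suc i) = nth xs i

-- i ∈ I for the index set I = {i | t_i ∉ v} of atom arguments ts
InIdx : List Var → List Term → ℕ → Set
InIdx v ts i = Σ Term (λ t → nth ts i ≡ just t × t ∉ map var v)

PredIn : Pol → PSym → QF → Set
PredIn s r F = Σ Atom (λ R → Σ (List Var) (λ v → Quant s R v F × proj₁ R ≡ r))

-- the pattern ⟨s, pred R, {i | arg_i R ∉ v}⟩ is covered by some binding
-- pattern ⟨s, pred R, I'⟩ of F (I' ⊆ I)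
CoveredIn : Pol → Atom → List Var → QF → Set
CoveredIn s R v F =
  Σ Atom (λ R' → Σ (List Var) (λ v' →
    Quant s R' v' F × proj₁ R' ≡ proj₁ R ×
    (∀ i → InIdx v' (args R') i → InIdx v (args R) i)))

GArgAtom : Term → Atom → Set
GArgAtom t R = t ∈ args R × Ground t

GArg : Term → QF → Set
GArg t tt′ = ⊥
GArg t ff′ = ⊥
GArg t (A ∧′ B) = GArg t A ⊎ GArg t B
GArg t (A ∨′ B) = GArg t A ⊎ GArg t B
GArg t (all′ v R A) = GArgAtom t R ⊎ GArg t A
GArg t (ex′ v R A) = GArgAtom t R ⊎ GArg t A

GArgLits : Term → List Lit → Set
GArgLits t ls = Any (λ l → GArgAtom t (atomOf l)) ls

-- Semantics (Tarskian, nonempty domains)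

record Structure : Set₁ where
  field
    D   : Set
    inh : D
    fun : FSym → List D → D
    rel : PSym → List D → Set

module Sem (M : Structure) where
  open Structure M

  mutual
    evalT : (Var → D) → Term → D
    evalT ρ (var x) = ρ x
    evalT ρ (fn f ts) = fun f (evalTs ρ ts)

    evalTs : (Var → D) → List Term → List D
    evalTs ρ [] = []
    evalTs ρ (t ∷ ts) = evalT ρ t ∷ evalTs ρ ts

  evalA : (Var → D) → Atom → Set
  evalA ρ (r , ts) = rel r (evalTs ρ ts)

  evalL : (Var → D) → Lit → Set
  evalL ρ (pos a) = evalA ρ a
  evalL ρ (neg a) = ¬ evalA ρ a

  update : (Var → D) → Var → D → Var → D
  update ρ x d y with y ≟ x
  ... | yes _ = d
  ... | no _ = ρ y

  AllV : List Var → (Var → D) → ((Var → D) → Set) → Set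
  AllV [] ρ P = P ρ
  AllV (x ∷ xs) ρ P = (d : D) → AllV xs (update ρ x d) P

  ExV : List Var → (Var → D) → ((Var → D) → Set) → Set
  ExV [] ρ P = P ρ
  ExV (x ∷ xs) ρ P = Σ D (λ d → ExV xs (update ρ x d) P)

  ⟦_⟧ : QF → (Var → D) → Set
  ⟦ tt′ ⟧ ρ = ⊤
  ⟦ ff′ ⟧ ρ = ⊥
  ⟦ A ∧′ B ⟧ ρ = ⟦ A ⟧ ρ × ⟦ B ⟧ ρ
  ⟦ A ∨′ B ⟧ ρ = ⟦ A ⟧ ρ ⊎ ⟦ B ⟧ ρ
  ⟦ all′ v R A ⟧ ρ = AllV v ρ (λ ρ' → ¬ evalA ρ' R ⊎ ⟦ A ⟧ ρ')
  ⟦ ex′ v R A ⟧ ρ = ExV v ρ (λ ρ' → evalA ρ' R × ⟦ A ⟧ ρ')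

Entails : QF → QF → Set₁
Entails F G = ∀ (M : Structure) (ρ : Var → Structure.D M) →
  Sem.⟦_⟧ M F ρ → Sem.⟦_⟧ M G ρ

-- Weak access interpolant of ⟨F, F', G, G'⟩.
-- F' is given as the list of literals of the conjunction F'; G' is
-- ¬(⋀ Gl), i.e. the disjunction of the complements of the literals Gl.

WeakAI : QF → List Lit → QF → List Lit → QF → Set₁
WeakAI F Fl G Gl H =
  RQFOT H × Sentence H ×
  (∀ (M : Structure) (ρ : Var → Structure.D M) →
     Sem.⟦_⟧ M F ρ → All (Sem.evalL M ρ) Fl → Sem.⟦_⟧ M H ρ) ×
  (∀ (M : Structure) (ρ : Var → Structure.D M) →
     Sem.⟦_⟧ M H ρ → Sem.⟦_⟧ M G ρ ⊎ Any (λ l → ¬ Sem.evalL M ρ l) Gl) ×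
  (∀ s R v → Quant s R v H → PredIn s (proj₁ R) F × PredIn s (proj₁ R) G) ×
  (∀ R v → Quant plus R v H → CoveredIn plus R v G) ×
  (∀ R v → Quant minus R v H → CoveredIn minus R v F) ×
  (∀ t → GArg t H → (GArg t F ⊎ GArgLits t Fl) × (GArg t G ⊎ GArgLits t Gl))

-- Definitional clausification

posList : QF → List (Pos × QF)
posList F = ([] , F) ∷ rest F
  where
  pre : Dir → List (Pos × QF) → List (Pos × QF)
  pre d = map (λ pg → (d ∷ proj₁ pg) , proj₂ pg)
  rest : QF → List (Pos × QF)
  rest tt′ = []
  rest ff′ = []
  rest (A ∧′ B) = pre one (posList A) ++ pre two (posList B)
  rest (A ∨′ B) = pre one (posList A) ++ pre two (posList B)
  rest (all′ v R A) = pre one (posList A)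
  rest (ex′ v R A) = pre one (posList A)

-- an ordering x_p of the free variables at each position
Ord : Set
Ord = Pos → List Var

OrdOK : QF → Ord → Set
OrdOK F ord = ∀ p A → (p , A) ∈ posList F →
  Unique (ord p) × (∀ x → (x ∈ ord p) ⇔ FreeIn x A)

_·1 _·2 : Pos → Pos
p ·1 = p ++ (one ∷ [])
p ·2 = p ++ (two ∷ [])

Dat : Side → Ord → Pos → Atom
Dat s ord p = dfn s p , map var (ord p)

idx : List Var → Var → Maybe ℕ
idx [] x = nothing
idx (y ∷ ys) x with x ≟ y
... | yes _ = just zero
... | no _ = Maybe.map suc (idx ys x)

σp : Side → Ord → Pos → List Var → Var → Term
σp s ord p v x with idx v x
... | just i = fn (sk s p i) (map var (ord p))
... | nothing = var x

data Form : Set where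
  f1 f2 f3 f4 f5 f6 f7 f8 : Form

clausesAt : Side → Ord → Pos → QF → List (Form × Clause)
clausesAt s o p tt′ = []
clausesAt s o p ff′ = (f2 , neg (Dat s o p) ∷ []) ∷ []
clausesAt s o p (A ∧′ B) =
  (f3 , neg (Dat s o p) ∷ pos (Dat s o (p ·1)) ∷ []) ∷
  (f4 , neg (Dat s o p) ∷ pos (Dat s o (p ·2)) ∷ []) ∷ []
clausesAt s o p (A ∨′ B) =
  (f5 , neg (Dat s o p) ∷ pos (Dat s o (p ·1)) ∷ pos (Dat s o (p ·2)) ∷ []) ∷ []
clausesAt s o p (all′ v R A) =
  (f6 , neg (Dat s o p) ∷ neg R ∷ pos (Dat s o (p ·1)) ∷ []) ∷ []
clausesAt s o p (ex′ v R A) =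
  (f7 , neg (Dat s o p) ∷ pos (substA (σp s o p v) R) ∷ []) ∷
  (f8 , neg (Dat s o p) ∷ pos (substA (σp s o p v) (Dat s o (p ·1))) ∷ []) ∷ []

Clausify : Side → Ord → QF → List (Form × Clause)
Clausify s o F =
  (f1 , pos (Dat s o []) ∷ []) ∷
  concatMap (λ pg → clausesAt s o (proj₁ pg) (proj₂ pg)) (posList F)

atomQF : Atom → QF
atomQF a = ex′ [] a tt′

defAt : Side → Ord → Pos → QF → QF
defAt s o p tt′ = all′ (o p) (Dat s o p) tt′
defAt s o p ff′ = all′ (o p) (Dat s o p) ff′
defAt s o p (A ∧′ B) =
  all′ (o p) (Dat s o p) (atomQF (Dat s o (p ·1)) ∧′ atomQF (Dat s o (p ·2)))
defAt s o p (A ∨′ B) =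
  all′ (o p) (Dat s o p) (atomQF (Dat s o (p ·1)) ∨′ atomQF (Dat s o (p ·2)))
defAt s o p (all′ v R A) =
  all′ (o p) (Dat s o p) (all′ v R (atomQF (Dat s o (p ·1))))
defAt s o p (ex′ v R A) =
  all′ (o p) (Dat s o p) (ex′ v R (atomQF (Dat s o (p ·1))))

bigAnd : List QF → QF
bigAnd [] = tt′
bigAnd (A ∷ []) = A
bigAnd (A ∷ As) = A ∧′ bigAnd As

bigOr : List QF → QF
bigOr [] = ff′
bigOr (A ∷ []) = A
bigOr (A ∷ As) = A ∨′ bigOr As

-- DEF(F) = d_ε(x_ε) ∧ ⋀_p def_p   (D → X written ∀x_p(¬D ∨ X))
DEF : Side → Ord → QF → QF
DEF s o F = atomQF (Dat s o []) ∧′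
  bigAnd (map (λ pg → defAt s o (proj₁ pg) (proj₂ pg)) (posList F))

-- Two-sided clausal tableaux

-- A (sub)tableau: a leaf, or an inner node given by the common side of
-- its children and the list of children (label, subtree).  The root of a
-- tableau is the unlabelled top 'Tab'.
data Tab : Set where
  leaf  : Tab
  inner : Side → List (Lit × Tab) → Tab

-- Reach T anc t : t is (the subtree at) a node N of T; anc lists the
-- (label, side) of N and its non-root ancestors, nearest first
-- (anc = [] iff N is the root).
data Reach (T : Tab) : List (Lit × Side) → Tab → Set where
  root  : Reach T [] T
  child : ∀ {anc s cs l t} → Reach T anc (inner s cs) → (l , t) ∈ cs →
          Reach T ((l , s) ∷ anc) t

sameSide : Side → Side → Bool
sameSide red red = true
sameSide blue blue = true
sameSide red blue = false
sameSide blue red = false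

-- branch_S(N) as a list of literals (the conjunction of its members)
branch : Side → List (Lit × Side) → List Lit
branch S [] = []
branch S ((l , s) ∷ a) =
  if sameSide S s then l ∷ branch S a else branch S a

LeafClosed : List (Lit × Side) → Set
LeafClosed [] = ⊥
LeafClosed ((l , s) ∷ a) = compl l ∈ map proj₁ a

module TableauDefs (F G : QF) (oF oG : Ord) where

  Fs : Side → QF
  Fs red = F
  Fs blue = negQF G

  os : Side → Ord
  os red = oF
  os blue = oG

  DEFs : Side → QF
  DEFs s = DEF s (os s) (Fs s)

  InstOf : Side → Form → List Lit → Set
  InstOf s f ls = Σ Clause (λ c → (f , c) ∈ Clausify s (os s) (Fs s) ×
                    Σ (Var → Term) (λ μ → ls ≡ map (substL μ) c))

  ContigPair : Lit → Lit → Set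
  ContigPair l l' =
    Σ Side (λ s → Σ Pos (λ p → Σ (List Var) (λ v → Σ Atom (λ R → Σ QF (λ A →
    Σ (Var → Term) (λ μ →
      (p , ex′ v R A) ∈ posList (Fs s) ×
      (let a = pos (substA μ (substA (σp s (os s) p v) R))
           b = pos (substA μ (substA (σp s (os s) p v) (Dat s (os s) (p ·1))))
       in (l ≡ a × l' ≡ b) ⊎ (l ≡ b × l' ≡ a))))))))

  record ACI (T : Tab) : Set where
    field
      clauses  : ∀ {anc s cs} → Reach T anc (inner s cs) →
                 Σ Form (λ f → InstOf s f (map proj₁ cs))
      ground   : ∀ {l s a t} → Reach T ((l , s) ∷ a) t → GroundLit l
      -- closed (all leaves closed; in particular the root is inner)
      closed   : ∀ {anc} → Reach T anc leaf → LeafClosed anc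
      regular  : ∀ {l s a t} → Reach T ((l , s) ∷ a) t → l ∉ map proj₁ a
      leafOnly : ∀ {x s a s' cs} → ¬ Reach T ((neg x , s) ∷ a) (inner s' cs)
      contig   : ∀ {l s a t pre l' s' rest} → Reach T ((l , s) ∷ a) t →
                 a ≡ pre ++ ((l' , s') ∷ rest) → ContigPair l l' → pre ≡ []

  -- aipol, as a relation  Aip anc s cs H : H is (a choice of) aipol(N)
  -- for the inner node N with ancestor labels anc (N's own label first),
  -- children side s and children cs.  All admissible choices of fresh
  -- variables and of the enumeration t_1..t_n are allowed.

  -- ⟨θ⁻¹⟩ with θ given as the list of pairs (v_i , t_i)
  ArgAbs : List (Var × Term) → Term → Term → Set
  ArgAbs θ t t' = Σ Var (λ v → (v , t) ∈ θ × t' ≡ var v)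
                ⊎ (t ∉ map proj₂ θ × t' ≡ t)

  data Abs (θ : List (Var × Term)) : QF → QF → Set where
    absT : Abs θ tt′ tt′
    absF : Abs θ ff′ ff′
    absAnd : ∀ {A A' B B'} → Abs θ A A' → Abs θ B B' → Abs θ (A ∧′ B) (A' ∧′ B')
    absOr  : ∀ {A A' B B'} → Abs θ A A' → Abs θ B B' → Abs θ (A ∨′ B) (A' ∨′ B')
    absAll : ∀ {v r ts ts' A A'} → Pointwise (ArgAbs θ) ts ts' → Abs θ A A' →
             Abs θ (all′ v (r , ts) A) (all′ v (r , ts') A')
    absEx  : ∀ {v r ts ts' A A'} → Pointwise (ArgAbs θ) ts ts' → Abs θ A A' →
             Abs θ (ex′ v (r , ts) A) (ex′ v (r , ts') A')

  GTerms : Side → Atom → List (Lit × Side) → List Term → Set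
  GTerms S R anc ts = Unique ts ×
    (∀ t → (t ∈ ts) ⇔ (GArgAtom t R × ¬ (GArg t (DEFs S) ⊎ GArgLits t (branch S anc))))

  Fresh : List Var → List Term → QF → Set
  Fresh vs ts H = Unique vs × length vs ≡ length ts × (∀ x → x ∈ vs → ¬ OccIn x H)

  combine : Side → List QF → QF
  combine red = bigOr
  combine blue = bigAnd

  data Junct : Form → Set where
    j2 : Junct f2
    j3 : Junct f3
    j4 : Junct f4
    j5 : Junct f5
    j7 : Junct f7
    j8 : Junct f8

  mutual
    data Aip : List (Lit × Side) → Side → List (Lit × Tab) → QF → Set where
      aip1 : ∀ {anc s l s' cs' H} →
        InstOf s f1 (l ∷ []) →
        Aip ((l , s) ∷ anc) s' cs' H →
        Aip anc s ((l , inner s' cs') ∷ []) H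
      aipJ : ∀ {anc s f l t rest Hs} →
        Junct f →
        InstOf s f (l ∷ map proj₁ rest) →
        AipAll anc s rest Hs →
        Aip anc s ((l , t) ∷ rest) (combine s Hs)
      -- form 6, side(tgt(N₂)) = side(N₁)
      aip6 : ∀ {anc s l₁ t₁ R t₂ l₃ s₃ cs₃ H} →
        InstOf s f6 (l₁ ∷ neg R ∷ l₃ ∷ []) →
        (pos R , s) ∈ anc →
        Aip ((l₃ , s) ∷ anc) s₃ cs₃ H →
        Aip anc s ((l₁ , t₁) ∷ (neg R , t₂) ∷ (l₃ , inner s₃ cs₃) ∷ []) H
      -- form 6, N₁ red, tgt(N₂) blue
      aip6rb : ∀ {anc l₁ t₁ R t₂ l₃ s₃ cs₃ H₃ ts vs H} →
        InstOf red f6 (l₁ ∷ neg R ∷ l₃ ∷ []) →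
        (pos R , blue) ∈ anc →
        Aip ((l₃ , red) ∷ anc) s₃ cs₃ H₃ →
        GTerms red R anc ts →
        Fresh vs ts H₃ →
        Abs (zip vs ts) (all′ vs R H₃) H →
        Aip anc red ((l₁ , t₁) ∷ (neg R , t₂) ∷ (l₃ , inner s₃ cs₃) ∷ []) H
      -- form 6, N₁ blue, tgt(N₂) red
      aip6br : ∀ {anc l₁ t₁ R t₂ l₃ s₃ cs₃ H₃ ts vs H} →
        InstOf blue f6 (l₁ ∷ neg R ∷ l₃ ∷ []) →
        (pos R , red) ∈ anc →
        Aip ((l₃ , blue) ∷ anc) s₃ cs₃ H₃ →
        GTerms blue R anc ts →
        Fresh vs ts H₃ →
        Abs (zip vs ts) (ex′ vs R H₃) H →
        Aip anc blue ((l₁ , t₁) ∷ (neg R , t₂) ∷ (l₃ , inner s₃ cs₃) ∷ []) H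

    data AipAll : List (Lit × Side) → Side → List (Lit × Tab) → List QF → Set where
      []  : ∀ {anc s} → AipAll anc s [] []
      _∷_ : ∀ {anc s l s' cs' rest H Hs} →
        Aip ((l , s) ∷ anc) s' cs' H →
        AipAll anc s rest Hs →
        AipAll anc s ((l , inner s' cs') ∷ rest) (H ∷ Hs)

-- By induction on the node N we prove a stronger invariant: besides the syntactic conditions,
-- DEF(F) ∧ branch_red(N) ⊨ aipol(N) and aipol(N) ∧ DEF(¬G) ∧ branch_blue(N) is unsatisfiable,
-- where ground terms are interpreted by an arbitrary valuation instead of by the structure.
-- This freedom carries the two delicate steps.  At an existential clause (forms 7, 8) the fresh
-- Skolem terms are sent to the witnesses of ∃v(R ∧ D_p1); by regularity and contiguity they occur
-- on the branch only in the twin literal, and not at all on the other side.  At a form 6 clause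
-- closed across sides, the terms t₁..tₙ abstracted by ⟨θ⁻¹⟩ do not occur on the node's side, so
-- they can be reinterpreted as the values of the quantified variables v₁..vₙ.

module Submission where

open import Defs
open import Level using (0ℓ)
open import Axiom.ExcludedMiddle using (ExcludedMiddle)
open import Data.Nat using (ℕ; zero; suc; _+_; _≤_; s≤s) renaming (_≟_ to _≟ℕ_)
open import Data.Nat.Properties using (m≤m+n; m≤n+m; ≤-trans; <-irrefl; suc-injective)
open import Data.Maybe using (Maybe; just; nothing)
open import Data.List using (List; []; _∷_; _++_; map; length; zip)
open import Data.List.Properties using (∷-injective; ≡-dec)
open import Data.List.Relation.Unary.All as All using (All; []; _∷_)
open import Data.List.Relation.Unary.All.Properties using (¬All⇒Any¬)
open import Data.List.Relation.Unary.Any as Any using (Any; here; there; any?)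
open import Data.List.Relation.Unary.Unique.Propositional using (Unique)
open import Data.List.Relation.Unary.AllPairs using ([]; _∷_)
open import Data.List.Relation.Binary.Pointwise using (Pointwise; []; _∷_)
open import Data.List.Membership.Propositional using (_∈_; _∉_; find)
open import Data.List.Membership.Propositional.Properties
  using (∈-map⁺; ∈-map⁻; ∈-++⁺ˡ; ∈-++⁺ʳ; ∈-++⁻; ∈-concatMap⁻; ∈-∃++)
open import Data.Product using (Σ; _×_; _,_; proj₁; proj₂; ∃; ∃₂)
import Data.Product as Product
open import Data.Sum using (_⊎_; inj₁; inj₂; [_,_]′)
import Data.Sum as Sum
open import Data.Unit using (⊤; tt)
open import Data.Empty using (⊥; ⊥-elim)
open import Function.Base using (id)
open import Function.Bundles using (_⇔_; mk⇔; Equivalence)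
open import Relation.Nullary using (¬_; yes; no; Dec)
open import Relation.Binary.PropositionalEquality
  using (_≡_; refl; sym; trans; cong; cong₂; subst)

open Equivalence using (to; from)

pointwise-∈ˡ : ∀ {A B : Set} {P : A → B → Set} {xs ys x} → Pointwise P xs ys → x ∈ xs →
  ∃ λ y → y ∈ ys × P x y
pointwise-∈ˡ (p ∷ ps) (here refl) = _ , here refl , p
pointwise-∈ˡ (p ∷ ps) (there m) = Product.map₂ (Product.map₁ there) (pointwise-∈ˡ ps m)

pointwise-∈ʳ : ∀ {A B : Set} {P : A → B → Set} {xs ys y} → Pointwise P xs ys → y ∈ ys →
  ∃ λ x → x ∈ xs × P x y
pointwise-∈ʳ (p ∷ ps) (here refl) = _ , here refl , p
pointwise-∈ʳ (p ∷ ps) (there m) = Product.map₂ (Product.map₁ there) (pointwise-∈ʳ ps m)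

pointwise-nth : ∀ {A B : Set} {P : A → B → Set} {xs ys i x} → Pointwise P xs ys → nth xs i ≡ just x →
  ∃ λ y → nth ys i ≡ just y × P x y
pointwise-nth {i = zero} (p ∷ ps) refl = _ , refl , p
pointwise-nth {i = suc i} (p ∷ ps) e = pointwise-nth ps e

nth-∈ : ∀ {A : Set} (xs : List A) i {x} → nth xs i ≡ just x → x ∈ xs
nth-∈ (y ∷ xs) zero refl = here refl
nth-∈ (y ∷ xs) (suc i) e = there (nth-∈ xs i e)

map-proj₁-zip : ∀ {A B : Set} (xs : List A) (ys : List B) → length xs ≡ length ys → map proj₁ (zip xs ys) ≡ xs
map-proj₁-zip [] [] e = refl
map-proj₁-zip (x ∷ xs) (y ∷ ys) e = cong (x ∷_) (map-proj₁-zip xs ys (suc-injective e))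

map-proj₂-zip : ∀ {A B : Set} (xs : List A) (ys : List B) → length xs ≡ length ys → map proj₂ (zip xs ys) ≡ ys
map-proj₂-zip [] [] e = refl
map-proj₂-zip (x ∷ xs) (y ∷ ys) e = cong (y ∷_) (map-proj₂-zip xs ys (suc-injective e))

∈-zip⁺ˡ : ∀ {A B : Set} (xs : List A) (ys : List B) {x} → length xs ≡ length ys → x ∈ xs →
  ∃ λ y → (x , y) ∈ zip xs ys
∈-zip⁺ˡ (x ∷ xs) (y ∷ ys) e (here refl) = y , here refl
∈-zip⁺ˡ (x ∷ xs) (y ∷ ys) e (there m) = Product.map₂ there (∈-zip⁺ˡ xs ys (suc-injective e) m)

∈-proj₁ : ∀ {A B : Set} {a : A} {b : B} {L} → (a , b) ∈ L → a ∈ map proj₁ L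
∈-proj₁ = ∈-map⁺ proj₁

∈-proj₂ : ∀ {A B : Set} {a : A} {b : B} {L} → (a , b) ∈ L → b ∈ map proj₂ L
∈-proj₂ = ∈-map⁺ proj₂

unique-proj₁⇒functional : ∀ {A B : Set} (L : List (A × B)) {a b b'} → Unique (map proj₁ L) →
  (a , b) ∈ L → (a , b') ∈ L → b ≡ b'
unique-proj₁⇒functional (_ ∷ L) u (here refl) (here refl) = refl
unique-proj₁⇒functional (_ ∷ L) (d ∷ u) (here refl) (there m') = ⊥-elim (All.lookup d (∈-proj₁ m') refl)
unique-proj₁⇒functional (_ ∷ L) (d ∷ u) (there m) (here refl) = ⊥-elim (All.lookup d (∈-proj₁ m) refl)
unique-proj₁⇒functional (_ ∷ L) (d ∷ u) (there m) (there m') = unique-proj₁⇒functional L u m m'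

unique-proj₂⇒injective : ∀ {A B : Set} (L : List (A × B)) {a a' b} → Unique (map proj₂ L) →
  (a , b) ∈ L → (a' , b) ∈ L → a ≡ a'
unique-proj₂⇒injective (_ ∷ L) u (here refl) (here refl) = refl
unique-proj₂⇒injective (_ ∷ L) (d ∷ u) (here refl) (there m') = ⊥-elim (All.lookup d (∈-proj₂ m') refl)
unique-proj₂⇒injective (_ ∷ L) (d ∷ u) (there m) (here refl) = ⊥-elim (All.lookup d (∈-proj₂ m) refl)
unique-proj₂⇒injective (_ ∷ L) (d ∷ u) (there m) (there m') = unique-proj₂⇒injective L u m m'

-- Terms and substitutions

_≟ˢ_ : (a b : Side) → Dec (a ≡ b)
red ≟ˢ red = yes refl
red ≟ˢ blue = no (λ ())
blue ≟ˢ red = no (λ ())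
blue ≟ˢ blue = yes refl

_≟ᵈ_ : (a b : Dir) → Dec (a ≡ b)
one ≟ᵈ one = yes refl
one ≟ᵈ two = no (λ ())
two ≟ᵈ one = no (λ ())
two ≟ᵈ two = yes refl

_≟ᵖ_ : (a b : Pos) → Dec (a ≡ b)
_≟ᵖ_ = ≡-dec _≟ᵈ_

_≟ᶠ_ : (a b : FSym) → Dec (a ≡ b)
origF n ≟ᶠ origF m with n ≟ℕ m
... | yes refl = yes refl
... | no ne = no (λ { refl → ne refl })
origF _ ≟ᶠ sk _ _ _ = no (λ ())
sk _ _ _ ≟ᶠ origF _ = no (λ ())
sk s p i ≟ᶠ sk s' p' i' with s ≟ˢ s' | p ≟ᵖ p' | i ≟ℕ i'
... | yes refl | yes refl | yes refl = yes refl
... | no ne | _ | _ = no (λ { refl → ne refl })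
... | yes _ | no ne | _ = no (λ { refl → ne refl })
... | yes _ | yes _ | no ne = no (λ { refl → ne refl })

mutual
  _≟ᵗ_ : (a b : Term) → Dec (a ≡ b)
  var x ≟ᵗ var y with x ≟ℕ y
  ... | yes refl = yes refl
  ... | no ne = no (λ { refl → ne refl })
  var _ ≟ᵗ fn _ _ = no (λ ())
  fn _ _ ≟ᵗ var _ = no (λ ())
  fn f ts ≟ᵗ fn g us with f ≟ᶠ g | ts ≟ᵗˢ us
  ... | yes refl | yes refl = yes refl
  ... | no ne | _ = no (λ { refl → ne refl })
  ... | yes _ | no ne = no (λ { refl → ne refl })

  _≟ᵗˢ_ : (a b : List Term) → Dec (a ≡ b)
  [] ≟ᵗˢ [] = yes refl
  [] ≟ᵗˢ (_ ∷ _) = no (λ ())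
  (_ ∷ _) ≟ᵗˢ [] = no (λ ())
  (t ∷ ts) ≟ᵗˢ (u ∷ us) with t ≟ᵗ u | ts ≟ᵗˢ us
  ... | yes refl | yes refl = yes refl
  ... | no ne | _ = no (λ { refl → ne refl })
  ... | yes _ | no ne = no (λ { refl → ne refl })

mutual
  size : Term → ℕ
  size (var x) = 1
  size (fn f ts) = suc (sizes ts)

  sizes : List Term → ℕ
  sizes [] = 0
  sizes (t ∷ ts) = size t + sizes ts

size-∈ : ∀ {t ts} → t ∈ ts → size t ≤ sizes ts
size-∈ {t} {.t ∷ ts} (here refl) = m≤m+n (size t) (sizes ts)
size-∈ {t} {u ∷ ts} (there m) = ≤-trans (size-∈ m) (m≤n+m (sizes ts) (size u))

fn-≢-arg : ∀ {t f ts} → t ∈ ts → fn f ts ≡ t → ⊥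
fn-≢-arg m e = <-irrefl (cong size (sym e)) (s≤s (size-∈ m))

mutual
  ground-∉ᵥ : ∀ {x t} → Ground t → x ∈ᵥ t → ⊥
  ground-∉ᵥ (fnG gs) (vfn a) = grounds-∉ᵥ gs a

  grounds-∉ᵥ : ∀ {x ts} → All Ground ts → Any (x ∈ᵥ_) ts → ⊥
  grounds-∉ᵥ (g ∷ gs) (here o) = ground-∉ᵥ g o
  grounds-∉ᵥ (g ∷ gs) (there a) = grounds-∉ᵥ gs a

ground-∉-vars : ∀ {t} xs → Ground t → t ∉ map var xs
ground-∉-vars xs g m with ∈-map⁻ var m
ground-∉-vars xs () m | x , _ , refl

ground-fn : ∀ {t} → Ground t → ∃₂ λ f us → t ≡ fn f us
ground-fn (fnG {f} {ts} _) = f , ts , refl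

var-∈-vars : ∀ {x xs} → var x ∈ map var xs → x ∈ xs
var-∈-vars {x} {y ∷ xs} (here refl) = here refl
var-∈-vars {x} {y ∷ xs} (there m) = there (var-∈-vars m)

var-∈⇒∈ᵥ : ∀ {x ts} → var x ∈ ts → Any (x ∈ᵥ_) ts
var-∈⇒∈ᵥ = Any.map (λ { refl → vhere })

Const : Term → Set
Const u = Σ ℕ (λ c → u ≡ fn (origF c) [])

RelArg-ground⇒Const : ∀ {t ts} → All RelArg ts → t ∈ ts → Ground t → Const t
RelArg-ground⇒Const (inj₁ (x , refl) ∷ ra) (here refl) ()
RelArg-ground⇒Const (inj₂ (c , refl) ∷ ra) (here refl) g = c , refl
RelArg-ground⇒Const (_ ∷ ra) (there m) g = RelArg-ground⇒Const ra m g

vars-RelArg : ∀ xs → All RelArg (map var xs)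
vars-RelArg [] = []
vars-RelArg (x ∷ xs) = inj₁ (x , refl) ∷ vars-RelArg xs

vars-TArg : ∀ xs → All TArg (map var xs)
vars-TArg [] = []
vars-TArg (x ∷ xs) = inj₁ (x , refl) ∷ vars-TArg xs

RelArg⇒TArg : ∀ {ts} → All RelArg ts → All TArg ts
RelArg⇒TArg [] = []
RelArg⇒TArg (inj₁ v ∷ r) = inj₁ v ∷ RelArg⇒TArg r
RelArg⇒TArg (inj₂ (c , refl) ∷ r) = inj₂ (fnG []) ∷ RelArg⇒TArg r

Ground⇒TArg : ∀ {ts} → All Ground ts → All TArg ts
Ground⇒TArg [] = []
Ground⇒TArg (g ∷ gs) = inj₂ g ∷ Ground⇒TArg gs

substTs-∈⁺ : ∀ μ ts t → t ∈ ts → substT μ t ∈ substTs μ ts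
substTs-∈⁺ μ (t ∷ ts) t (here refl) = here refl
substTs-∈⁺ μ (_ ∷ ts) t (there m) = there (substTs-∈⁺ μ ts t m)

substTs-∈⁻ : ∀ μ ts t → t ∈ substTs μ ts → ∃ λ t₀ → t₀ ∈ ts × t ≡ substT μ t₀
substTs-∈⁻ μ (t₀ ∷ ts) t (here refl) = t₀ , here refl , refl
substTs-∈⁻ μ (t₀ ∷ ts) t (there m) = Product.map₂ (Product.map₁ there) (substTs-∈⁻ μ ts t m)

substTs-vars-∈⁺ : ∀ μ xs x → x ∈ xs → μ x ∈ substTs μ (map var xs)
substTs-vars-∈⁺ μ xs x m = substTs-∈⁺ μ (map var xs) (var x) (∈-map⁺ var m)

substTs-vars-∈⁻ : ∀ μ xs t → t ∈ substTs μ (map var xs) → ∃ λ x → x ∈ xs × t ≡ μ x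
substTs-vars-∈⁻ μ xs t m with substTs-∈⁻ μ (map var xs) t m
... | t₀ , m' , e with ∈-map⁻ var m'
...   | x , mx , refl = x , mx , e

substTs-ground-var : ∀ μ ts x → All Ground (substTs μ ts) → var x ∈ ts → Ground (μ x)
substTs-ground-var μ (t ∷ ts) x (g ∷ gs) (here refl) = g
substTs-ground-var μ (t ∷ ts) x (g ∷ gs) (there m) = substTs-ground-var μ ts x gs m

substTs-vars-injective : ∀ μ μ' xs x → substTs μ (map var xs) ≡ substTs μ' (map var xs) → x ∈ xs → μ x ≡ μ' x
substTs-vars-injective μ μ' (y ∷ xs) x e (here refl) = proj₁ (∷-injective e)
substTs-vars-injective μ μ' (y ∷ xs) x e (there m) = substTs-vars-injective μ μ' xs x (proj₂ (∷-injective e)) m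

nth-substTs : ∀ μ ts i {t₀} → nth ts i ≡ just t₀ → nth (substTs μ ts) i ≡ just (substT μ t₀)
nth-substTs μ (t ∷ ts) zero refl = refl
nth-substTs μ (t ∷ ts) (suc i) e = nth-substTs μ ts i e

idx-nth : ∀ v x i → idx v x ≡ just i → nth v i ≡ just x
idx-nth (y ∷ v) x i e with x ≟ℕ y
idx-nth (y ∷ v) x .zero refl | yes refl = refl
idx-nth (y ∷ v) x i e | no ne with idx v x in eq
idx-nth (y ∷ v) x .(suc j) refl | no ne | just j = idx-nth v x j eq
idx-nth (y ∷ v) x i () | no ne | nothing

idx-nothing : ∀ v x → idx v x ≡ nothing → x ∉ v
idx-nothing (y ∷ v) x e m with x ≟ℕ y
idx-nothing (y ∷ v) x () m | yes _
idx-nothing (y ∷ v) x e m | no ne with idx v x in eq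
idx-nothing (y ∷ v) x () m | no ne | just j
idx-nothing (y ∷ v) x e (here refl) | no ne | nothing = ne refl
idx-nothing (y ∷ v) x e (there m) | no ne | nothing = idx-nothing v x eq m

skArgs : Ord → (Var → Term) → Pos → List Term
skArgs o μ p = substTs μ (map var (o p))

skT : Side → Ord → (Var → Term) → Pos → ℕ → Term
skT s o μ p i = fn (sk s p i) (skArgs o μ p)

σp-view : ∀ s o μ p v x →
  (∃ λ i → idx v x ≡ just i × substT μ (σp s o p v x) ≡ skT s o μ p i) ⊎
  (idx v x ≡ nothing × substT μ (σp s o p v x) ≡ μ x)
σp-view s o μ p v x with idx v x
... | just i = inj₁ (i , refl , refl)
... | nothing = inj₂ (refl , refl)

-- Positions

data Child : QF → Dir → QF → Set where
  ∧-left  : ∀ {A B} → Child (A ∧′ B) one A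
  ∧-right : ∀ {A B} → Child (A ∧′ B) two B
  ∨-left  : ∀ {A B} → Child (A ∨′ B) one A
  ∨-right : ∀ {A B} → Child (A ∨′ B) two B
  ∀-body  : ∀ {v R A} → Child (all′ v R A) one A
  ∃-body  : ∀ {v R A} → Child (ex′ v R A) one A

child-functional : ∀ {X d Y Y'} → Child X d Y → Child X d Y' → Y ≡ Y'
child-functional ∧-left ∧-left = refl
child-functional ∧-right ∧-right = refl
child-functional ∨-left ∨-left = refl
child-functional ∨-right ∨-right = refl
child-functional ∀-body ∀-body = refl
child-functional ∃-body ∃-body = refl

Child-RQFO : ∀ {X d Y} → Child X d Y → RQFO X → RQFO Y
Child-RQFO ∧-left (a , b) = a
Child-RQFO ∧-right (a , b) = b
Child-RQFO ∨-left (a , b) = a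
Child-RQFO ∨-right (a , b) = b
Child-RQFO ∀-body (_ , _ , _ , a) = a
Child-RQFO ∃-body (_ , _ , _ , a) = a

private
  prefix : Dir → Pos × QF → Pos × QF
  prefix d (p , Y) = d ∷ p , Y

posList-child : ∀ {X d X' p Y} → Child X d X' → (p , Y) ∈ posList X' → (d ∷ p , Y) ∈ posList X
posList-child {A ∧′ B} ∧-left m = there (∈-++⁺ˡ (∈-map⁺ (prefix one) m))
posList-child {A ∧′ B} ∧-right m = there (∈-++⁺ʳ (map _ (posList A)) (∈-map⁺ (prefix two) m))
posList-child {A ∨′ B} ∨-left m = there (∈-++⁺ˡ (∈-map⁺ (prefix one) m))
posList-child {A ∨′ B} ∨-right m = there (∈-++⁺ʳ (map _ (posList A)) (∈-map⁺ (prefix two) m))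
posList-child {all′ v R A} ∀-body m = there (∈-map⁺ (prefix one) m)
posList-child {ex′ v R A} ∃-body m = there (∈-map⁺ (prefix one) m)

data PosView (X : QF) : Pos → QF → Set where
  root  : PosView X [] X
  below : ∀ {d X' p Y} → Child X d X' → (p , Y) ∈ posList X' → PosView X (d ∷ p) Y

posList-view : ∀ X {p Y} → (p , Y) ∈ posList X → PosView X p Y
posList-view X (here refl) = root
posList-view tt′ (there ())
posList-view ff′ (there ())
posList-view (A ∧′ B) (there m) = [ below-prefix ∧-left , below-prefix ∧-right ]′ (∈-++⁻ (map _ (posList A)) m)
  where
  below-prefix : ∀ {d X' q Y} → Child (A ∧′ B) d X' → (q , Y) ∈ map (prefix d) (posList X') → PosView (A ∧′ B) q Y
  below-prefix c m with ∈-map⁻ _ m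
  ... | _ , m' , refl = below c m'
posList-view (A ∨′ B) (there m) = [ below-prefix ∨-left , below-prefix ∨-right ]′ (∈-++⁻ (map _ (posList A)) m)
  where
  below-prefix : ∀ {d X' q Y} → Child (A ∨′ B) d X' → (q , Y) ∈ map (prefix d) (posList X') → PosView (A ∨′ B) q Y
  below-prefix c m with ∈-map⁻ _ m
  ... | _ , m' , refl = below c m'
posList-view (all′ v R A) (there m) with ∈-map⁻ _ m
... | _ , m' , refl = below ∀-body m'
posList-view (ex′ v R A) (there m) with ∈-map⁻ _ m
... | _ , m' , refl = below ∃-body m'

posList-functional : ∀ X {p Y Y'} → (p , Y) ∈ posList X → (p , Y') ∈ posList X → Y ≡ Y'
posList-functional X m m' with posList-view X m | posList-view X m'
... | root | root = refl
... | below c n | below c' n' with child-functional c c'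
...   | refl = posList-functional _ n n'

posList-trans : ∀ X {p Y q Z} → (p , Y) ∈ posList X → (q , Z) ∈ posList Y → (p ++ q , Z) ∈ posList X
posList-trans X m m' with posList-view X m
... | root = m'
... | below c n = posList-child c (posList-trans _ n m')

posList-·child : ∀ X {p Y d Y'} → (p , Y) ∈ posList X → Child Y d Y' → (p ++ (d ∷ []) , Y') ∈ posList X
posList-·child X m c = posList-trans X m (posList-child c (here refl))

RQFO-at : ∀ X {p A} → RQFO X → (p , A) ∈ posList X → RQFO A
RQFO-at X r m with posList-view X m
... | root = r
... | below c m' = RQFO-at _ (Child-RQFO c r) m'

negQF-RQFO : ∀ A → RQFO A → RQFO (negQF A)
negQF-RQFO tt′ r = tt
negQF-RQFO ff′ r = tt
negQF-RQFO (A ∧′ B) (a , b) = negQF-RQFO A a , negQF-RQFO B b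
negQF-RQFO (A ∨′ B) (a , b) = negQF-RQFO A a , negQF-RQFO B b
negQF-RQFO (all′ v R A) (i , a , q , r) = i , a , q , negQF-RQFO A r
negQF-RQFO (ex′ v R A) (i , a , q , r) = i , a , q , negQF-RQFO A r

negQF-FreeIn : ∀ A x → FreeIn x (negQF A) → FreeIn x A
negQF-FreeIn (A ∧′ B) x (inj₁ f) = inj₁ (negQF-FreeIn A x f)
negQF-FreeIn (A ∧′ B) x (inj₂ f) = inj₂ (negQF-FreeIn B x f)
negQF-FreeIn (A ∨′ B) x (inj₁ f) = inj₁ (negQF-FreeIn A x f)
negQF-FreeIn (A ∨′ B) x (inj₂ f) = inj₂ (negQF-FreeIn B x f)
negQF-FreeIn (all′ v R A) x (inj₁ r , n) = inj₁ r , n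
negQF-FreeIn (all′ v R A) x (inj₂ f , n) = inj₂ (negQF-FreeIn A x f) , n
negQF-FreeIn (ex′ v R A) x (inj₁ r , n) = inj₁ r , n
negQF-FreeIn (ex′ v R A) x (inj₂ f , n) = inj₂ (negQF-FreeIn A x f) , n

flipPol : Pol → Pol
flipPol plus = minus
flipPol minus = plus

negQF-Quant : ∀ {s R v A} → Quant s R v A → Quant (flipPol s) R v (negQF A)
negQF-Quant qAll = qEx
negQF-Quant qEx = qAll
negQF-Quant (inAll q) = inEx (negQF-Quant q)
negQF-Quant (inEx q) = inAll (negQF-Quant q)
negQF-Quant (inAndL q) = inOrL (negQF-Quant q)
negQF-Quant (inAndR q) = inOrR (negQF-Quant q)
negQF-Quant (inOrL q) = inAndL (negQF-Quant q)
negQF-Quant (inOrR q) = inAndR (negQF-Quant q)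

negQF-PredIn : ∀ {s r} A → PredIn s r A → PredIn (flipPol s) r (negQF A)
negQF-PredIn A (R , v , q , e) = R , v , negQF-Quant q , e

negQF-GArg⁻ : ∀ {t} A → GArg t (negQF A) → GArg t A
negQF-GArg⁻ (A ∧′ B) (inj₁ g) = inj₁ (negQF-GArg⁻ A g)
negQF-GArg⁻ (A ∧′ B) (inj₂ g) = inj₂ (negQF-GArg⁻ B g)
negQF-GArg⁻ (A ∨′ B) (inj₁ g) = inj₁ (negQF-GArg⁻ A g)
negQF-GArg⁻ (A ∨′ B) (inj₂ g) = inj₂ (negQF-GArg⁻ B g)
negQF-GArg⁻ (all′ v R A) (inj₁ g) = inj₁ g
negQF-GArg⁻ (all′ v R A) (inj₂ g) = inj₂ (negQF-GArg⁻ A g)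
negQF-GArg⁻ (ex′ v R A) (inj₁ g) = inj₁ g
negQF-GArg⁻ (ex′ v R A) (inj₂ g) = inj₂ (negQF-GArg⁻ A g)

negQF-GArg⁺ : ∀ {t} A → GArg t A → GArg t (negQF A)
negQF-GArg⁺ (A ∧′ B) (inj₁ g) = inj₁ (negQF-GArg⁺ A g)
negQF-GArg⁺ (A ∧′ B) (inj₂ g) = inj₂ (negQF-GArg⁺ B g)
negQF-GArg⁺ (A ∨′ B) (inj₁ g) = inj₁ (negQF-GArg⁺ A g)
negQF-GArg⁺ (A ∨′ B) (inj₂ g) = inj₂ (negQF-GArg⁺ B g)
negQF-GArg⁺ (all′ v R A) (inj₁ g) = inj₁ g
negQF-GArg⁺ (all′ v R A) (inj₂ g) = inj₂ (negQF-GArg⁺ A g)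
negQF-GArg⁺ (ex′ v R A) (inj₁ g) = inj₁ g
negQF-GArg⁺ (ex′ v R A) (inj₂ g) = inj₂ (negQF-GArg⁺ A g)

Quant-OccIn : ∀ {s R w A x} → Quant s R w A → x ∈ w → OccIn x A
Quant-OccIn qAll i = inj₁ i
Quant-OccIn qEx i = inj₁ i
Quant-OccIn (inAll q) i = inj₂ (inj₂ (Quant-OccIn q i))
Quant-OccIn (inEx q) i = inj₂ (inj₂ (Quant-OccIn q i))
Quant-OccIn (inAndL q) i = inj₁ (Quant-OccIn q i)
Quant-OccIn (inAndR q) i = inj₂ (Quant-OccIn q i)
Quant-OccIn (inOrL q) i = inj₁ (Quant-OccIn q i)
Quant-OccIn (inOrR q) i = inj₂ (Quant-OccIn q i)

Quant-∧⁻ : ∀ {s R v A B} → Quant s R v (A ∧′ B) → Quant s R v A ⊎ Quant s R v B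
Quant-∧⁻ (inAndL q) = inj₁ q
Quant-∧⁻ (inAndR q) = inj₂ q

Quant-∨⁻ : ∀ {s R v A B} → Quant s R v (A ∨′ B) → Quant s R v A ⊎ Quant s R v B
Quant-∨⁻ (inOrL q) = inj₁ q
Quant-∨⁻ (inOrR q) = inj₂ q

-- RQFOT without the conditions on quantified variables, which DEF need not satisfy.
TermArgs : QF → Set
TermArgs tt′ = ⊤
TermArgs ff′ = ⊤
TermArgs (A ∧′ B) = TermArgs A × TermArgs B
TermArgs (A ∨′ B) = TermArgs A × TermArgs B
TermArgs (all′ v R A) = All TArg (args R) × TermArgs A
TermArgs (ex′ v R A) = All TArg (args R) × TermArgs A

RQFOT⇒TermArgs : ∀ A → RQFOT A → TermArgs A
RQFOT⇒TermArgs tt′ h = tt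
RQFOT⇒TermArgs ff′ h = tt
RQFOT⇒TermArgs (A ∧′ B) (a , b) = RQFOT⇒TermArgs A a , RQFOT⇒TermArgs B b
RQFOT⇒TermArgs (A ∨′ B) (a , b) = RQFOT⇒TermArgs A a , RQFOT⇒TermArgs B b
RQFOT⇒TermArgs (all′ v R A) (a , _ , b) = a , RQFOT⇒TermArgs A b
RQFOT⇒TermArgs (ex′ v R A) (a , _ , b) = a , RQFOT⇒TermArgs A b

negQF-TermArgs : ∀ A → TermArgs A → TermArgs (negQF A)
negQF-TermArgs tt′ h = tt
negQF-TermArgs ff′ h = tt
negQF-TermArgs (A ∧′ B) (a , b) = negQF-TermArgs A a , negQF-TermArgs B b
negQF-TermArgs (A ∨′ B) (a , b) = negQF-TermArgs A a , negQF-TermArgs B b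
negQF-TermArgs (all′ v R A) (a , b) = a , negQF-TermArgs A b
negQF-TermArgs (ex′ v R A) (a , b) = a , negQF-TermArgs A b

module _ {P : QF → Set} where
  bigOr-Any : ¬ P ff′ → (∀ {A B} → P (A ∨′ B) → P A ⊎ P B) → ∀ Hs → P (bigOr Hs) → Any P Hs
  bigOr-Any e split [] p = ⊥-elim (e p)
  bigOr-Any e split (H ∷ []) p = here p
  bigOr-Any e split (H ∷ H' ∷ Hs) p = [ here , (λ q → there (bigOr-Any e split (H' ∷ Hs) q)) ]′ (split p)

  bigAnd-Any : ¬ P tt′ → (∀ {A B} → P (A ∧′ B) → P A ⊎ P B) → ∀ Hs → P (bigAnd Hs) → Any P Hs
  bigAnd-Any e split [] p = ⊥-elim (e p)
  bigAnd-Any e split (H ∷ []) p = here p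
  bigAnd-Any e split (H ∷ H' ∷ Hs) p = [ here , (λ q → there (bigAnd-Any e split (H' ∷ Hs) q)) ]′ (split p)

  bigOr-All : P ff′ → (∀ {A B} → P A → P B → P (A ∨′ B)) → ∀ {Hs} → All P Hs → P (bigOr Hs)
  bigOr-All e join [] = e
  bigOr-All e join (p ∷ []) = p
  bigOr-All e join (p ∷ ps@(_ ∷ _)) = join p (bigOr-All e join ps)

  bigAnd-All : P tt′ → (∀ {A B} → P A → P B → P (A ∧′ B)) → ∀ {Hs} → All P Hs → P (bigAnd Hs)
  bigAnd-All e join [] = e
  bigAnd-All e join (p ∷ []) = p
  bigAnd-All e join (p ∷ ps@(_ ∷ _)) = join p (bigAnd-All e join ps)

  bigOr-∈ : (∀ {A B} → P A → P (A ∨′ B)) → (∀ {A B} → P B → P (A ∨′ B)) →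
    ∀ {H} Hs → H ∈ Hs → P H → P (bigOr Hs)
  bigOr-∈ l r (H ∷ []) (here refl) p = p
  bigOr-∈ l r (H ∷ H' ∷ Hs) (here refl) p = l p
  bigOr-∈ l r (H ∷ H' ∷ Hs) (there m) p = r (bigOr-∈ l r (H' ∷ Hs) m p)

  bigAnd-∈⁺ : (∀ {A B} → P A → P (A ∧′ B)) → (∀ {A B} → P B → P (A ∧′ B)) →
    ∀ {H} Hs → H ∈ Hs → P H → P (bigAnd Hs)
  bigAnd-∈⁺ l r (H ∷ []) (here refl) p = p
  bigAnd-∈⁺ l r (H ∷ H' ∷ Hs) (here refl) p = l p
  bigAnd-∈⁺ l r (H ∷ H' ∷ Hs) (there m) p = r (bigAnd-∈⁺ l r (H' ∷ Hs) m p)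

  bigAnd-∈⁻ : (∀ {A B} → P (A ∧′ B) → P A) → (∀ {A B} → P (A ∧′ B) → P B) →
    ∀ {H} Hs → P (bigAnd Hs) → H ∈ Hs → P H
  bigAnd-∈⁻ l r (H ∷ []) p (here refl) = p
  bigAnd-∈⁻ l r (H ∷ H' ∷ Hs) p (here refl) = l p
  bigAnd-∈⁻ l r (H ∷ H' ∷ Hs) p (there m) = bigAnd-∈⁻ l r (H' ∷ Hs) (r p) m

-- Definitional clausification

data ClauseShape (s : Side) (o : Ord) (X : QF) : Form → Clause → Set where
  shape-root : ClauseShape s o X f1 (pos (Dat s o []) ∷ [])
  shape-⊥ : ∀ {p} → (p , ff′) ∈ posList X → ClauseShape s o X f2 (neg (Dat s o p) ∷ [])
  shape-∧₁ : ∀ {p A B} → (p , A ∧′ B) ∈ posList X →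
    ClauseShape s o X f3 (neg (Dat s o p) ∷ pos (Dat s o (p ·1)) ∷ [])
  shape-∧₂ : ∀ {p A B} → (p , A ∧′ B) ∈ posList X →
    ClauseShape s o X f4 (neg (Dat s o p) ∷ pos (Dat s o (p ·2)) ∷ [])
  shape-∨ : ∀ {p A B} → (p , A ∨′ B) ∈ posList X →
    ClauseShape s o X f5 (neg (Dat s o p) ∷ pos (Dat s o (p ·1)) ∷ pos (Dat s o (p ·2)) ∷ [])
  shape-∀ : ∀ {p v R A} → (p , all′ v R A) ∈ posList X →
    ClauseShape s o X f6 (neg (Dat s o p) ∷ neg R ∷ pos (Dat s o (p ·1)) ∷ [])
  shape-∃R : ∀ {p v R A} → (p , ex′ v R A) ∈ posList X →
    ClauseShape s o X f7 (neg (Dat s o p) ∷ pos (substA (σp s o p v) R) ∷ [])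
  shape-∃D : ∀ {p v R A} → (p , ex′ v R A) ∈ posList X →
    ClauseShape s o X f8 (neg (Dat s o p) ∷ pos (substA (σp s o p v) (Dat s o (p ·1))) ∷ [])

clauseShape : ∀ s o X {f c} → (f , c) ∈ Clausify s o X → ClauseShape s o X f c
clauseShape s o X (here refl) = shape-root
clauseShape s o X (there m) = fromAny (posList X) (λ m → m) (∈-concatMap⁻ _ {xs = posList X} m)
  where
  at : ∀ p A {f c} → (p , A) ∈ posList X → (f , c) ∈ clausesAt s o p A → ClauseShape s o X f c
  at p ff′ m (here refl) = shape-⊥ m
  at p (A ∧′ B) m (here refl) = shape-∧₁ m
  at p (A ∧′ B) m (there (here refl)) = shape-∧₂ m
  at p (A ∨′ B) m (here refl) = shape-∨ m
  at p (all′ v R A) m (here refl) = shape-∀ m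
  at p (ex′ v R A) m (here refl) = shape-∃R m
  at p (ex′ v R A) m (there (here refl)) = shape-∃D m
  fromAny : ∀ L {f c} → (∀ {pg} → pg ∈ L → pg ∈ posList X) →
    Any (λ pg → (f , c) ∈ clausesAt s o (proj₁ pg) (proj₂ pg)) L → ClauseShape s o X f c
  fromAny ((p , A) ∷ L) sub (here m) = at p A (sub (here refl)) m
  fromAny (_ ∷ L) sub (there a) = fromAny L (λ m → sub (there m)) a

defBody : Side → Ord → Pos → QF → QF
defBody s o p tt′ = tt′
defBody s o p ff′ = ff′
defBody s o p (A ∧′ B) = atomQF (Dat s o (p ·1)) ∧′ atomQF (Dat s o (p ·2))
defBody s o p (A ∨′ B) = atomQF (Dat s o (p ·1)) ∨′ atomQF (Dat s o (p ·2))
defBody s o p (all′ v R A) = all′ v R (atomQF (Dat s o (p ·1)))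
defBody s o p (ex′ v R A) = ex′ v R (atomQF (Dat s o (p ·1)))

defAt-defBody : ∀ s o p A → defAt s o p A ≡ all′ (o p) (Dat s o p) (defBody s o p A)
defAt-defBody s o p tt′ = refl
defAt-defBody s o p ff′ = refl
defAt-defBody s o p (A ∧′ B) = refl
defAt-defBody s o p (A ∨′ B) = refl
defAt-defBody s o p (all′ v R A) = refl
defAt-defBody s o p (ex′ v R A) = refl

defList : Side → Ord → QF → List QF
defList s o X = map (λ pg → defAt s o (proj₁ pg) (proj₂ pg)) (posList X)

defAt-∈ : ∀ s o X {p A} → (p , A) ∈ posList X → defAt s o p A ∈ defList s o X
defAt-∈ s o X = ∈-map⁺ _

private
  defAt-in-DEF : ∀ {P : QF → Set} → (∀ {A B} → P A → P (A ∧′ B)) → (∀ {A B} → P B → P (A ∧′ B)) →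
    ∀ s o X {p A} → (p , A) ∈ posList X → P (defAt s o p A) → P (DEF s o X)
  defAt-in-DEF {P} l r s o X m q = r {atomQF (Dat s o [])} (bigAnd-∈⁺ {P} l r (defList s o X) (defAt-∈ s o X m) q)

DEF-Quant-∀ : ∀ s o X {p v R A} → (p , all′ v R A) ∈ posList X → Quant minus R v (DEF s o X)
DEF-Quant-∀ s o X {v = v} {R} m = defAt-in-DEF {Quant minus R v} inAndL inAndR s o X m (inAll qAll)

DEF-Quant-∃ : ∀ s o X {p v R A} → (p , ex′ v R A) ∈ posList X → Quant plus R v (DEF s o X)
DEF-Quant-∃ s o X {v = v} {R} m = defAt-in-DEF {Quant plus R v} inAndL inAndR s o X m (inAll qEx)

DEF-GArg-∀ : ∀ s o X {p v R A t} → (p , all′ v R A) ∈ posList X → GArgAtom t R → GArg t (DEF s o X)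
DEF-GArg-∀ s o X {t = t} m g = defAt-in-DEF {GArg t} inj₁ inj₂ s o X m (inj₂ (inj₁ g))

DEF-GArg-∃ : ∀ s o X {p v R A t} → (p , ex′ v R A) ∈ posList X → GArgAtom t R → GArg t (DEF s o X)
DEF-GArg-∃ s o X {t = t} m g = defAt-in-DEF {GArg t} inj₁ inj₂ s o X m (inj₂ (inj₁ g))

vars-no-GArg : ∀ {t} xs → ¬ (t ∈ map var xs × Ground t)
vars-no-GArg xs (m , g) = ground-∉-vars xs g m

-- Definers only take variables, so the ground arguments of DEF are constants of X.
DEF-GArg⇒Const : ∀ s o X {t} → RQFO X → GArg t (DEF s o X) → Const t
DEF-GArg⇒Const s o X r (inj₁ (inj₁ g)) = ⊥-elim (vars-no-GArg (o []) g)
DEF-GArg⇒Const s o X {t} r (inj₂ g) with find (bigAnd-Any {GArg t} (λ ()) (λ g → g) (defList s o X) g)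
... | D , mD , gD with ∈-map⁻ _ mD
...   | (p , A) , m , refl = atom p A (RQFO-at X r m) gD
  where
  atom : ∀ p A → RQFO A → GArg t (defAt s o p A) → Const t
  atom p (all′ v R A) (_ , ra , _) (inj₂ (inj₁ (m , g))) = RelArg-ground⇒Const ra m g
  atom p (ex′ v R A) (_ , ra , _) (inj₂ (inj₁ (m , g))) = RelArg-ground⇒Const ra m g
  atom p tt′ r (inj₁ g) = ⊥-elim (vars-no-GArg (o p) g)
  atom p ff′ r (inj₁ g) = ⊥-elim (vars-no-GArg (o p) g)
  atom p (A ∧′ B) r (inj₁ g) = ⊥-elim (vars-no-GArg (o p) g)
  atom p (A ∧′ B) r (inj₂ (inj₁ (inj₁ g))) = ⊥-elim (vars-no-GArg (o (p ·1)) g)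
  atom p (A ∧′ B) r (inj₂ (inj₂ (inj₁ g))) = ⊥-elim (vars-no-GArg (o (p ·2)) g)
  atom p (A ∨′ B) r (inj₁ g) = ⊥-elim (vars-no-GArg (o p) g)
  atom p (A ∨′ B) r (inj₂ (inj₁ (inj₁ g))) = ⊥-elim (vars-no-GArg (o (p ·1)) g)
  atom p (A ∨′ B) r (inj₂ (inj₂ (inj₁ g))) = ⊥-elim (vars-no-GArg (o (p ·2)) g)
  atom p (all′ v R A) r (inj₁ g) = ⊥-elim (vars-no-GArg (o p) g)
  atom p (all′ v R A) r (inj₂ (inj₂ (inj₁ g))) = ⊥-elim (vars-no-GArg (o (p ·1)) g)
  atom p (ex′ v R A) r (inj₁ g) = ⊥-elim (vars-no-GArg (o p) g)
  atom p (ex′ v R A) r (inj₂ (inj₂ (inj₁ g))) = ⊥-elim (vars-no-GArg (o (p ·1)) g)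

DEF-TermArgs : ∀ s o X → RQFO X → TermArgs (DEF s o X)
DEF-TermArgs s o X r =
  (vars-TArg (o []) , tt) , bigAnd-All tt _,_ (All.tabulate λ m → atom (∈-map⁻ _ m))
  where
  atom : ∀ {D} → ∃ (λ pg → pg ∈ posList X × D ≡ defAt s o (proj₁ pg) (proj₂ pg)) → TermArgs D
  atom ((p , A) , m , refl) = body A (RQFO-at X r m)
    where
    body : ∀ A → RQFO A → TermArgs (defAt s o p A)
    body tt′ _ = vars-TArg (o p) , tt
    body ff′ _ = vars-TArg (o p) , tt
    body (A ∧′ B) _ = vars-TArg (o p) , (vars-TArg (o (p ·1)) , tt) , (vars-TArg (o (p ·2)) , tt)
    body (A ∨′ B) _ = vars-TArg (o p) , (vars-TArg (o (p ·1)) , tt) , (vars-TArg (o (p ·2)) , tt)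
    body (all′ v R A) (_ , ra , _) = vars-TArg (o p) , RelArg⇒TArg ra , vars-TArg (o (p ·1)) , tt
    body (ex′ v R A) (_ , ra , _) = vars-TArg (o p) , RelArg⇒TArg ra , vars-TArg (o (p ·1)) , tt

boundBy : QF → List Var
boundBy (all′ v R A) = v
boundBy (ex′ v R A) = v
boundBy _ = []

Child-FreeIn : ∀ {Y d Y' x} → Child Y d Y' → FreeIn x Y' → x ∉ boundBy Y → FreeIn x Y
Child-FreeIn ∧-left f _ = inj₁ f
Child-FreeIn ∧-right f _ = inj₂ f
Child-FreeIn ∨-left f _ = inj₁ f
Child-FreeIn ∨-right f _ = inj₂ f
Child-FreeIn ∀-body f n = inj₂ f , n
Child-FreeIn ∃-body f n = inj₂ f , n

QuantAt : QF → Pos → List Var → Atom → QF → Set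
QuantAt X p v R A = (p , all′ v R A) ∈ posList X ⊎ (p , ex′ v R A) ∈ posList X

ord-root-empty : ∀ X o → OrdOK X o → Sentence X → o [] ≡ []
ord-root-empty X o ok sen = empty (o []) (λ x m → sen x (to (proj₂ (ok [] X (here refl)) x) m))
  where
  empty : (xs : List Var) → (∀ x → x ∉ xs) → xs ≡ []
  empty [] f = refl
  empty (x ∷ xs) f = ⊥-elim (f x (here refl))

module OrderFacts (o : Ord) (X : QF) (rq : RQFO X) (ok : OrdOK X o) where

  ord⇒FreeIn : ∀ {p A x} → (p , A) ∈ posList X → x ∈ o p → FreeIn x A
  ord⇒FreeIn {p} {A} {x} m = to (proj₂ (ok p A m) x)

  FreeIn⇒ord : ∀ {p A x} → (p , A) ∈ posList X → FreeIn x A → x ∈ o p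
  FreeIn⇒ord {p} {A} {x} m = from (proj₂ (ok p A m) x)

  ord-child⊆ : ∀ {p Y d Y' x} → (p , Y) ∈ posList X → Child Y d Y' →
    x ∈ o (p ++ (d ∷ [])) → x ∉ boundBy Y → x ∈ o p
  ord-child⊆ m c i n = FreeIn⇒ord m (Child-FreeIn c (ord⇒FreeIn (posList-·child X m c) i) n)

  quantAtom-var⇒ord : ∀ {p v R A x} → QuantAt X p v R A → var x ∈ args R → x ∉ v → x ∈ o p
  quantAtom-var⇒ord (inj₁ m) i n = FreeIn⇒ord m (inj₁ (var-∈⇒∈ᵥ i) , n)
  quantAtom-var⇒ord (inj₂ m) i n = FreeIn⇒ord m (inj₁ (var-∈⇒∈ᵥ i) , n)

  quantBody-ord⇒ord : ∀ {p v R A x} → QuantAt X p v R A → x ∈ o (p ·1) → x ∉ v → x ∈ o p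
  quantBody-ord⇒ord (inj₁ m) = ord-child⊆ m ∀-body
  quantBody-ord⇒ord (inj₂ m) = ord-child⊆ m ∃-body

  quantAtom-RQFO : ∀ {p v R A} → QuantAt X p v R A → All RelArg (args R) × QuantOK v R
  quantAtom-RQFO (inj₁ m) with RQFO-at X rq m
  ... | _ , a , q , _ = a , q
  quantAtom-RQFO (inj₂ m) with RQFO-at X rq m
  ... | _ , a , q , _ = a , q

module Blocks (M : Structure) where
  open Structure M
  open Sem M using (update; AllV; ExV)

  Env : Set
  Env = Var → D

  update-same : ∀ ρ x d → update ρ x d x ≡ d
  update-same ρ x d with x ≟ℕ x
  ... | yes _ = refl
  ... | no ne = ⊥-elim (ne refl)

  update-other : ∀ ρ x d y → ¬ y ≡ x → update ρ x d y ≡ ρ y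
  update-other ρ x d y ne with y ≟ℕ x
  ... | yes e = ⊥-elim (ne e)
  ... | no _ = refl

  updates : Env → List Var → Env → Env
  updates ρ [] g = ρ
  updates ρ (x ∷ xs) g = updates (update ρ x (g x)) xs g

  updates-∉ : ∀ ρ xs g y → y ∉ xs → updates ρ xs g y ≡ ρ y
  updates-∉ ρ [] g y n = refl
  updates-∉ ρ (x ∷ xs) g y n =
    trans (updates-∉ (update ρ x (g x)) xs g y (λ m → n (there m)))
          (update-other ρ x (g x) y (λ e → n (here e)))

  updates-∈ : ∀ ρ xs g y → y ∈ xs → updates ρ xs g y ≡ g y
  updates-∈ ρ (x ∷ xs) g y m with any? (y ≟ℕ_) xs
  ... | yes m' = updates-∈ (update ρ x (g x)) xs g y m'
  ... | no n' with m
  ...   | here refl = trans (updates-∉ (update ρ x (g x)) xs g y n') (update-same ρ x (g x))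
  ...   | there m'' = ⊥-elim (n' m'')

  EqualOff : List Var → Env → Env → Set
  EqualOff xs ρ ρ' = ∀ y → y ∉ xs → ρ' y ≡ ρ y

  private
    equalOff-∷ : ∀ {x xs ρ ρ'} d → EqualOff xs (update ρ x d) ρ' → EqualOff (x ∷ xs) ρ ρ'
    equalOff-∷ {x} {ρ = ρ} d o y n = trans (o y (λ m → n (there m))) (update-other ρ x d y (λ e → n (here e)))

  AllV-inst : ∀ xs ρ {P} g → AllV xs ρ P → P (updates ρ xs g)
  AllV-inst [] ρ g a = a
  AllV-inst (x ∷ xs) ρ g a = AllV-inst xs (update ρ x (g x)) g (a (g x))

  AllV-intro : ∀ xs ρ {P} → (∀ ρ' → EqualOff xs ρ ρ' → P ρ') → AllV xs ρ P
  AllV-intro [] ρ f = f ρ (λ y _ → refl)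
  AllV-intro (x ∷ xs) ρ f d = AllV-intro xs (update ρ x d) λ ρ' o → f ρ' (equalOff-∷ d o)

  ExV-intro : ∀ xs ρ {P} g → P (updates ρ xs g) → ExV xs ρ P
  ExV-intro [] ρ g a = a
  ExV-intro (x ∷ xs) ρ g a = g x , ExV-intro xs (update ρ x (g x)) g a

  ExV-elim : ∀ xs ρ {P} → ExV xs ρ P → ∃ λ ρ' → P ρ' × EqualOff xs ρ ρ'
  ExV-elim [] ρ a = ρ , a , (λ y _ → refl)
  ExV-elim (x ∷ xs) ρ (d , a) with ExV-elim xs (update ρ x d) a
  ... | ρ' , p , o = ρ' , p , equalOff-∷ d o

  AllV-map : ∀ xs ρ {P Q : Env → Set} → (∀ ρ' → EqualOff xs ρ ρ' → P ρ' → Q ρ') → AllV xs ρ P → AllV xs ρ Q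
  AllV-map [] ρ f a = f ρ (λ y _ → refl) a
  AllV-map (x ∷ xs) ρ f a d = AllV-map xs (update ρ x d) (λ ρ' o → f ρ' (equalOff-∷ d o)) (a d)

  ExV-map : ∀ xs ρ {P Q : Env → Set} → (∀ ρ' → EqualOff xs ρ ρ' → P ρ' → Q ρ') → ExV xs ρ P → ExV xs ρ Q
  ExV-map [] ρ f a = f ρ (λ y _ → refl) a
  ExV-map (x ∷ xs) ρ f (d , a) = d , ExV-map xs (update ρ x d) (λ ρ' o → f ρ' (equalOff-∷ d o)) a

  ¬ExV⇒AllV¬ : ∀ xs ρ {P : Env → Set} → ¬ ExV xs ρ P → AllV xs ρ (λ ρ' → ¬ P ρ')
  ¬ExV⇒AllV¬ [] ρ n = n
  ¬ExV⇒AllV¬ (x ∷ xs) ρ n d = ¬ExV⇒AllV¬ xs (update ρ x d) (λ e → n (d , e))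

  module _ (em : ExcludedMiddle 0ℓ) where
    ¬¬-elim : ∀ {A : Set} → ¬ ¬ A → A
    ¬¬-elim {A} nna with em {A}
    ... | yes a = a
    ... | no na = ⊥-elim (nna na)

    ¬AllV⇒ExV¬ : ∀ xs ρ {P : Env → Set} → ¬ AllV xs ρ P → ExV xs ρ (λ ρ' → ¬ P ρ')
    ¬AllV⇒ExV¬ [] ρ n = n
    ¬AllV⇒ExV¬ (x ∷ xs) ρ {P} n with em {∃ λ d → ¬ AllV xs (update ρ x d) P}
    ... | yes (d , nd) = d , ¬AllV⇒ExV¬ xs (update ρ x d) nd
    ... | no nn = ⊥-elim (n (λ d → ¬¬-elim (λ na → nn (d , na))))

-- Semantics with a valuation of ground terms

-- A non-variable argument is interpreted by val as a whole.  This agrees with Tarski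
-- semantics for ground arguments (see Standard below), and it lets us change the value of
-- individual ground terms, such as Skolem terms, without touching the structure.
module Valued (M : Structure) (val : Term → Structure.D M) where
  open Structure M
  open Sem M using (update; AllV; ExV)
  open Blocks M

  evalᵗ : Env → Term → D
  evalᵗ ρ (var x) = ρ x
  evalᵗ ρ (fn f ts) = val (fn f ts)

  holdsᵃ : Env → Atom → Set
  holdsᵃ ρ (r , ts) = rel r (map (evalᵗ ρ) ts)

  holdsˡ : Env → Lit → Set
  holdsˡ ρ (pos a) = holdsᵃ ρ a
  holdsˡ ρ (neg a) = ¬ holdsᵃ ρ a

  ⟦_⟧ : QF → Env → Set
  ⟦ tt′ ⟧ ρ = ⊤
  ⟦ ff′ ⟧ ρ = ⊥
  ⟦ A ∧′ B ⟧ ρ = ⟦ A ⟧ ρ × ⟦ B ⟧ ρ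
  ⟦ A ∨′ B ⟧ ρ = ⟦ A ⟧ ρ ⊎ ⟦ B ⟧ ρ
  ⟦ all′ v R A ⟧ ρ = AllV v ρ (λ ρ' → ¬ holdsᵃ ρ' R ⊎ ⟦ A ⟧ ρ')
  ⟦ ex′ v R A ⟧ ρ = ExV v ρ (λ ρ' → holdsᵃ ρ' R × ⟦ A ⟧ ρ')

  evalᵗ-ground : ∀ ρ t → Ground t → evalᵗ ρ t ≡ val t
  evalᵗ-ground ρ (fn f ts) _ = refl

  holdsᵃ-resp : ∀ {ρ ρ'} R R' → map (evalᵗ ρ) (args R) ≡ map (evalᵗ ρ') (args R') → proj₁ R ≡ proj₁ R' →
    holdsᵃ ρ R ⇔ holdsᵃ ρ' R'
  holdsᵃ-resp (r , ts) (.r , ts') e refl = mk⇔ (subst (rel r) e) (subst (rel r) (sym e))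

  holdsˡ-ground : ∀ ρ ρ' l → GroundLit l → holdsˡ ρ l → holdsˡ ρ' l
  holdsˡ-ground ρ ρ' (pos R) g = to (holdsᵃ-resp R R (args-ground (args R) g) refl)
    where
    args-ground : ∀ ts → All Ground ts → map (evalᵗ ρ) ts ≡ map (evalᵗ ρ') ts
    args-ground [] g = refl
    args-ground (fn f us ∷ ts) (_ ∷ g) = cong (_ ∷_) (args-ground ts g)
  holdsˡ-ground ρ ρ' (neg R) g n h = n (holdsˡ-ground ρ' ρ (pos R) g h)

  holdsᵃ-subst : ∀ ρ ρ₀ μ R → All RelArg (args R) → (∀ x → var x ∈ args R → ρ x ≡ val (μ x) × Ground (μ x)) →
    holdsᵃ ρ R ⇔ holdsᵃ ρ₀ (substA μ R)
  holdsᵃ-subst ρ ρ₀ μ R ra h = holdsᵃ-resp R (substA μ R) (subst-args (proj₂ R) ra h) refl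
    where
    subst-args : ∀ ts → All RelArg ts → (∀ x → var x ∈ ts → ρ x ≡ val (μ x) × Ground (μ x)) →
      map (evalᵗ ρ) ts ≡ map (evalᵗ ρ₀) (substTs μ ts)
    subst-args [] [] h = refl
    subst-args (.(var x) ∷ ts) (inj₁ (x , refl) ∷ rs) h =
      cong₂ _∷_ (trans (proj₁ (h x (here refl))) (sym (evalᵗ-ground ρ₀ (μ x) (proj₂ (h x (here refl))))))
                (subst-args ts rs (λ y m → h y (there m)))
    subst-args (.(fn (origF c) []) ∷ ts) (inj₂ (c , refl) ∷ rs) h = cong (_ ∷_) (subst-args ts rs (λ y m → h y (there m)))

  holdsᵃ-Dat-subst : ∀ ρ ρ₀ μ s o p → (∀ x → x ∈ o p → ρ x ≡ val (μ x) × Ground (μ x)) →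
    holdsᵃ ρ (Dat s o p) ⇔ holdsᵃ ρ₀ (substA μ (Dat s o p))
  holdsᵃ-Dat-subst ρ ρ₀ μ s o p h =
    holdsᵃ-subst ρ ρ₀ μ (Dat s o p) (vars-RelArg (o p)) (λ x m → h x (var-∈-vars m))

  DEF-root : ∀ s o X ρ → ⟦ DEF s o X ⟧ ρ → holdsᵃ ρ (Dat s o [])
  DEF-root s o X ρ ((a , _) , _) = a

  DEF-defAt : ∀ s o X ρ → ⟦ DEF s o X ⟧ ρ → ∀ {p A} → (p , A) ∈ posList X → ⟦ defAt s o p A ⟧ ρ
  DEF-defAt s o X ρ (_ , h) m = bigAnd-∈⁻ {λ A → ⟦ A ⟧ ρ} proj₁ proj₂ (defList s o X) h (defAt-∈ s o X m)

  bigOr-sem⁻ : ∀ Hs ρ → ⟦ bigOr Hs ⟧ ρ → Any (λ H → ⟦ H ⟧ ρ) Hs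
  bigOr-sem⁻ Hs ρ = bigOr-Any {λ A → ⟦ A ⟧ ρ} (λ ()) (λ x → x) Hs

  bigOr-sem⁺ : ∀ Hs ρ {H} → H ∈ Hs → ⟦ H ⟧ ρ → ⟦ bigOr Hs ⟧ ρ
  bigOr-sem⁺ Hs ρ = bigOr-∈ {λ A → ⟦ A ⟧ ρ} inj₁ inj₂ Hs

  bigAnd-sem⁺ : ∀ Hs ρ → All (λ H → ⟦ H ⟧ ρ) Hs → ⟦ bigAnd Hs ⟧ ρ
  bigAnd-sem⁺ Hs ρ = bigAnd-All {λ A → ⟦ A ⟧ ρ} tt _,_

  bigAnd-sem⁻ : ∀ Hs ρ {H} → ⟦ bigAnd Hs ⟧ ρ → H ∈ Hs → ⟦ H ⟧ ρ
  bigAnd-sem⁻ Hs ρ = bigAnd-∈⁻ {λ A → ⟦ A ⟧ ρ} proj₁ proj₂ Hs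

  ¬⟦⟧⇒⟦negQF⟧ : ExcludedMiddle 0ℓ → ∀ A ρ → ¬ ⟦ A ⟧ ρ → ⟦ negQF A ⟧ ρ
  ¬⟦⟧⇒⟦negQF⟧ em tt′ ρ n = n tt
  ¬⟦⟧⇒⟦negQF⟧ em ff′ ρ n = tt
  ¬⟦⟧⇒⟦negQF⟧ em (A ∧′ B) ρ n with em {⟦ A ⟧ ρ}
  ... | yes a = inj₂ (¬⟦⟧⇒⟦negQF⟧ em B ρ (λ b → n (a , b)))
  ... | no na = inj₁ (¬⟦⟧⇒⟦negQF⟧ em A ρ na)
  ¬⟦⟧⇒⟦negQF⟧ em (A ∨′ B) ρ n =
    ¬⟦⟧⇒⟦negQF⟧ em A ρ (λ a → n (inj₁ a)) , ¬⟦⟧⇒⟦negQF⟧ em B ρ (λ b → n (inj₂ b))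
  ¬⟦⟧⇒⟦negQF⟧ em (all′ v R A) ρ n =
    ExV-map v ρ (λ ρ' _ nn → ¬¬-elim em (λ nr → nn (inj₁ nr)) , ¬⟦⟧⇒⟦negQF⟧ em A ρ' (λ a → nn (inj₂ a)))
      (¬AllV⇒ExV¬ em v ρ n)
  ¬⟦⟧⇒⟦negQF⟧ em (ex′ v R A) ρ n = AllV-map v ρ step (¬ExV⇒AllV¬ v ρ n)
    where
    step : ∀ ρ' → EqualOff v ρ ρ' → ¬ (holdsᵃ ρ' R × ⟦ A ⟧ ρ') → ¬ holdsᵃ ρ' R ⊎ ⟦ negQF A ⟧ ρ'
    step ρ' _ nn with em {holdsᵃ ρ' R}
    ... | yes r = inj₂ (¬⟦⟧⇒⟦negQF⟧ em A ρ' (λ a → nn (r , a)))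
    ... | no nr = inj₁ nr

  args-coincidence : ∀ {ρ ρ'} ts → (∀ x → Any (x ∈ᵥ_) ts → ρ x ≡ ρ' x) → map (evalᵗ ρ) ts ≡ map (evalᵗ ρ') ts
  args-coincidence [] h = refl
  args-coincidence (var x ∷ ts) h = cong₂ _∷_ (h x (here vhere)) (args-coincidence ts (λ y a → h y (there a)))
  args-coincidence (fn f us ∷ ts) h = cong (_ ∷_) (args-coincidence ts (λ y a → h y (there a)))

  QuantFreeAgree : List Var → Atom → QF → Env → Env → Set
  QuantFreeAgree v R A ρ ρ' = ∀ x → (Any (x ∈ᵥ_) (args R) ⊎ FreeIn x A) × x ∉ v → ρ x ≡ ρ' x

  quant-coincidence : ∀ {v} R A {ρ ρ' ρ₁ ρ₂} → QuantFreeAgree v R A ρ ρ' →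
    EqualOff v ρ ρ₁ → EqualOff v ρ' ρ₂ → (∀ x → x ∈ v → ρ₁ x ≡ ρ₂ x) →
    ∀ x → Any (x ∈ᵥ_) (args R) ⊎ FreeIn x A → ρ₁ x ≡ ρ₂ x
  quant-coincidence {v} R A h o₁ o₂ hv x f with any? (x ≟ℕ_) v
  ... | yes i = hv x i
  ... | no n = trans (o₁ x n) (trans (h x (f , n)) (sym (o₂ x n)))

  quantAtom-coincidence : ∀ {v} R A {ρ ρ' ρ₁ ρ₂} → QuantFreeAgree v R A ρ ρ' →
    EqualOff v ρ ρ₁ → EqualOff v ρ' ρ₂ → (∀ x → x ∈ v → ρ₁ x ≡ ρ₂ x) → holdsᵃ ρ₁ R ⇔ holdsᵃ ρ₂ R
  quantAtom-coincidence R A h o₁ o₂ hv =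
    holdsᵃ-resp R R (args-coincidence (args R) (λ x i → quant-coincidence R A h o₁ o₂ hv x (inj₁ i))) refl

  ⟦⟧-coincidence : ∀ A ρ ρ' → (∀ x → FreeIn x A → ρ x ≡ ρ' x) → ⟦ A ⟧ ρ → ⟦ A ⟧ ρ'
  ⟦⟧-coincidence tt′ ρ ρ' h x = tt
  ⟦⟧-coincidence (A ∧′ B) ρ ρ' h (a , b) =
    ⟦⟧-coincidence A ρ ρ' (λ x f → h x (inj₁ f)) a , ⟦⟧-coincidence B ρ ρ' (λ x f → h x (inj₂ f)) b
  ⟦⟧-coincidence (A ∨′ B) ρ ρ' h (inj₁ a) = inj₁ (⟦⟧-coincidence A ρ ρ' (λ x f → h x (inj₁ f)) a)
  ⟦⟧-coincidence (A ∨′ B) ρ ρ' h (inj₂ b) = inj₂ (⟦⟧-coincidence B ρ ρ' (λ x f → h x (inj₂ f)) b)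
  ⟦⟧-coincidence (all′ v R A) ρ ρ' h a = AllV-intro v ρ' λ ρ₂ o₂ →
    step (updates ρ v ρ₂) ρ₂ (updates-∉ ρ v ρ₂) o₂ (updates-∈ ρ v ρ₂) (AllV-inst v ρ ρ₂ a)
    where
    step : ∀ ρ₁ ρ₂ → EqualOff v ρ ρ₁ → EqualOff v ρ' ρ₂ → (∀ x → x ∈ v → ρ₁ x ≡ ρ₂ x) →
      ¬ holdsᵃ ρ₁ R ⊎ ⟦ A ⟧ ρ₁ → ¬ holdsᵃ ρ₂ R ⊎ ⟦ A ⟧ ρ₂
    step ρ₁ ρ₂ o₁ o₂ hv (inj₁ nr) = inj₁ (λ z → nr (from (quantAtom-coincidence R A h o₁ o₂ hv) z))
    step ρ₁ ρ₂ o₁ o₂ hv (inj₂ b) = inj₂ (⟦⟧-coincidence A ρ₁ ρ₂ (λ x f → quant-coincidence R A h o₁ o₂ hv x (inj₂ f)) b)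
  ⟦⟧-coincidence (ex′ v R A) ρ ρ' h a with ExV-elim v ρ a
  ... | ρ₁ , (r , b) , o₁ = ExV-intro v ρ' ρ₁
    (to (quantAtom-coincidence R A h o₁ o₂ hv) r ,
     ⟦⟧-coincidence A ρ₁ ρ₂ (λ x f → quant-coincidence R A h o₁ o₂ hv x (inj₂ f)) b)
    where
    ρ₂ : Env
    ρ₂ = updates ρ' v ρ₁
    o₂ : EqualOff v ρ' ρ₂
    o₂ = updates-∉ ρ' v ρ₁
    hv : ∀ x → x ∈ v → ρ₁ x ≡ ρ₂ x
    hv x i = sym (updates-∈ ρ' v ρ₁ x i)

  sentence-⟦⟧ : ∀ A ρ ρ' → Sentence A → ⟦ A ⟧ ρ → ⟦ A ⟧ ρ'
  sentence-⟦⟧ A ρ ρ' s = ⟦⟧-coincidence A ρ ρ' (λ x f → ⊥-elim (s x f))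

module Agreement (M : Structure) (val val' : Term → Structure.D M) where
  open Structure M
  open Blocks M
  module V = Valued M val
  module V' = Valued M val'

  holdsᵃ-agree : ∀ ρ R → All TArg (args R) → (∀ t → GArgAtom t R → val t ≡ val' t) →
    V.holdsᵃ ρ R ⇔ V'.holdsᵃ ρ R
  holdsᵃ-agree ρ (r , ts) a h = mk⇔ (subst (rel r) (args-agree ts a λ t m g → h t (m , g)))
                                   (subst (rel r) (sym (args-agree ts a λ t m g → h t (m , g))))
    where
    args-agree : ∀ ts → All TArg ts → (∀ t → t ∈ ts → Ground t → val t ≡ val' t) →
      map (V.evalᵗ ρ) ts ≡ map (V'.evalᵗ ρ) ts
    args-agree [] _ h = refl
    args-agree (var x ∷ ts) (_ ∷ a) h = cong (_ ∷_) (args-agree ts a (λ t m g → h t (there m) g))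
    args-agree (fn f us ∷ ts) (inj₁ (x , ()) ∷ a) h
    args-agree (fn f us ∷ ts) (inj₂ g ∷ a) h =
      cong₂ _∷_ (h _ (here refl) g) (args-agree ts a (λ t m g → h t (there m) g))

  holdsˡ-agree : ∀ ρ l → GroundLit l → (∀ t → GArgAtom t (atomOf l) → val t ≡ val' t) →
    V.holdsˡ ρ l → V'.holdsˡ ρ l
  holdsˡ-agree ρ (pos a) g h = to (holdsᵃ-agree ρ a (Ground⇒TArg g) h)
  holdsˡ-agree ρ (neg a) g h x y = x (from (holdsᵃ-agree ρ a (Ground⇒TArg g) h) y)

  ⟦⟧-agree : ∀ A ρ → TermArgs A → (∀ t → GArg t A → val t ≡ val' t) → V.⟦ A ⟧ ρ → V'.⟦ A ⟧ ρ
  ⟦⟧-agree tt′ ρ _ h x = tt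
  ⟦⟧-agree (A ∧′ B) ρ (ta , tb) h (a , b) =
    ⟦⟧-agree A ρ ta (λ t g → h t (inj₁ g)) a , ⟦⟧-agree B ρ tb (λ t g → h t (inj₂ g)) b
  ⟦⟧-agree (A ∨′ B) ρ (ta , tb) h (inj₁ a) = inj₁ (⟦⟧-agree A ρ ta (λ t g → h t (inj₁ g)) a)
  ⟦⟧-agree (A ∨′ B) ρ (ta , tb) h (inj₂ b) = inj₂ (⟦⟧-agree B ρ tb (λ t g → h t (inj₂ g)) b)
  ⟦⟧-agree (all′ v R A) ρ (tr , ta) h = AllV-map v ρ step
    where
    step : ∀ ρ' → EqualOff v ρ ρ' → ¬ V.holdsᵃ ρ' R ⊎ V.⟦ A ⟧ ρ' → ¬ V'.holdsᵃ ρ' R ⊎ V'.⟦ A ⟧ ρ'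
    step ρ' _ (inj₁ nr) = inj₁ (λ r → nr (from (holdsᵃ-agree ρ' R tr (λ t g → h t (inj₁ g))) r))
    step ρ' _ (inj₂ a) = inj₂ (⟦⟧-agree A ρ' ta (λ t g → h t (inj₂ g)) a)
  ⟦⟧-agree (ex′ v R A) ρ (tr , ta) h = ExV-map v ρ λ ρ' _ (r , a) →
    to (holdsᵃ-agree ρ' R tr (λ t g → h t (inj₁ g))) r , ⟦⟧-agree A ρ' ta (λ t g → h t (inj₂ g)) a

module Standard (M : Structure) where
  open Structure M
  open Sem M using (evalT; evalTs; evalA; evalL)
  open Blocks M

  groundVal : Term → D
  groundVal = evalT (λ _ → inh)

  open Valued M groundVal

  mutual
    evalT-ground : ∀ ρ ρ' t → Ground t → evalT ρ t ≡ evalT ρ' t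
    evalT-ground ρ ρ' (fn f ts) (fnG g) = cong (fun f) (evalTs-ground ρ ρ' ts g)

    evalTs-ground : ∀ ρ ρ' ts → All Ground ts → evalTs ρ ts ≡ evalTs ρ' ts
    evalTs-ground ρ ρ' [] [] = refl
    evalTs-ground ρ ρ' (t ∷ ts) (g ∷ gs) = cong₂ _∷_ (evalT-ground ρ ρ' t g) (evalTs-ground ρ ρ' ts gs)

  evalA⇔holdsᵃ : ∀ ρ R → All TArg (args R) → evalA ρ R ⇔ holdsᵃ ρ R
  evalA⇔holdsᵃ ρ (r , ts) a = mk⇔ (subst (rel r) (evalTs-args ts a)) (subst (rel r) (sym (evalTs-args ts a)))
    where
    evalTs-args : ∀ ts → All TArg ts → evalTs ρ ts ≡ map (evalᵗ ρ) ts
    evalTs-args [] [] = refl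
    evalTs-args (var x ∷ ts) (_ ∷ a) = cong (_ ∷_) (evalTs-args ts a)
    evalTs-args (fn f us ∷ ts) (inj₁ (_ , ()) ∷ a)
    evalTs-args (fn f us ∷ ts) (inj₂ g ∷ a) = cong₂ _∷_ (evalT-ground ρ _ (fn f us) g) (evalTs-args ts a)

  evalL⇒holdsˡ : ∀ ρ l → GroundLit l → evalL ρ l → holdsˡ ρ l
  evalL⇒holdsˡ ρ (pos a) g = to (evalA⇔holdsᵃ ρ a (Ground⇒TArg g))
  evalL⇒holdsˡ ρ (neg a) g n r = n (from (evalA⇔holdsᵃ ρ a (Ground⇒TArg g)) r)

  Sem⇔Valued : ∀ A ρ → TermArgs A → Sem.⟦_⟧ M A ρ ⇔ ⟦ A ⟧ ρ
  Sem⇔Valued tt′ ρ _ = mk⇔ (λ x → x) (λ x → x)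
  Sem⇔Valued ff′ ρ _ = mk⇔ (λ x → x) (λ x → x)
  Sem⇔Valued (A ∧′ B) ρ (ta , tb) = mk⇔
    (Product.map (to (Sem⇔Valued A ρ ta)) (to (Sem⇔Valued B ρ tb)))
    (Product.map (from (Sem⇔Valued A ρ ta)) (from (Sem⇔Valued B ρ tb)))
  Sem⇔Valued (A ∨′ B) ρ (ta , tb) = mk⇔
    (Sum.map (to (Sem⇔Valued A ρ ta)) (to (Sem⇔Valued B ρ tb)))
    (Sum.map (from (Sem⇔Valued A ρ ta)) (from (Sem⇔Valued B ρ tb)))
  Sem⇔Valued (all′ v R A) ρ (tr , ta) = mk⇔
    (AllV-map v ρ λ ρ' _ → Sum.map (λ nr r → nr (from (evalA⇔holdsᵃ ρ' R tr) r)) (to (Sem⇔Valued A ρ' ta)))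
    (AllV-map v ρ λ ρ' _ → Sum.map (λ nr r → nr (to (evalA⇔holdsᵃ ρ' R tr) r)) (from (Sem⇔Valued A ρ' ta)))
  Sem⇔Valued (ex′ v R A) ρ (tr , ta) = mk⇔
    (ExV-map v ρ λ ρ' _ → Product.map (to (evalA⇔holdsᵃ ρ' R tr)) (to (Sem⇔Valued A ρ' ta)))
    (ExV-map v ρ λ ρ' _ → Product.map (from (evalA⇔holdsᵃ ρ' R tr)) (from (Sem⇔Valued A ρ' ta)))

_∈?_ : (x : Var) (v : List Var) → Dec (x ∈ v)
x ∈? v = any? (x ≟ℕ_) v

module Unfold (M : Structure) (val : Term → Structure.D M) (s : Side) (o : Ord) (X : QF)
              (rq : RQFO X) (ok : OrdOK X o) where
  open Structure M
  open Blocks M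
  open Valued M val
  open OrderFacts o X rq ok

  DefinerHolds : (Var → Term) → Pos → Set
  DefinerHolds μ p = holdsᵃ (λ _ → inh) (substA μ (Dat s o p))

  DefinerGround : (Var → Term) → Pos → Set
  DefinerGround μ p = All Ground (args (substA μ (Dat s o p)))

  ground-ord : ∀ μ p → DefinerGround μ p → ∀ x → x ∈ o p → Ground (μ x)
  ground-ord μ p g x m = substTs-ground-var μ (map var (o p)) x g (∈-map⁺ var m)

  envAt : Env → (Var → Term) → Pos → Env
  envAt ρ μ p = updates ρ (o p) (λ x → val (μ x))

  envAt-ord : ∀ ρ μ p x → x ∈ o p → envAt ρ μ p x ≡ val (μ x)
  envAt-ord ρ μ p x m = updates-∈ ρ (o p) (λ x → val (μ x)) x m

  unfold : ∀ ρ μ p A → (p , A) ∈ posList X → ⟦ defAt s o p A ⟧ ρ →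
    DefinerHolds μ p → DefinerGround μ p → ⟦ defBody s o p A ⟧ (envAt ρ μ p)
  unfold ρ μ p A m h d g
    with AllV-inst (o p) ρ (λ x → val (μ x)) (subst (λ Z → ⟦ Z ⟧ ρ) (defAt-defBody s o p A) h)
  ... | inj₂ b = b
  ... | inj₁ nd = ⊥-elim (nd (from (holdsᵃ-Dat-subst (envAt ρ μ p) _ μ s o p
                                      (λ x i → envAt-ord ρ μ p x i , ground-ord μ p g x i)) d))

  definer-at-child : ∀ ρ μ p q → (∀ x → x ∈ o q → x ∈ o p) → DefinerGround μ p →
    holdsᵃ (envAt ρ μ p) (Dat s o q) → DefinerHolds μ q
  definer-at-child ρ μ p q sub g =
    to (holdsᵃ-Dat-subst (envAt ρ μ p) _ μ s o q (λ x i → envAt-ord ρ μ p x (sub x i) , ground-ord μ p g x (sub x i)))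

  unfold-⊥ : ∀ ρ μ p → (p , ff′) ∈ posList X → ⟦ defAt s o p ff′ ⟧ ρ →
    DefinerHolds μ p → DefinerGround μ p → ⊥
  unfold-⊥ ρ μ p = unfold ρ μ p ff′

  unfold-∧ : ∀ ρ μ p A B → (p , A ∧′ B) ∈ posList X → ⟦ defAt s o p (A ∧′ B) ⟧ ρ →
    DefinerHolds μ p → DefinerGround μ p → DefinerHolds μ (p ·1) × DefinerHolds μ (p ·2)
  unfold-∧ ρ μ p A B m h d g with unfold ρ μ p (A ∧′ B) m h d g
  ... | (a₁ , _) , (a₂ , _) =
    definer-at-child ρ μ p (p ·1) (λ x i → ord-child⊆ m ∧-left i λ ()) g a₁ ,
    definer-at-child ρ μ p (p ·2) (λ x i → ord-child⊆ m ∧-right i λ ()) g a₂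

  unfold-∨ : ∀ ρ μ p A B → (p , A ∨′ B) ∈ posList X → ⟦ defAt s o p (A ∨′ B) ⟧ ρ →
    DefinerHolds μ p → DefinerGround μ p → DefinerHolds μ (p ·1) ⊎ DefinerHolds μ (p ·2)
  unfold-∨ ρ μ p A B m h d g with unfold ρ μ p (A ∨′ B) m h d g
  ... | inj₁ (a₁ , _) = inj₁ (definer-at-child ρ μ p (p ·1) (λ x i → ord-child⊆ m ∨-left i λ ()) g a₁)
  ... | inj₂ (a₂ , _) = inj₂ (definer-at-child ρ μ p (p ·2) (λ x i → ord-child⊆ m ∨-right i λ ()) g a₂)

  unfold-∀ : ∀ ρ μ p v R A → (p , all′ v R A) ∈ posList X → ⟦ defAt s o p (all′ v R A) ⟧ ρ →
    DefinerHolds μ p → DefinerGround μ p →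
    holdsᵃ (λ _ → inh) (substA μ R) → All Ground (args (substA μ R)) → DefinerHolds μ (p ·1)
  unfold-∀ ρ μ p v R A m h d g r gr
    with AllV-inst v (envAt ρ μ p) (λ x → val (μ x)) (unfold ρ μ p (all′ v R A) m h d g)
  ... | inj₁ nr = ⊥-elim (nr (from (holdsᵃ-subst ρ₂ _ μ R (proj₁ (quantAtom-RQFO (inj₁ m))) atom-vars) r))
    where
    ρ₂ : Env
    ρ₂ = updates (envAt ρ μ p) v (λ x → val (μ x))
    atom-vars : ∀ x → var x ∈ args R → ρ₂ x ≡ val (μ x) × Ground (μ x)
    atom-vars x i with x ∈? v
    ... | yes iv = updates-∈ _ v _ x iv , substTs-ground-var μ (args R) x gr i
    ... | no nv = trans (updates-∉ _ v _ x nv) (envAt-ord ρ μ p x (quantAtom-var⇒ord (inj₁ m) i nv)) ,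
                  ground-ord μ p g x (quantAtom-var⇒ord (inj₁ m) i nv)
  ... | inj₂ (a , _) = to (holdsᵃ-Dat-subst ρ₂ _ μ s o (p ·1) body-vars) a
    where
    ρ₂ : Env
    ρ₂ = updates (envAt ρ μ p) v (λ x → val (μ x))
    body-vars : ∀ x → x ∈ o (p ·1) → ρ₂ x ≡ val (μ x) × Ground (μ x)
    body-vars x i with x ∈? v
    ... | yes iv = updates-∈ _ v _ x iv ,
                   substTs-ground-var μ (args R) x gr (proj₂ (proj₂ (quantAtom-RQFO (inj₁ m))) x iv)
    ... | no nv = trans (updates-∉ _ v _ x nv) (envAt-ord ρ μ p x (quantBody-ord⇒ord (inj₁ m) i nv)) ,
                  ground-ord μ p g x (quantBody-ord⇒ord (inj₁ m) i nv)

  unfold-∃ : ∀ ρ μ p v R A → (p , ex′ v R A) ∈ posList X → ⟦ defAt s o p (ex′ v R A) ⟧ ρ →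
    DefinerHolds μ p → DefinerGround μ p →
    ∃ λ ρ₂ → holdsᵃ ρ₂ R × holdsᵃ ρ₂ (Dat s o (p ·1)) × (∀ x → x ∉ v → x ∈ o p → ρ₂ x ≡ val (μ x))
  unfold-∃ ρ μ p v R A m h d g with ExV-elim v (envAt ρ μ p) (unfold ρ μ p (ex′ v R A) m h d g)
  ... | ρ₂ , (r , a , _) , off = ρ₂ , r , a , (λ x nv i → trans (off x nv) (envAt-ord ρ μ p x i))

-- Skolem terms as witnesses

-- Sending the Skolem terms f_⟨p,i⟩(x_p μ) to the values ρ₂(x_i) of an existential witness
-- makes the two Skolemised literals R_p σ_p μ and D_p1 σ_p μ true.
module SkolemWitness (M : Structure) (val : Term → Structure.D M) (s : Side) (o : Ord) (X : QF)
          (rq : RQFO X) (ok : OrdOK X o)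
          (μ : Var → Term) (p : Pos) (v : List Var) (R : Atom) (A : QF) (m : (p , ex′ v R A) ∈ posList X)
          (ρ₂ : Var → Structure.D M) (hρ : ∀ x → x ∉ v → x ∈ o p → ρ₂ x ≡ val (μ x))
          (g : All Ground (args (substA μ (Dat s o p)))) where
  open Structure M
  open Unfold M val s o X rq ok using (ground-ord)
  open OrderFacts o X rq ok

  skolemVal : Term → D
  skolemVal (var x) = val (var x)
  skolemVal (fn (origF n) us) = val (fn (origF n) us)
  skolemVal (fn (sk s' p' i) us) with s' ≟ˢ s | p' ≟ᵖ p | us ≟ᵗˢ skArgs o μ p | nth v i
  ... | yes _ | yes _ | yes _ | just x = ρ₂ x
  ... | _ | _ | _ | _ = val (fn (sk s' p' i) us)

  IsFreshSkolem : Term → Set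
  IsFreshSkolem t = Σ ℕ (λ i → t ≡ skT s o μ p i)

  skolemVal-other : ∀ t → ¬ IsFreshSkolem t → skolemVal t ≡ val t
  skolemVal-other (var x) n = refl
  skolemVal-other (fn (origF n₁) us) n = refl
  skolemVal-other (fn (sk s' p' i) us) n with s' ≟ˢ s | p' ≟ᵖ p | us ≟ᵗˢ skArgs o μ p | nth v i
  ... | yes refl | yes refl | yes refl | just x = ⊥-elim (n (i , refl))
  ... | yes _ | yes _ | yes _ | nothing = refl
  ... | yes _ | yes _ | no _ | _ = refl
  ... | yes _ | no _ | _ | _ = refl
  ... | no _ | _ | _ | _ = refl

  skolemVal-sk : ∀ i x → nth v i ≡ just x → skolemVal (skT s o μ p i) ≡ ρ₂ x
  skolemVal-sk i x e with s ≟ˢ s | p ≟ᵖ p | skArgs o μ p ≟ᵗˢ skArgs o μ p | nth v i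
  skolemVal-sk i x refl | yes refl | yes refl | yes refl | just .x = refl
  ... | no ne | _ | _ | _ = ⊥-elim (ne refl)
  ... | yes _ | no ne | _ | _ = ⊥-elim (ne refl)
  ... | yes _ | yes _ | no ne | _ = ⊥-elim (ne refl)
  skolemVal-sk i x () | yes _ | yes _ | yes _ | nothing

  ord-not-sk : ∀ x → x ∈ o p → ¬ IsFreshSkolem (μ x)
  ord-not-sk x i (j , e) = fn-≢-arg (substTs-vars-∈⁺ μ (o p) x i) (sym e)

  module V = Valued M val
  module V' = Valued M skolemVal

  σ-var : ∀ x → (x ∈ v ⊎ x ∈ o p) → V'.evalᵗ (λ _ → inh) (substT μ (σp s o p v x)) ≡ ρ₂ x
  σ-var x h with σp-view s o μ p v x
  ... | inj₁ (i , e , e') rewrite e' = skolemVal-sk i x (idx-nth v x i e)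
  ... | inj₂ (e , e') rewrite e' with h
  ...   | inj₁ iv = ⊥-elim (idx-nothing v x e iv)
  ...   | inj₂ io with ground-fn (ground-ord μ p g x io)
  ...     | f , us , eq rewrite eq =
    trans (skolemVal-other (fn f us) (subst (λ t → ¬ IsFreshSkolem t) eq (ord-not-sk x io)))
          (trans (cong val (sym eq)) (sym (hρ x (idx-nothing v x e) io)))

  σ-args : ∀ ts → All RelArg ts → (∀ x → var x ∈ ts → x ∉ v → x ∈ o p) →
    map (V.evalᵗ ρ₂) ts ≡ map (V'.evalᵗ (λ _ → inh)) (substTs μ (substTs (σp s o p v) ts))
  σ-args [] [] h = refl
  σ-args (.(var x) ∷ ts) (inj₁ (x , refl) ∷ rs) h =
    cong₂ _∷_ (sym (σ-var x (v-or-ord (h x (here refl))))) (σ-args ts rs (λ y i → h y (there i)))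
    where
    v-or-ord : (x ∉ v → x ∈ o p) → x ∈ v ⊎ x ∈ o p
    v-or-ord f with x ∈? v
    ... | yes i = inj₁ i
    ... | no n = inj₂ (f n)
  σ-args (.(fn (origF c) []) ∷ ts) (inj₂ (c , refl) ∷ rs) h = cong (_ ∷_) (σ-args ts rs (λ y i → h y (there i)))

  witness-R : V.holdsᵃ ρ₂ R → V'.holdsᵃ (λ _ → inh) (substA μ (substA (σp s o p v) R))
  witness-R = subst (rel (proj₁ R))
    (σ-args (args R) (proj₁ (quantAtom-RQFO (inj₂ m))) (λ x i → quantAtom-var⇒ord (inj₂ m) i))

  witness-D : V.holdsᵃ ρ₂ (Dat s o (p ·1)) → V'.holdsᵃ (λ _ → inh) (substA μ (substA (σp s o p v) (Dat s o (p ·1))))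
  witness-D = subst (rel (dfn s (p ·1)))
    (σ-args (map var (o (p ·1))) (vars-RelArg (o (p ·1))) (λ x i → quantBody-ord⇒ord (inj₂ m) (var-∈-vars i)))

-- Abstraction ⟨θ⁻¹⟩ of ground terms by variables

Binding : Set
Binding = List (Var × Term)

GroundRange : Binding → Set
GroundRange θ = ∀ t → t ∈ map proj₂ θ → Ground t

FreshFor : Binding → QF → Set
FreshFor θ A = ∀ x → x ∈ map proj₁ θ → ¬ OccIn x A

module Abstraction (F G : QF) (oF oG : Ord) where
  open TableauDefs F G oF oG

  ArgAbs-TArg : ∀ {θ ts ts'} → Pointwise (ArgAbs θ) ts ts' → All TArg ts → All TArg ts'
  ArgAbs-TArg [] [] = []
  ArgAbs-TArg (inj₁ (v , _ , refl) ∷ pw) (_ ∷ a) = inj₁ (v , refl) ∷ ArgAbs-TArg pw a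
  ArgAbs-TArg (inj₂ (_ , refl) ∷ pw) (x ∷ a) = x ∷ ArgAbs-TArg pw a

  ArgAbs-var : ∀ {θ ts ts' x} → GroundRange θ → Pointwise (ArgAbs θ) ts ts' → var x ∈ ts → var x ∈ ts'
  ArgAbs-var gθ pw m with pointwise-∈ˡ pw m
  ... | t' , m' , inj₁ (v , i , _) with gθ _ (∈-proj₂ i)
  ...   | ()
  ArgAbs-var gθ pw m | t' , m' , inj₂ (_ , refl) = m'

  ArgAbs-ground : ∀ {θ ts ts' t} → Pointwise (ArgAbs θ) ts ts' → t ∈ ts' → Ground t → t ∈ ts × t ∉ map proj₂ θ
  ArgAbs-ground pw m g with pointwise-∈ʳ pw m
  ... | t₀ , m₀ , inj₁ (v , _ , refl) with g
  ...   | ()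
  ArgAbs-ground pw m g | t₀ , m₀ , inj₂ (n , refl) = m₀ , n

  ArgAbs-free : ∀ {θ ts ts' x} → Pointwise (ArgAbs θ) ts ts' → Any (x ∈ᵥ_) ts' →
    Any (x ∈ᵥ_) ts ⊎ x ∈ map proj₁ θ
  ArgAbs-free (inj₁ (v , i , refl) ∷ pw) (here vhere) = inj₂ (∈-proj₁ i)
  ArgAbs-free (inj₂ (_ , refl) ∷ pw) (here h) = inj₁ (here h)
  ArgAbs-free (_ ∷ pw) (there a) = Sum.map₁ there (ArgAbs-free pw a)

  -- abstraction only turns arguments into variables not bound in the atom, so it keeps indices in I
  ArgAbs-InIdx : ∀ {θ w ts ts' i} → (∀ x → x ∈ map proj₁ θ → x ∉ w) → Pointwise (ArgAbs θ) ts ts' →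
    InIdx w ts i → InIdx w ts' i
  ArgAbs-InIdx fr pw (t , e , n) with pointwise-nth pw e
  ... | t' , e' , inj₁ (v , i , refl) = var v , e' , (λ m → fr v (∈-proj₁ i) (var-∈-vars m))
  ... | t' , e' , inj₂ (_ , refl) = t' , e' , n

  Abs-Quant⁻ : ∀ {θ A A' s R' w} → Abs θ A A' → Quant s R' w A' →
    ∃ λ R → Quant s R w A × proj₁ R ≡ proj₁ R' × Pointwise (ArgAbs θ) (args R) (args R')
  Abs-Quant⁻ (absAnd a b) (inAndL q) = Product.map₂ (Product.map₁ inAndL) (Abs-Quant⁻ a q)
  Abs-Quant⁻ (absAnd a b) (inAndR q) = Product.map₂ (Product.map₁ inAndR) (Abs-Quant⁻ b q)
  Abs-Quant⁻ (absOr a b) (inOrL q) = Product.map₂ (Product.map₁ inOrL) (Abs-Quant⁻ a q)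
  Abs-Quant⁻ (absOr a b) (inOrR q) = Product.map₂ (Product.map₁ inOrR) (Abs-Quant⁻ b q)
  Abs-Quant⁻ (absAll {r = r} {ts = ts} pw a) qAll = (r , ts) , qAll , refl , pw
  Abs-Quant⁻ (absAll pw a) (inAll q) = Product.map₂ (Product.map₁ inAll) (Abs-Quant⁻ a q)
  Abs-Quant⁻ (absEx {r = r} {ts = ts} pw a) qEx = (r , ts) , qEx , refl , pw
  Abs-Quant⁻ (absEx pw a) (inEx q) = Product.map₂ (Product.map₁ inEx) (Abs-Quant⁻ a q)

  Abs-GArg⁻ : ∀ {θ A A' t} → Abs θ A A' → GArg t A' → GArg t A × t ∉ map proj₂ θ
  Abs-GArg⁻ (absAnd a b) (inj₁ x) = Product.map₁ inj₁ (Abs-GArg⁻ a x)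
  Abs-GArg⁻ (absAnd a b) (inj₂ x) = Product.map₁ inj₂ (Abs-GArg⁻ b x)
  Abs-GArg⁻ (absOr a b) (inj₁ x) = Product.map₁ inj₁ (Abs-GArg⁻ a x)
  Abs-GArg⁻ (absOr a b) (inj₂ x) = Product.map₁ inj₂ (Abs-GArg⁻ b x)
  Abs-GArg⁻ (absAll pw a) (inj₁ (m , g)) with ArgAbs-ground pw m g
  ... | m' , n = inj₁ (m' , g) , n
  Abs-GArg⁻ (absAll pw a) (inj₂ x) = Product.map₁ inj₂ (Abs-GArg⁻ a x)
  Abs-GArg⁻ (absEx pw a) (inj₁ (m , g)) with ArgAbs-ground pw m g
  ... | m' , n = inj₁ (m' , g) , n
  Abs-GArg⁻ (absEx pw a) (inj₂ x) = Product.map₁ inj₂ (Abs-GArg⁻ a x)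

  Abs-RQFOT : ∀ {θ A A'} → GroundRange θ → Abs θ A A' → RQFOT A → RQFOT A'
  Abs-RQFOT gθ absT r = tt
  Abs-RQFOT gθ absF r = tt
  Abs-RQFOT gθ (absAnd a b) (ra , rb) = Abs-RQFOT gθ a ra , Abs-RQFOT gθ b rb
  Abs-RQFOT gθ (absOr a b) (ra , rb) = Abs-RQFOT gθ a ra , Abs-RQFOT gθ b rb
  Abs-RQFOT gθ (absAll pw a) (ta , (u , q) , r) =
    ArgAbs-TArg pw ta , (u , (λ x i → ArgAbs-var gθ pw (q x i))) , Abs-RQFOT gθ a r
  Abs-RQFOT gθ (absEx pw a) (ta , (u , q) , r) =
    ArgAbs-TArg pw ta , (u , (λ x i → ArgAbs-var gθ pw (q x i))) , Abs-RQFOT gθ a r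

  Abs-FreeIn⁻ : ∀ {θ A A' x} → Abs θ A A' → FreeIn x A' → FreeIn x A ⊎ x ∈ map proj₁ θ
  Abs-FreeIn⁻ absT ()
  Abs-FreeIn⁻ absF ()
  Abs-FreeIn⁻ (absAnd a b) (inj₁ f) = Sum.map₁ inj₁ (Abs-FreeIn⁻ a f)
  Abs-FreeIn⁻ (absAnd a b) (inj₂ f) = Sum.map₁ inj₂ (Abs-FreeIn⁻ b f)
  Abs-FreeIn⁻ (absOr a b) (inj₁ f) = Sum.map₁ inj₁ (Abs-FreeIn⁻ a f)
  Abs-FreeIn⁻ (absOr a b) (inj₂ f) = Sum.map₁ inj₂ (Abs-FreeIn⁻ b f)
  Abs-FreeIn⁻ (absAll pw a) (inj₁ r , n) = Sum.map₁ (λ r' → inj₁ r' , n) (ArgAbs-free pw r)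
  Abs-FreeIn⁻ (absAll pw a) (inj₂ f , n) = Sum.map₁ (λ f' → inj₂ f' , n) (Abs-FreeIn⁻ a f)
  Abs-FreeIn⁻ (absEx pw a) (inj₁ r , n) = Sum.map₁ (λ r' → inj₁ r' , n) (ArgAbs-free pw r)
  Abs-FreeIn⁻ (absEx pw a) (inj₂ f , n) = Sum.map₁ (λ f' → inj₂ f' , n) (Abs-FreeIn⁻ a f)

  module _ (M : Structure) (val : Term → Structure.D M) where
    open Blocks M
    open Valued M val

    Interprets : Binding → Env → Set
    Interprets θ ρ = ∀ v t → (v , t) ∈ θ → ρ v ≡ val t

    ArgAbs-holdsᵃ : ∀ {θ r ts ts'} ρ → GroundRange θ → Interprets θ ρ → Pointwise (ArgAbs θ) ts ts' →
      holdsᵃ ρ (r , ts') ⇔ holdsᵃ ρ (r , ts)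
    ArgAbs-holdsᵃ {r = r} {ts} {ts'} ρ gθ iv pw = holdsᵃ-resp (r , ts') (r , ts) (args-abs pw) refl
      where
      args-abs : ∀ {ts ts'} → Pointwise (ArgAbs _) ts ts' → map (evalᵗ ρ) ts' ≡ map (evalᵗ ρ) ts
      args-abs [] = refl
      args-abs {t ∷ _} (inj₁ (v , i , refl) ∷ pw) =
        cong₂ _∷_ (trans (iv v t i) (sym (evalᵗ-ground ρ t (gθ t (∈-proj₂ i))))) (args-abs pw)
      args-abs (inj₂ (_ , refl) ∷ pw) = cong (_ ∷_) (args-abs pw)

    Abs-⟦⟧ : ∀ {θ A A'} ρ → GroundRange θ → FreshFor θ A → Interprets θ ρ → Abs θ A A' → ⟦ A' ⟧ ρ ⇔ ⟦ A ⟧ ρ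
    Abs-⟦⟧ ρ gθ nb iv absT = mk⇔ (λ x → x) (λ x → x)
    Abs-⟦⟧ ρ gθ nb iv absF = mk⇔ (λ x → x) (λ x → x)
    Abs-⟦⟧ ρ gθ nb iv (absAnd a b) =
      let ia = Abs-⟦⟧ ρ gθ (λ x i o → nb x i (inj₁ o)) iv a
          ib = Abs-⟦⟧ ρ gθ (λ x i o → nb x i (inj₂ o)) iv b
      in mk⇔ (Product.map (to ia) (to ib)) (Product.map (from ia) (from ib))
    Abs-⟦⟧ ρ gθ nb iv (absOr a b) =
      let ia = Abs-⟦⟧ ρ gθ (λ x i o → nb x i (inj₁ o)) iv a
          ib = Abs-⟦⟧ ρ gθ (λ x i o → nb x i (inj₂ o)) iv b
      in mk⇔ (Sum.map (to ia) (to ib)) (Sum.map (from ia) (from ib))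
    Abs-⟦⟧ {θ} ρ gθ nb iv (absAll {v = w} {r} {ts} {ts'} {A} {A'} pw a) = mk⇔
      (AllV-map w ρ λ ρ' off → Sum.map (λ nr r → nr (from (atom ρ' off) r)) (to (body ρ' off)))
      (AllV-map w ρ λ ρ' off → Sum.map (λ nr r → nr (to (atom ρ' off) r)) (from (body ρ' off)))
      where
      iv' : ∀ ρ' → EqualOff w ρ ρ' → Interprets θ ρ'
      iv' ρ' off v t i = trans (off v (λ m → nb v (∈-proj₁ i) (inj₁ m))) (iv v t i)
      atom : ∀ ρ' → EqualOff w ρ ρ' → holdsᵃ ρ' (r , ts') ⇔ holdsᵃ ρ' (r , ts)
      atom ρ' off = ArgAbs-holdsᵃ ρ' gθ (iv' ρ' off) pw
      body : ∀ ρ' → EqualOff w ρ ρ' → ⟦ A' ⟧ ρ' ⇔ ⟦ A ⟧ ρ'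
      body ρ' off = Abs-⟦⟧ ρ' gθ (λ x i o → nb x i (inj₂ (inj₂ o))) (iv' ρ' off) a
    Abs-⟦⟧ {θ} ρ gθ nb iv (absEx {v = w} {r} {ts} {ts'} {A} {A'} pw a) = mk⇔
      (ExV-map w ρ λ ρ' off → Product.map (to (atom ρ' off)) (to (body ρ' off)))
      (ExV-map w ρ λ ρ' off → Product.map (from (atom ρ' off)) (from (body ρ' off)))
      where
      iv' : ∀ ρ' → EqualOff w ρ ρ' → Interprets θ ρ'
      iv' ρ' off v t i = trans (off v (λ m → nb v (∈-proj₁ i) (inj₁ m))) (iv v t i)
      atom : ∀ ρ' → EqualOff w ρ ρ' → holdsᵃ ρ' (r , ts') ⇔ holdsᵃ ρ' (r , ts)
      atom ρ' off = ArgAbs-holdsᵃ ρ' gθ (iv' ρ' off) pw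
      body : ∀ ρ' → EqualOff w ρ ρ' → ⟦ A' ⟧ ρ' ⇔ ⟦ A ⟧ ρ'
      body ρ' off = Abs-⟦⟧ ρ' gθ (λ x i o → nb x i (inj₂ (inj₂ o))) (iv' ρ' off) a

lookupVar : Binding → Term → Maybe Var
lookupVar [] t = nothing
lookupVar ((v , u) ∷ θ) t with t ≟ᵗ u
... | yes _ = just v
... | no _ = lookupVar θ t

lookupVar-just : ∀ θ t v → lookupVar θ t ≡ just v → (v , t) ∈ θ
lookupVar-just ((v' , u) ∷ θ) t v e with t ≟ᵗ u
lookupVar-just ((v' , u) ∷ θ) .u .v' refl | yes refl = here refl
... | no _ = there (lookupVar-just θ t v e)

lookupVar-nothing : ∀ θ t → lookupVar θ t ≡ nothing → t ∉ map proj₂ θ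
lookupVar-nothing ((v' , u) ∷ θ) t e m with t ≟ᵗ u
lookupVar-nothing ((v' , u) ∷ θ) t () m | yes _
lookupVar-nothing ((v' , u) ∷ θ) t e (here e') | no ne = ne e'
lookupVar-nothing ((v' , u) ∷ θ) t e (there m) | no ne = lookupVar-nothing θ t e m

lookupTerm : Binding → Var → Maybe Term
lookupTerm [] x = nothing
lookupTerm ((v , u) ∷ θ) x with x ≟ℕ v
... | yes _ = just u
... | no _ = lookupTerm θ x

lookupTerm-just : ∀ θ x t → lookupTerm θ x ≡ just t → (x , t) ∈ θ
lookupTerm-just ((v , u) ∷ θ) x t e with x ≟ℕ v
lookupTerm-just ((v , u) ∷ θ) .v .u refl | yes refl = here refl
... | no _ = there (lookupTerm-just θ x t e)

lookupTerm-∈ : ∀ θ x → x ∈ map proj₁ θ → ∃ λ t → lookupTerm θ x ≡ just t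
lookupTerm-∈ ((v , u) ∷ θ) x m with x ≟ℕ v
... | yes _ = u , refl
... | no ne with m
...   | here e = ⊥-elim (ne e)
...   | there m' = lookupTerm-∈ θ x m'

rebind : {D : Set} → (Term → D) → (Var → D) → Binding → Term → D
rebind val ρ θ t with lookupVar θ t
... | just v = ρ v
... | nothing = val t

rebind-∉ : ∀ {D} (val : Term → D) ρ θ t → t ∉ map proj₂ θ → rebind val ρ θ t ≡ val t
rebind-∉ val ρ θ t n with lookupVar θ t in eq
... | just v = ⊥-elim (n (∈-proj₂ (lookupVar-just θ t v eq)))
... | nothing = refl

rebind-∈ : ∀ {D} (val : Term → D) ρ θ → Unique (map proj₂ θ) → ∀ v t → (v , t) ∈ θ → ρ v ≡ rebind val ρ θ t
rebind-∈ val ρ θ u v t i with lookupVar θ t in eq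
... | just v' = cong ρ (unique-proj₂⇒injective θ u i (lookupVar-just θ t v' eq))
... | nothing = ⊥-elim (lookupVar-nothing θ t eq (∈-proj₂ i))

bindEnv : {D : Set} → (Term → D) → D → Binding → Var → D
bindEnv val d₀ θ x with lookupTerm θ x
... | just t = val t
... | nothing = d₀

bindEnv-∈ : ∀ {D} (val : Term → D) d₀ θ → Unique (map proj₁ θ) → ∀ v t → (v , t) ∈ θ → bindEnv val d₀ θ v ≡ val t
bindEnv-∈ val d₀ θ u v t i with lookupTerm θ v in eq | lookupTerm-∈ θ v (∈-proj₁ i)
... | just t' | _ = cong val (unique-proj₁⇒functional θ u (lookupTerm-just θ v t' eq) i)
... | nothing | _ , ()

-- Origin of the terms on a branch

data _⊑_ (u : Term) : Term → Set where
  ⊑-refl : u ⊑ u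
  ⊑-arg  : ∀ {f ts t} → t ∈ ts → u ⊑ t → u ⊑ fn f ts

OccursIn : Term → Lit → Set
OccursIn u l = ∃ λ t → t ∈ args (atomOf l) × u ⊑ t

OccursOn : Term → List (Lit × Side) → Set
OccursOn u a = Any (λ e → OccursIn u (proj₁ e)) a

occursOn-∈ : ∀ {u} {a : List (Lit × Side)} {b t} → pos b ∈ map proj₁ a → t ∈ args b → u ⊑ t → OccursOn u a
occursOn-∈ m mt st with ∈-map⁻ proj₁ m
... | (l , s) , m' , refl = Any.map (λ { refl → _ , mt , st }) m'

labelsSide : ∀ {S l s} anc → (l , s) ∈ anc → s ≡ S → l ∈ branch S anc
labelsSide {red} ((l , red) ∷ a) (here refl) refl = here refl
labelsSide {blue} ((l , blue) ∷ a) (here refl) refl = here refl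
labelsSide {red} ((l , blue) ∷ a) (here refl) ()
labelsSide {blue} ((l , red) ∷ a) (here refl) ()
labelsSide {red} ((l' , red) ∷ a) (there m) e = there (labelsSide a m e)
labelsSide {red} ((l' , blue) ∷ a) (there m) e = labelsSide a m e
labelsSide {blue} ((l' , red) ∷ a) (there m) e = labelsSide a m e
labelsSide {blue} ((l' , blue) ∷ a) (there m) e = there (labelsSide a m e)

branch-labels : ∀ {S l} anc → l ∈ branch S anc → (l , S) ∈ anc
branch-labels {red} ((l' , red) ∷ a) (here refl) = here refl
branch-labels {red} ((l' , red) ∷ a) (there m) = there (branch-labels a m)
branch-labels {red} ((l' , blue) ∷ a) m = there (branch-labels a m)
branch-labels {blue} ((l' , red) ∷ a) m = there (branch-labels a m)
branch-labels {blue} ((l' , blue) ∷ a) (here refl) = here refl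
branch-labels {blue} ((l' , blue) ∷ a) (there m) = there (branch-labels a m)

GArgLits⁺ : ∀ {t l} ls → l ∈ ls → GArgAtom t (atomOf l) → GArgLits t ls
GArgLits⁺ (l ∷ ls) (here refl) g = here g
GArgLits⁺ (l ∷ ls) (there m) g = there (GArgLits⁺ ls m g)

other : Side → Side
other red = blue
other blue = red

other≢ : ∀ S → other S ≡ S → ⊥
other≢ red ()
other≢ blue ()

module TableauFacts (F G : QF) (oF oG : Ord) where
  open TableauDefs F G oF oG

  SkolemIntroduces : Side → Lit → Term → Set
  SkolemIntroduces S l u = ∃ λ p → ∃ λ v → ∃ λ R → ∃ λ A → ∃ λ μ → ∃ λ i →
    (p , ex′ v R A) ∈ posList (Fs S) ×
    (l ≡ pos (substA μ (substA (σp S (os S) p v) R)) ⊎ l ≡ pos (substA μ (substA (σp S (os S) p v) (Dat S (os S) (p ·1))))) ×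
    u ≡ skT S (os S) μ p i

  SkolemTwins : Side → (Var → Term) → Pos → List Var → Atom → Lit → Lit → Set
  SkolemTwins S μ p v R X Y =
    (X ≡ pos (substA μ (substA (σp S (os S) p v) R)) × Y ≡ pos (substA μ (substA (σp S (os S) p v) (Dat S (os S) (p ·1))))) ⊎
    (X ≡ pos (substA μ (substA (σp S (os S) p v) (Dat S (os S) (p ·1)))) × Y ≡ pos (substA μ (substA (σp S (os S) p v) R)))

  module OnTableau (rqs : ∀ S → RQFO (Fs S)) (oks : ∀ S → OrdOK (Fs S) (os S)) (sens : ∀ S → Sentence (Fs S))
           (T : Tab) (aci : ACI T) where
    open ACI aci
    module Order (S : Side) = OrderFacts (os S) (Fs S) (rqs S) (oks S)

    ord-root : ∀ S → os S [] ≡ []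
    ord-root S = ord-root-empty (Fs S) (os S) (oks S) (sens S)

    neg-label-closed : ∀ {a s anc t} → Reach T ((neg a , s) ∷ anc) t → pos a ∈ map proj₁ anc
    neg-label-closed {t = leaf} r = closed r
    neg-label-closed {t = inner s' cs'} r = ⊥-elim (leafOnly r)

    label-ground : ∀ {anc t l s} → Reach T anc t → (l , s) ∈ anc → GroundLit l
    label-ground r@(child _ _) (here refl) = ground r
    label-ground (child r m) (there i) = label-ground r i

    instance-child : ∀ {cs : List (Lit × Tab)} {μ c lit} → map proj₁ cs ≡ map (substL μ) c → lit ∈ c →
      ∃ λ t → (substL μ lit , t) ∈ cs
    instance-child {μ = μ} e m with ∈-map⁻ proj₁ (subst (substL μ _ ∈_) (sym e) (∈-map⁺ (substL μ) m))
    ... | (l , t) , m' , refl = t , m'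

    child-instance : ∀ {cs : List (Lit × Tab)} {μ c l t} → map proj₁ cs ≡ map (substL μ) c → (l , t) ∈ cs →
      ∃ λ lit → lit ∈ c × l ≡ substL μ lit
    child-instance {μ = μ} e m = ∈-map⁻ (substL μ) (subst (_ ∈_) e (∈-map⁺ proj₁ m))

    -- ¬D_p μ is a leaf, closed by D_p μ above it, so the terms μ x (x ∈ x_p) occur above.
    definer-var-occurs : ∀ {S a cs μ c p x u} → Reach T a (inner S cs) → map proj₁ cs ≡ map (substL μ) c →
      neg (Dat S (os S) p) ∈ c → x ∈ os S p → u ⊑ μ x → OccursOn u a
    definer-var-occurs {S} {μ = μ} {p = p} {x} r e mn mx st with instance-child e mn
    ... | t₁ , m₁ = occursOn-∈ (neg-label-closed (child r m₁)) (substTs-vars-∈⁺ μ (os S p) x mx) st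

    atom-var-occurs : ∀ {S a cs μ c R x u} → Reach T a (inner S cs) → map proj₁ cs ≡ map (substL μ) c →
      neg R ∈ c → var x ∈ args R → u ⊑ μ x → OccursOn u a
    atom-var-occurs {μ = μ} {R = R} {x} r e mn mx st with instance-child e mn
    ... | t₁ , m₁ = occursOn-∈ (neg-label-closed (child r m₁)) (substTs-∈⁺ μ (args R) (var x) mx) st

    Origin : Term → List (Lit × Side) → Side → Lit → Set
    Origin u a S l = OccursOn u a ⊎ Const u ⊎ SkolemIntroduces S l u

    definer-occurs : ∀ {S u μ} q → OccursIn u (pos (substA μ (Dat S (os S) q))) →
      ∃ λ x → x ∈ os S q × u ⊑ μ x
    definer-occurs {S} {μ = μ} q (t , mt , st) with substTs-vars-∈⁻ μ (os S q) t mt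
    ... | x , mx , refl = x , mx , st

    skolemised-origin : ∀ {S a cs μ c p v R A u} ts → Reach T a (inner S cs) → map proj₁ cs ≡ map (substL μ) c →
      neg (Dat S (os S) p) ∈ c → (p , ex′ v R A) ∈ posList (Fs S) → All RelArg ts →
      (∀ x → var x ∈ ts → x ∉ v → x ∈ os S p) →
      ∀ {l} → (l ≡ pos (substA μ (substA (σp S (os S) p v) R)) ⊎
               l ≡ pos (substA μ (substA (σp S (os S) p v) (Dat S (os S) (p ·1))))) →
      ∀ t → t ∈ substTs μ (substTs (σp S (os S) p v) ts) → u ⊑ t → Origin u a S l
    skolemised-origin {S} {μ = μ} {p = p} {v} {R} {A} ts r e mn mp ra fv {l} el t mt st
      with substTs-∈⁻ μ _ t mt
    ... | t₀ , m₀ , refl with substTs-∈⁻ (σp S (os S) p v) ts t₀ m₀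
    ...   | t₁ , m₁ , refl with All.lookup ra m₁
    ...     | inj₂ (c , refl) with st
    ...       | ⊑-refl = inj₂ (inj₁ (c , refl))
    ...       | ⊑-arg () _
    skolemised-origin {S} {μ = μ} {p = p} {v} {R} {A} ts r e mn mp ra fv {l} el t mt st
      | t₀ , m₀ , refl | t₁ , m₁ , refl | inj₁ (x , refl) with σp-view S (os S) μ p v x
    ...       | inj₂ (ei , ex) rewrite ex = inj₁ (definer-var-occurs r e mn (fv x m₁ (idx-nothing v x ei)) st)
    ...       | inj₁ (i , ei , ex) rewrite ex with st
    ...         | ⊑-refl = inj₂ (inj₂ (p , v , R , A , μ , i , mp , el , refl))
    ...         | ⊑-arg mt' st' with substTs-vars-∈⁻ μ (os S p) _ mt'
    ...           | y , my , refl = inj₁ (definer-var-occurs r e mn my st')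

    label-origin : ∀ {S a cs μ f c lit s' cs' u} → Reach T a (inner S cs) → map proj₁ cs ≡ map (substL μ) c →
      ClauseShape S (os S) (Fs S) f c → lit ∈ c → Reach T ((substL μ lit , S) ∷ a) (inner s' cs') →
      OccursIn u (substL μ lit) → Origin u a S (substL μ lit)
    label-origin {S} r e shape-root (here refl) rc occ with definer-occurs [] occ
    ... | x , mx , _ rewrite ord-root S with mx
    ...   | ()
    label-origin r e (shape-⊥ mp) (here refl) rc occ = ⊥-elim (leafOnly rc)
    label-origin r e (shape-∧₁ mp) (here refl) rc occ = ⊥-elim (leafOnly rc)
    label-origin {S} r e (shape-∧₁ {p} mp) (there (here refl)) rc occ with definer-occurs (p ·1) occ
    ... | x , mx , st = inj₁ (definer-var-occurs r e (here refl) (Order.ord-child⊆ S mp ∧-left mx λ ()) st)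
    label-origin r e (shape-∧₂ mp) (here refl) rc occ = ⊥-elim (leafOnly rc)
    label-origin {S} r e (shape-∧₂ {p} mp) (there (here refl)) rc occ with definer-occurs (p ·2) occ
    ... | x , mx , st = inj₁ (definer-var-occurs r e (here refl) (Order.ord-child⊆ S mp ∧-right mx λ ()) st)
    label-origin r e (shape-∨ mp) (here refl) rc occ = ⊥-elim (leafOnly rc)
    label-origin {S} r e (shape-∨ {p} mp) (there (here refl)) rc occ with definer-occurs (p ·1) occ
    ... | x , mx , st = inj₁ (definer-var-occurs r e (here refl) (Order.ord-child⊆ S mp ∨-left mx λ ()) st)
    label-origin {S} r e (shape-∨ {p} mp) (there (there (here refl))) rc occ with definer-occurs (p ·2) occ
    ... | x , mx , st = inj₁ (definer-var-occurs r e (here refl) (Order.ord-child⊆ S mp ∨-right mx λ ()) st)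
    label-origin r e (shape-∀ mp) (here refl) rc occ = ⊥-elim (leafOnly rc)
    label-origin r e (shape-∀ mp) (there (here refl)) rc occ = ⊥-elim (leafOnly rc)
    label-origin {S} r e (shape-∀ {p} {v} {R} mp) (there (there (here refl))) rc occ with definer-occurs (p ·1) occ
    ... | x , mx , st with x ∈? v
    ...   | yes iv = inj₁ (atom-var-occurs r e (there (here refl)) (proj₂ (proj₂ (Order.quantAtom-RQFO S (inj₁ mp))) x iv) st)
    ...   | no nv = inj₁ (definer-var-occurs r e (here refl) (Order.quantBody-ord⇒ord S (inj₁ mp) mx nv) st)
    label-origin r e (shape-∃R mp) (here refl) rc occ = ⊥-elim (leafOnly rc)
    label-origin {S} r e (shape-∃R {p} {v} {R} mp) (there (here refl)) rc (t , mt , st) =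
      skolemised-origin (args R) r e (here refl) mp (proj₁ (Order.quantAtom-RQFO S (inj₂ mp)))
        (λ x i n → Order.quantAtom-var⇒ord S (inj₂ mp) i n) (inj₁ refl) t mt st
    label-origin r e (shape-∃D mp) (here refl) rc occ = ⊥-elim (leafOnly rc)
    label-origin {S} r e (shape-∃D {p} {v} {R} mp) (there (here refl)) rc (t , mt , st) =
      skolemised-origin (map var (os S (p ·1))) r e (here refl) mp (vars-RelArg (os S (p ·1)))
        (λ x i n → Order.quantBody-ord⇒ord S (inj₂ mp) (var-∈-vars i) n) (inj₂ refl) t mt st

    skolem-introduced : ∀ {a s cs u S p i us} → Reach T a (inner s cs) → OccursOn u a → u ≡ fn (sk S p i) us →
      ∃ λ l' → (l' , S) ∈ a × SkolemIntroduces S l' u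
    skolem-introduced (child {s = S} r m) (here occ) eu with clauses r
    ... | f , c , mc , μ , e with child-instance e m
    ...   | lit , mlit , refl with label-origin r e (clauseShape S (os S) (Fs S) mc) mlit (child r m) occ
    ...     | inj₁ o = Product.map₂ (Product.map₁ there) (skolem-introduced r o eu)
    ...     | inj₂ (inj₁ (c , refl)) with eu
    ...       | ()
    skolem-introduced (child r m) (here occ) eu | f , c , mc , μ , e | lit , mlit , refl | inj₂ (inj₂ si)
      with trans (sym (proj₂ (proj₂ (proj₂ (proj₂ (proj₂ (proj₂ (proj₂ (proj₂ si))))))))) eu
    ...       | refl = _ , here refl , si
    skolem-introduced (child r m) (there o) eu = Product.map₂ (Product.map₁ there) (skolem-introduced r o eu)

    ancestor-reach : ∀ pre {x s cs} → Reach T (pre ++ x) (inner s cs) → ∃₂ λ s' cs' → Reach T x (inner s' cs')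
    ancestor-reach [] r = _ , _ , r
    ancestor-reach (e ∷ pre) (child r m) = ancestor-reach pre r

    σ-instance-cong : ∀ S μ μ' p v → skArgs (os S) μ p ≡ skArgs (os S) μ' p → ∀ ts → All RelArg ts →
      (∀ x → var x ∈ ts → x ∉ v → x ∈ os S p) →
      substTs μ (substTs (σp S (os S) p v) ts) ≡ substTs μ' (substTs (σp S (os S) p v) ts)
    σ-instance-cong S μ μ' p v e [] [] h = refl
    σ-instance-cong S μ μ' p v e (.(fn (origF c) []) ∷ ts) (inj₂ (c , refl) ∷ ra) h =
      cong (_ ∷_) (σ-instance-cong S μ μ' p v e ts ra (λ x i → h x (there i)))
    σ-instance-cong S μ μ' p v e (.(var x) ∷ ts) (inj₁ (x , refl) ∷ ra) h =
      cong₂ _∷_ head (σ-instance-cong S μ μ' p v e ts ra (λ x i → h x (there i)))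
      where
      head : substT μ (σp S (os S) p v x) ≡ substT μ' (σp S (os S) p v x)
      head with σp-view S (os S) μ p v x | σp-view S (os S) μ' p v x
      ... | inj₁ (i , ei , ex) | inj₁ (i' , ei' , ex') with trans (sym ei) ei'
      ...   | refl = trans ex (trans (cong (fn (sk S p i)) e) (sym ex'))
      head | inj₁ (i , ei , ex) | inj₂ (ei' , _) with trans (sym ei) ei'
      ...   | ()
      head | inj₂ (ei , _) | inj₁ (i' , ei' , _) with trans (sym ei) ei'
      ...   | ()
      head | inj₂ (ei , ex) | inj₂ (_ , ex') =
        trans ex (trans (substTs-vars-injective μ μ' (os S p) x e (h x (here refl) (idx-nothing v x ei))) (sym ex'))

    private
      fn-injective : ∀ {f g ts us} → fn f ts ≡ fn g us → f ≡ g × ts ≡ us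
      fn-injective refl = refl , refl

    -- the Skolem symbol f_⟨p,i⟩ determines the position, so only the twins introduce skT μ p i
    introducer-twin : ∀ {S μ p v R A i X Y l'} → (p , ex′ v R A) ∈ posList (Fs S) → SkolemTwins S μ p v R X Y →
      SkolemIntroduces S l' (skT S (os S) μ p i) → l' ≡ X ⊎ l' ≡ Y
    introducer-twin {S} {μ} {p} {v} {R} {l' = l'} mp xy (p' , v' , R' , A' , μ' , i' , mp' , el' , eu)
      with fn-injective eu
    ... | refl , eargs with posList-functional (Fs S) mp mp'
    ...   | refl = twin xy el'
      where
      open Order S
      eR : substA μ (substA (σp S (os S) p v) R) ≡ substA μ' (substA (σp S (os S) p v) R)
      eR = cong (proj₁ R ,_) (σ-instance-cong S μ μ' p v eargs (args R) (proj₁ (quantAtom-RQFO (inj₂ mp)))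
                               (λ x i n → quantAtom-var⇒ord (inj₂ mp) i n))
      eD : substA μ (substA (σp S (os S) p v) (Dat S (os S) (p ·1))) ≡
           substA μ' (substA (σp S (os S) p v) (Dat S (os S) (p ·1)))
      eD = cong (dfn S (p ·1) ,_) (σ-instance-cong S μ μ' p v eargs (map var (os S (p ·1))) (vars-RelArg (os S (p ·1)))
                                     (λ x i n → quantBody-ord⇒ord (inj₂ mp) (var-∈-vars i) n))
      twin : ∀ {X Y} → SkolemTwins S μ p v R X Y → _ → l' ≡ X ⊎ l' ≡ Y
      twin (inj₁ (ex , ey)) (inj₁ e) = inj₁ (trans e (trans (cong pos (sym eR)) (sym ex)))
      twin (inj₁ (ex , ey)) (inj₂ e) = inj₂ (trans e (trans (cong pos (sym eD)) (sym ey)))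
      twin (inj₂ (ex , ey)) (inj₁ e) = inj₂ (trans e (trans (cong pos (sym eR)) (sym ey)))
      twin (inj₂ (ex , ey)) (inj₂ e) = inj₁ (trans e (trans (cong pos (sym eD)) (sym ex)))

    -- A Skolem term introduced at a child X of a node occurs above that node only in its twin Y,
    -- which by contiguity is the node itself: other introducers would be X (excluded by regularity)
    -- or lie strictly above Y (excluded by contiguity).
    skolem-fresh : ∀ {anc S cs μ p v R A X Y t₂} → Reach T anc (inner S cs) → (p , ex′ v R A) ∈ posList (Fs S) →
      (X , t₂) ∈ cs → SkolemTwins S μ p v R X Y →
      ∀ {l S' i} → (l , S') ∈ anc → OccursIn (skT S (os S) μ p i) l → S' ≡ S × l ≡ Y
    skolem-fresh {anc} {S} {cs} {μ} {p} {v} {R} {A} {X} {Y} r mp mX xy {l} {S'} ml occ with ∈-∃++ ml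
    ... | pre , rest , eq with ancestor-reach pre (subst (λ a → Reach T a (inner S cs)) eq r)
    ...   | _ , _ , r' with skolem-introduced r' (here occ) refl
    ...     | l' , ml' , si = at-head Y-parent
      where
      l'∈anc : (l' , S) ∈ anc
      l'∈anc = subst ((l' , S) ∈_) (sym eq) (∈-++⁺ʳ pre ml')
      l'≡Y : l' ≡ Y
      l'≡Y = [ (λ e → ⊥-elim (regular (child r mX) (subst (_∈ map proj₁ anc) e (∈-proj₁ l'∈anc)))) , (λ e → e) ]′
               (introducer-twin mp xy si)
      Y-parent : ∃ λ rest' → anc ≡ (l' , S) ∷ rest'
      Y-parent with ∈-∃++ l'∈anc
      ... | pre' , rest' , eq'
        with contig (child r mX) (subst (λ z → anc ≡ pre' ++ ((z , S) ∷ rest')) l'≡Y eq') (S , p , v , R , A , μ , mp , xy)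
      ...   | refl = rest' , eq'
      head-label : ∀ pre {rest rest'} → (l' , S) ∈ (l , S') ∷ rest → pre ++ ((l , S') ∷ rest) ≡ (l' , S) ∷ rest' →
        l' ∉ map proj₁ rest' → S' ≡ S × l ≡ Y
      head-label [] m refl n = refl , l'≡Y
      head-label (e ∷ pre'') m refl n = ⊥-elim (n (∈-proj₁ (∈-++⁺ʳ pre'' m)))
      at-head : (∃ λ rest' → anc ≡ (l' , S) ∷ rest') → S' ≡ S × l ≡ Y
      at-head (rest' , e) = head-label pre ml' (trans (sym eq) e) (regular (subst (λ z → Reach T z (inner S cs)) e r))

    data PositiveLabel (S : Side) : PSym → Set where
      definer  : ∀ {q} → PositiveLabel S (dfn S q)
      skolemised : ∀ {p v R A} → (p , ex′ v R A) ∈ posList (Fs S) → PositiveLabel S (proj₁ R)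

    positiveLabel : ∀ {anc t l S r us} → Reach T anc t → (l , S) ∈ anc → l ≡ pos (r , us) → PositiveLabel S r
    positiveLabel (child {s = S} r m) (here refl) el with clauses r
    ... | f , c , mc , μ , e with child-instance e m
    ...   | lit , mlit , el' = kind (clauseShape S (os S) (Fs S) mc) mlit (trans (sym el') el)
      where
      kind : ∀ {f c lit r us} → ClauseShape S (os S) (Fs S) f c → lit ∈ c → substL μ lit ≡ pos (r , us) → PositiveLabel S r
      kind shape-root (here refl) refl = definer
      kind (shape-∧₁ _) (there (here refl)) refl = definer
      kind (shape-∧₂ _) (there (here refl)) refl = definer
      kind (shape-∨ _) (there (here refl)) refl = definer
      kind (shape-∨ _) (there (there (here refl))) refl = definer
      kind (shape-∀ _) (there (there (here refl))) refl = definer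
      kind (shape-∃R m) (there (here refl)) refl = skolemised m
      kind (shape-∃D _) (there (here refl)) refl = definer
      kind (shape-⊥ _) (here refl) ()
      kind (shape-∧₁ _) (here refl) ()
      kind (shape-∧₂ _) (here refl) ()
      kind (shape-∨ _) (here refl) ()
      kind (shape-∀ _) (here refl) ()
      kind (shape-∀ _) (there (here refl)) ()
      kind (shape-∃R _) (here refl) ()
      kind (shape-∃D _) (here refl) ()
    positiveLabel (child r m) (there i) el = positiveLabel r i el

    definer-label-side : ∀ {anc t S S' q us} → Reach T anc t → (pos (dfn S' q , us) , S) ∈ anc → S' ≡ S
    definer-label-side {S = S} r i with positiveLabel r i refl
    ... | definer = refl
    ... | skolemised m with proj₁ (RQFO-at (Fs S) (rqs S) m)
    ...   | _ , ()

    original-label-pred : ∀ {anc t S n us} → Reach T anc t → (pos (orig n , us) , S) ∈ anc →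
      ∃ λ R → ∃ λ v → Quant plus R v (DEFs S) × proj₁ R ≡ orig n
    original-label-pred {S = S} r i with positiveLabel r i refl
    ... | skolemised {v = v} {R} m = R , v , DEF-Quant-∃ S (os S) (Fs S) m , refl

    definer-on-branch : ∀ {S anc cs μ p t} → Reach T anc (inner S cs) → (neg (substA μ (Dat S (os S) p)) , t) ∈ cs →
      pos (substA μ (Dat S (os S) p)) ∈ branch S anc
    definer-on-branch {S} {anc} r m with ∈-map⁻ proj₁ (neg-label-closed (child r m))
    ... | (l , s') , m' , refl = labelsSide anc m' (sym (definer-label-side r m'))

-- The interpolation invariant

branch-own : ∀ S l anc → branch S ((l , S) ∷ anc) ≡ l ∷ branch S anc
branch-own red l anc = refl
branch-own blue l anc = refl

branch-other : ∀ S l anc → branch (other S) ((l , S) ∷ anc) ≡ branch (other S) anc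
branch-other red l anc = refl
branch-other blue l anc = refl

module Interpolation (em : ExcludedMiddle 0ℓ) (F G : QF) (oF oG : Ord)
  (rqF : RQFO F) (senF : Sentence F) (rqG : RQFO G) (senG : Sentence G)
  (okF : OrdOK F oF) (okG : OrdOK (negQF G) oG)
  (T : Tab) (aci : TableauDefs.ACI F G oF oG T) where

  open TableauDefs F G oF oG
  open ACI aci
  open Abstraction F G oF oG

  rqs : ∀ S → RQFO (Fs S)
  rqs red = rqF
  rqs blue = negQF-RQFO G rqG

  oks : ∀ S → OrdOK (Fs S) (os S)
  oks red = okF
  oks blue = okG

  sens : ∀ S → Sentence (Fs S)
  sens red = senF
  sens blue x f = senG x (negQF-FreeIn G x f)

  open TableauFacts F G oF oG
  open OnTableau rqs oks sens T aci

  OnSide : Side → List (Lit × Side) → Term → Set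
  OnSide S anc t = GArg t (DEFs S) ⊎ GArgLits t (branch S anc)

  SharedArgsKnown : Side → List (Lit × Side) → Lit → Set
  SharedArgsKnown S anc l = ∀ t → GArgAtom t (atomOf l) → OnSide (other S) anc t → OnSide S anc t

  onSide-own : ∀ S {l anc t} → OnSide S ((l , S) ∷ anc) t → GArgAtom t (atomOf l) ⊎ OnSide S anc t
  onSide-own S {l} {anc} (inj₁ d) = inj₂ (inj₁ d)
  onSide-own S {l} {anc} (inj₂ g) with subst (GArgLits _) (branch-own S l anc) g
  ... | here g' = inj₁ g'
  ... | there g' = inj₂ (inj₂ g')

  onSide-other : ∀ S {l anc t} → OnSide (other S) ((l , S) ∷ anc) t → OnSide (other S) anc t
  onSide-other S {l} {anc} = Sum.map₂ (subst (GArgLits _) (branch-other S l anc))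

  both-sides : ∀ S {anc t} → OnSide S anc t → OnSide (other S) anc t → ∀ S' → OnSide S' anc t
  both-sides red o o' red = o
  both-sides red o o' blue = o'
  both-sides blue o o' red = o'
  both-sides blue o o' blue = o

  lift-shared : ∀ S {l anc t} → SharedArgsKnown S anc l → (∀ S' → OnSide S' ((l , S) ∷ anc) t) → ∀ S' → OnSide S' anc t
  lift-shared S {l} {anc} {t} known h = both-sides S {anc} own other-side
    where
    other-side : OnSide (other S) anc t
    other-side = onSide-other S {l} {anc} (h (other S))
    own : OnSide S anc t
    own = [ (λ g → known _ g other-side) , (λ o → o) ]′ (onSide-own S {l} {anc} (h S))

  root-args-known : ∀ S anc μ → SharedArgsKnown S anc (pos (substA μ (Dat S (os S) [])))
  root-args-known S anc μ t (mt , _) _ with substTs-vars-∈⁻ μ (os S []) t mt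
  ... | x , mx , _ rewrite ord-root S with mx
  ...   | ()

  definer-args-known : ∀ {S anc cs μ p q t} → Reach T anc (inner S cs) → (neg (substA μ (Dat S (os S) p)) , t) ∈ cs →
    (∀ x → x ∈ os S q → x ∈ os S p) → SharedArgsKnown S anc (pos (substA μ (Dat S (os S) q)))
  definer-args-known {S} {anc} {μ = μ} {p} {q} r m sub t (mt , gt) _ with substTs-vars-∈⁻ μ (os S q) t mt
  ... | x , mx , refl =
    inj₂ (GArgLits⁺ (branch S anc) (definer-on-branch r m) (substTs-vars-∈⁺ μ (os S p) x (sub x mx) , gt))

  ∀-body-args-known : ∀ {S anc cs μ p v R A t} → Reach T anc (inner S cs) → (neg (substA μ (Dat S (os S) p)) , t) ∈ cs →
    (p , all′ v R A) ∈ posList (Fs S) → pos (substA μ R) ∈ branch S anc →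
    SharedArgsKnown S anc (pos (substA μ (Dat S (os S) (p ·1))))
  ∀-body-args-known {S} {anc} {μ = μ} {p} {v} {R} r m mp mR t (mt , gt) _ with substTs-vars-∈⁻ μ (os S (p ·1)) t mt
  ... | x , mx , refl with x ∈? v
  ...   | yes iv = inj₂ (GArgLits⁺ (branch S anc) mR
            (substTs-∈⁺ μ (args R) (var x) (proj₂ (proj₂ (Order.quantAtom-RQFO S (inj₁ mp))) x iv) , gt))
  ...   | no nv = inj₂ (GArgLits⁺ (branch S anc) (definer-on-branch r m)
            (substTs-vars-∈⁺ μ (os S p) x (Order.quantBody-ord⇒ord S (inj₁ mp) mx nv) , gt))

  σ-instance-arg : ∀ S μ p v ts t → t ∈ substTs μ (substTs (σp S (os S) p v) ts) → All RelArg ts →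
    (∃ λ i → t ≡ skT S (os S) μ p i) ⊎ (∃ λ x → var x ∈ ts × x ∉ v × t ≡ μ x) ⊎
    (∃ λ c → fn (origF c) [] ∈ ts × t ≡ fn (origF c) [])
  σ-instance-arg S μ p v ts t mt ra with substTs-∈⁻ μ _ t mt
  ... | t₀ , m₀ , refl with substTs-∈⁻ (σp S (os S) p v) ts t₀ m₀
  ...   | t₁ , m₁ , refl with All.lookup ra m₁
  ...     | inj₂ (c , refl) = inj₂ (inj₂ (c , m₁ , refl))
  ...     | inj₁ (x , refl) with σp-view S (os S) μ p v x
  ...       | inj₁ (i , ei , ex) = inj₁ (i , ex)
  ...       | inj₂ (ei , ex) = inj₂ (inj₁ (x , m₁ , idx-nothing v x ei , ex))

  skolem-not-other-side : ∀ {S anc cs μ p v R A X Y t₂} → Reach T anc (inner S cs) → (p , ex′ v R A) ∈ posList (Fs S) →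
    (X , t₂) ∈ cs → SkolemTwins S μ p v R X Y → ∀ i → ¬ OnSide (other S) anc (skT S (os S) μ p i)
  skolem-not-other-side {S} r mp mX xy i (inj₁ g) with DEF-GArg⇒Const (other S) (os (other S)) (Fs (other S)) (rqs (other S)) g
  ... | c , ()
  skolem-not-other-side {S} {anc} r mp mX xy i (inj₂ gl) with find gl
  ... | l , ml , (mt , _) = other≢ S (proj₁ (skolem-fresh r mp mX xy (branch-labels anc ml) (_ , mt , ⊑-refl)))

  ∃R-args-known : ∀ {S anc cs μ p v R A t t₂} → Reach T anc (inner S cs) → (neg (substA μ (Dat S (os S) p)) , t) ∈ cs →
    (p , ex′ v R A) ∈ posList (Fs S) → (pos (substA μ (substA (σp S (os S) p v) R)) , t₂) ∈ cs →
    SharedArgsKnown S anc (pos (substA μ (substA (σp S (os S) p v) R)))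
  ∃R-args-known {S} {anc} {μ = μ} {p} {v} {R} r m mp mX t (mt , gt) oth
    with σ-instance-arg S μ p v (args R) t mt (proj₁ (Order.quantAtom-RQFO S (inj₂ mp)))
  ... | inj₁ (i , refl) = ⊥-elim (skolem-not-other-side r mp mX (inj₁ (refl , refl)) i oth)
  ... | inj₂ (inj₁ (x , mx , nv , refl)) = inj₂ (GArgLits⁺ (branch S anc) (definer-on-branch r m)
          (substTs-vars-∈⁺ μ (os S p) x (Order.quantAtom-var⇒ord S (inj₂ mp) mx nv) , gt))
  ... | inj₂ (inj₂ (c , mc , refl)) = inj₁ (DEF-GArg-∃ S (os S) (Fs S) mp (mc , fnG []))

  ∃D-args-known : ∀ {S anc cs μ p v R A t t₂} → Reach T anc (inner S cs) → (neg (substA μ (Dat S (os S) p)) , t) ∈ cs →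
    (p , ex′ v R A) ∈ posList (Fs S) → (pos (substA μ (substA (σp S (os S) p v) (Dat S (os S) (p ·1)))) , t₂) ∈ cs →
    SharedArgsKnown S anc (pos (substA μ (substA (σp S (os S) p v) (Dat S (os S) (p ·1)))))
  ∃D-args-known {S} {anc} {μ = μ} {p} {v} {R} r m mp mX t (mt , gt) oth
    with σ-instance-arg S μ p v (map var (os S (p ·1))) t mt (vars-RelArg (os S (p ·1)))
  ... | inj₁ (i , refl) = ⊥-elim (skolem-not-other-side r mp mX (inj₂ (refl , refl)) i oth)
  ... | inj₂ (inj₁ (x , mx , nv , refl)) = inj₂ (GArgLits⁺ (branch S anc) (definer-on-branch r m)
          (substTs-vars-∈⁺ μ (os S p) x (Order.quantBody-ord⇒ord S (inj₂ mp) (var-∈-vars mx) nv) , gt))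
  ... | inj₂ (inj₂ (c , mc , e)) with ∈-map⁻ var mc
  ...   | _ , _ , ()

  DR DB : QF
  DR = DEFs red
  DB = DEFs blue

  SideModel : Side → List (Lit × Side) → (M : Structure) → (Term → Structure.D M) → (Var → Structure.D M) → Set
  SideModel S anc M val ρ = Valued.⟦_⟧ M val (DEFs S) ρ × All (Valued.holdsˡ M val ρ) (branch S anc)

  record Interpolates (anc : List (Lit × Side)) (H : QF) : Set₁ where
    field
      rqfot : RQFOT H
      sentence : Sentence H
      preds : ∀ s R v → Quant s R v H → PredIn s (proj₁ R) DR × PredIn s (proj₁ R) (negQF DB)
      covered⁺ : ∀ R v → Quant plus R v H → CoveredIn plus R v (negQF DB)
      covered⁻ : ∀ R v → Quant minus R v H → CoveredIn minus R v DR
      shared : ∀ t → GArg t H → ∀ S → OnSide S anc t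
      implied : ∀ M val ρ → SideModel red anc M val ρ → Valued.⟦_⟧ M val H ρ
      refutes : ∀ M val ρ → Valued.⟦_⟧ M val H ρ → SideModel blue anc M val ρ → ⊥
  open Interpolates

  data ChildrenInterpolate (anc : List (Lit × Side)) (S : Side) : List (Lit × Tab) → List QF → Set₁ where
    [] : ChildrenInterpolate anc S [] []
    _∷_ : ∀ {l s' cs' rest H Hs} → Interpolates ((l , S) ∷ anc) H → ChildrenInterpolate anc S rest Hs →
      ChildrenInterpolate anc S ((l , inner s' cs') ∷ rest) (H ∷ Hs)

  children-∈ : ∀ {anc S rest Hs H} → ChildrenInterpolate anc S rest Hs → H ∈ Hs →
    ∃ λ l → ∃ λ t → (l , t) ∈ rest × Interpolates ((l , S) ∷ anc) H
  children-∈ (g ∷ gs) (here refl) = _ , _ , here refl , g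
  children-∈ (g ∷ gs) (there m) = Product.map₂ (Product.map₂ (Product.map₁ there)) (children-∈ gs m)

  children-Any : ∀ {anc S rest Hs} {P : Lit → Set} → ChildrenInterpolate anc S rest Hs → Any P (map proj₁ rest) →
    ∃ λ l → ∃ λ H → P l × H ∈ Hs × Interpolates ((l , S) ∷ anc) H
  children-Any (g ∷ gs) (here p) = _ , _ , p , here refl , g
  children-Any (g ∷ gs) (there a) = Product.map₂ (Product.map₂ (Product.map₂ (Product.map₁ there))) (children-Any gs a)

  SomeChildHolds : Side → List (Lit × Side) → List Lit → Set₁
  SomeChildHolds S anc ls = ∀ M val ρ → SideModel S anc M val ρ →
    ∃ λ val' → (∀ t → OnSide (other S) anc t → val' t ≡ val t) ×
               SideModel S anc M val' ρ × Any (Valued.holdsˡ M val' ρ) ls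

  combine-Any : ∀ S {P : QF → Set} → ¬ P tt′ → ¬ P ff′ →
    (∀ {A B} → P (A ∧′ B) → P A ⊎ P B) → (∀ {A B} → P (A ∨′ B) → P A ⊎ P B) →
    ∀ Hs → P (combine S Hs) → Any P Hs
  combine-Any red _ e _ split = bigOr-Any e split
  combine-Any blue e _ split _ = bigAnd-Any e split

  combine-All : ∀ S {P : QF → Set} → P tt′ → P ff′ →
    (∀ {A B} → P A → P B → P (A ∧′ B)) → (∀ {A B} → P A → P B → P (A ∨′ B)) →
    ∀ {Hs} → All P Hs → P (combine S Hs)
  combine-All red _ e _ join = bigOr-All e join
  combine-All blue e _ join _ = bigAnd-All e join

  junction-interpolates : ∀ S {anc rest Hs} → ChildrenInterpolate anc S rest Hs →
    (∀ {l t} → (l , t) ∈ rest → SharedArgsKnown S anc l) → SomeChildHolds S anc (map proj₁ rest) →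
    Interpolates anc (combine S Hs)
  junction-interpolates S {anc} {rest} {Hs} ch known some = record
    { rqfot = combine-All S {RQFOT} tt tt _,_ _,_ (All.tabulate λ m → rqfot (inv m))
    ; sentence = λ x f → let _ , m , f' = find (combine-Any S {FreeIn x} (λ ()) (λ ()) id id Hs f) in sentence (inv m) x f'
    ; preds = λ s R v q → let _ , m , q' = find (quant-child q) in preds (inv m) s R v q'
    ; covered⁺ = λ R v q → let _ , m , q' = find (quant-child q) in covered⁺ (inv m) R v q'
    ; covered⁻ = λ R v q → let _ , m , q' = find (quant-child q) in covered⁻ (inv m) R v q'
    ; shared = λ t g → let _ , m , g' = find (combine-Any S {GArg t} (λ ()) (λ ()) id id Hs g) in
                       lift-shared S {anc = anc} (known (proj₁ (proj₂ (proj₂ (children-∈ ch m))))) (shared (inv m) t g')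
    ; implied = implied-junction S ch some
    ; refutes = refutes-junction S ch some
    }
    where
    inv : ∀ {H} (m : H ∈ Hs) → Interpolates ((proj₁ (children-∈ ch m) , S) ∷ anc) H
    inv m = proj₂ (proj₂ (proj₂ (children-∈ ch m)))
    quant-child : ∀ {s R v} → Quant s R v (combine S Hs) → Any (Quant s R v) Hs
    quant-child = combine-Any S (λ ()) (λ ()) Quant-∧⁻ Quant-∨⁻ Hs
    implied-junction : ∀ S {rest Hs} → ChildrenInterpolate anc S rest Hs → SomeChildHolds S anc (map proj₁ rest) →
      ∀ M val ρ → SideModel red anc M val ρ → Valued.⟦_⟧ M val (combine S Hs) ρ
    implied-junction red {Hs = Hs} ch some M val ρ sm with some M val ρ sm
    ... | val' , agree , (d' , b') , holds with children-Any ch holds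
    ...   | l , H , lt , m , i = Valued.bigOr-sem⁺ M val Hs ρ m
            (Agreement.⟦⟧-agree M val' val H ρ (RQFOT⇒TermArgs H (rqfot i)) (λ t g → agree t (shared i t g blue))
              (implied i M val' ρ (d' , lt ∷ b')))
    implied-junction blue {Hs = Hs} ch some M val ρ sm =
      Valued.bigAnd-sem⁺ M val Hs ρ (All.tabulate λ m → implied (proj₂ (proj₂ (proj₂ (children-∈ ch m)))) M val ρ sm)
    refutes-junction : ∀ S {rest Hs} → ChildrenInterpolate anc S rest Hs → SomeChildHolds S anc (map proj₁ rest) →
      ∀ M val ρ → Valued.⟦_⟧ M val (combine S Hs) ρ → SideModel blue anc M val ρ → ⊥
    refutes-junction red {Hs = Hs} ch some M val ρ h sm =
      let _ , m , h' = find (Valued.bigOr-sem⁻ M val Hs ρ h) in refutes (proj₂ (proj₂ (proj₂ (children-∈ ch m)))) M val ρ h' sm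
    refutes-junction blue {Hs = Hs} ch some M val ρ h sm with some M val ρ sm
    ... | val' , agree , (d' , b') , holds with children-Any ch holds
    ...   | l , H , lt , m , i = refutes i M val' ρ
            (Agreement.⟦⟧-agree M val val' H ρ (RQFOT⇒TermArgs H (rqfot i)) (λ t g → sym (agree t (shared i t g red)))
              (Valued.bigAnd-sem⁻ M val Hs ρ h m))
            (d' , lt ∷ b')

  single-child-interpolates : ∀ S {anc l s' cs' H} → Interpolates ((l , S) ∷ anc) H →
    SharedArgsKnown S anc l → SomeChildHolds S anc (l ∷ []) → Interpolates anc H
  single-child-interpolates S {anc} {l} {s'} {cs'} {H} i known some =
    subst (Interpolates anc) (combine-singleton S) (junction-interpolates S ch (λ { (here refl) → known }) some)
    where
    ch : ChildrenInterpolate anc S ((l , inner s' cs') ∷ []) (H ∷ [])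
    ch = i ∷ []
    combine-singleton : ∀ S → combine S (H ∷ []) ≡ H
    combine-singleton red = refl
    combine-singleton blue = refl

  module ChildHolds (S : Side) {anc cs} (r : Reach T anc (inner S cs)) where
    module UnfoldHere (M : Structure) (val : Term → Structure.D M) = Unfold M val S (os S) (Fs S) (rqs S) (oks S)

    on-branch : ∀ M val ρ {l} → All (Valued.holdsˡ M val ρ) (branch S anc) → l ∈ branch S anc →
      Valued.holdsˡ M val (λ _ → Structure.inh M) l
    on-branch M val ρ {l} b m = Valued.holdsˡ-ground M val ρ _ l (label-ground r (branch-labels anc m)) (All.lookup b m)

    at-child : ∀ M val ρ {l t} → (l , t) ∈ cs → Valued.holdsˡ M val (λ _ → Structure.inh M) l → Valued.holdsˡ M val ρ l
    at-child M val ρ {l} m = Valued.holdsˡ-ground M val _ ρ l (ground (child r m))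

    unchanged : ∀ {ls} → (∀ M val ρ → SideModel S anc M val ρ → Any (Valued.holdsˡ M val ρ) ls) → SomeChildHolds S anc ls
    unchanged f M val ρ sm = val , (λ _ _ → refl) , sm , f M val ρ sm

    definer-premises : ∀ M val ρ {μ p A t} → SideModel S anc M val ρ → (neg (substA μ (Dat S (os S) p)) , t) ∈ cs →
      (p , A) ∈ posList (Fs S) →
      Valued.⟦_⟧ M val (defAt S (os S) p A) ρ × UnfoldHere.DefinerHolds M val μ p × UnfoldHere.DefinerGround M val μ p
    definer-premises M val ρ (d , b) m mp =
      Valued.DEF-defAt M val S (os S) (Fs S) ρ d mp , on-branch M val ρ b (definer-on-branch r m) , ground (child r m)

    holds-root : ∀ {μ t} → (pos (substA μ (Dat S (os S) [])) , t) ∈ cs →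
      SomeChildHolds S anc (pos (substA μ (Dat S (os S) [])) ∷ [])
    holds-root {μ} m = unchanged λ M val ρ (d , b) → here (root-instance M val ρ (Valued.DEF-root M val S (os S) (Fs S) ρ d))
      where
      root-instance : ∀ M val ρ → Valued.holdsᵃ M val ρ (Dat S (os S) []) → Valued.holdsᵃ M val ρ (substA μ (Dat S (os S) []))
      root-instance M val ρ a rewrite ord-root S = a

    holds-⊥ : ∀ {μ p t} → (neg (substA μ (Dat S (os S) p)) , t) ∈ cs → (p , ff′) ∈ posList (Fs S) → SomeChildHolds S anc []
    holds-⊥ {μ} {p} m mp M val ρ sm =
      let h , d , g = definer-premises M val ρ sm m mp in ⊥-elim (UnfoldHere.unfold-⊥ M val ρ μ p mp h d g)

    holds-∧₁ : ∀ {μ p A B t t₂} → (neg (substA μ (Dat S (os S) p)) , t) ∈ cs → (p , A ∧′ B) ∈ posList (Fs S) →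
      (pos (substA μ (Dat S (os S) (p ·1))) , t₂) ∈ cs → SomeChildHolds S anc (pos (substA μ (Dat S (os S) (p ·1))) ∷ [])
    holds-∧₁ {μ} {p} {A} {B} m mp m₂ = unchanged λ M val ρ sm →
      let h , d , g = definer-premises M val ρ sm m mp in
      here (at-child M val ρ m₂ (proj₁ (UnfoldHere.unfold-∧ M val ρ μ p A B mp h d g)))

    holds-∧₂ : ∀ {μ p A B t t₂} → (neg (substA μ (Dat S (os S) p)) , t) ∈ cs → (p , A ∧′ B) ∈ posList (Fs S) →
      (pos (substA μ (Dat S (os S) (p ·2))) , t₂) ∈ cs → SomeChildHolds S anc (pos (substA μ (Dat S (os S) (p ·2))) ∷ [])
    holds-∧₂ {μ} {p} {A} {B} m mp m₂ = unchanged λ M val ρ sm →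
      let h , d , g = definer-premises M val ρ sm m mp in
      here (at-child M val ρ m₂ (proj₂ (UnfoldHere.unfold-∧ M val ρ μ p A B mp h d g)))

    holds-∨ : ∀ {μ p A B t t₂ t₃} → (neg (substA μ (Dat S (os S) p)) , t) ∈ cs → (p , A ∨′ B) ∈ posList (Fs S) →
      (pos (substA μ (Dat S (os S) (p ·1))) , t₂) ∈ cs → (pos (substA μ (Dat S (os S) (p ·2))) , t₃) ∈ cs →
      SomeChildHolds S anc (pos (substA μ (Dat S (os S) (p ·1))) ∷ pos (substA μ (Dat S (os S) (p ·2))) ∷ [])
    holds-∨ {μ} {p} {A} {B} m mp m₂ m₃ = unchanged λ M val ρ sm →
      let h , d , g = definer-premises M val ρ sm m mp in
      [ (λ a → here (at-child M val ρ m₂ a)) , (λ a → there (here (at-child M val ρ m₃ a))) ]′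
        (UnfoldHere.unfold-∨ M val ρ μ p A B mp h d g)

    holds-∀ : ∀ {μ p v R A t t₂} → (neg (substA μ (Dat S (os S) p)) , t) ∈ cs → (p , all′ v R A) ∈ posList (Fs S) →
      pos (substA μ R) ∈ branch S anc →
      (pos (substA μ (Dat S (os S) (p ·1))) , t₂) ∈ cs → SomeChildHolds S anc (pos (substA μ (Dat S (os S) (p ·1))) ∷ [])
    holds-∀ {μ} {p} {v} {R} {A} m mp mR m₂ = unchanged λ M val ρ sm →
      let h , d , g = definer-premises M val ρ sm m mp in
      here (at-child M val ρ m₂ (UnfoldHere.unfold-∀ M val ρ μ p v R A mp h d g
                                   (on-branch M val ρ (proj₂ sm) mR) (label-ground r (branch-labels anc mR))))

    -- The fresh Skolem terms occur on the branch at most in the twin literal, which the witness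
    -- also makes true.
    holds-skolemised : ∀ {μ p v R A t X Y t₂} → (neg (substA μ (Dat S (os S) p)) , t) ∈ cs →
      (p , ex′ v R A) ∈ posList (Fs S) → (X , t₂) ∈ cs → SkolemTwins S μ p v R X Y → SomeChildHolds S anc (X ∷ [])
    holds-skolemised {μ} {p} {v} {R} {A} {t} {X} {Y} m mp mX xy M val ρ sm@(d , b)
      with definer-premises M val ρ sm m mp
    ... | h , dh , g with UnfoldHere.unfold-∃ M val ρ μ p v R A mp h dh g
    ...   | ρ₂ , aR , aD , hρ = W.skolemVal , agree , (d' , b') , here (at-child M W.skolemVal ρ mX (twin-holds xy))
      where
      module W = SkolemWitness M val S (os S) (Fs S) (rqs S) (oks S) μ p v R A mp ρ₂ hρ g
      inh : Structure.D M
      inh = Structure.inh M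
      twin-holds : ∀ {X Y} → SkolemTwins S μ p v R X Y → Valued.holdsˡ M W.skolemVal (λ _ → inh) X
      twin-holds (inj₁ (refl , _)) = W.witness-R aR
      twin-holds (inj₂ (refl , _)) = W.witness-D aD
      twin-holds' : SkolemTwins S μ p v R X Y → Valued.holdsˡ M W.skolemVal (λ _ → inh) Y
      twin-holds' (inj₁ (_ , refl)) = W.witness-D aD
      twin-holds' (inj₂ (_ , refl)) = W.witness-R aR
      agree : ∀ t → OnSide (other S) anc t → W.skolemVal t ≡ val t
      agree t o = W.skolemVal-other t λ { (i , refl) → skolem-not-other-side r mp mX xy i o }
      d' : Valued.⟦_⟧ M W.skolemVal (DEFs S) ρ
      d' = Agreement.⟦⟧-agree M val W.skolemVal (DEFs S) ρ (DEF-TermArgs S (os S) (Fs S) (rqs S))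
             (λ t g → sym (W.skolemVal-other t λ { (i , refl) → const-not-sk (DEF-GArg⇒Const S (os S) (Fs S) (rqs S) g) }))
             d
        where
        const-not-sk : ∀ {i} → ¬ Const (skT S (os S) μ p i)
        const-not-sk (c , ())
      b' : All (Valued.holdsˡ M W.skolemVal ρ) (branch S anc)
      b' = All.tabulate label-holds
        where
        label-holds : ∀ {l} → l ∈ branch S anc → Valued.holdsˡ M W.skolemVal ρ l
        label-holds {l} ml with em {∃ λ t → t ∈ args (atomOf l) × W.IsFreshSkolem t}
        ... | yes (t' , mt , (i , refl)) with skolem-fresh r mp mX xy (branch-labels anc ml) (_ , mt , ⊑-refl)
        ...   | _ , refl = Valued.holdsˡ-ground M W.skolemVal _ ρ l (label-ground r (branch-labels anc ml)) (twin-holds' xy)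
        label-holds {l} ml | no n = Agreement.holdsˡ-agree M val W.skolemVal ρ l (label-ground r (branch-labels anc ml))
          (λ t (mt , _) → sym (W.skolemVal-other t (λ sk → n (t , mt , sk)))) (All.lookup b ml)

  label-child : ∀ {rest : List (Lit × Tab)} {L x} → map proj₁ rest ≡ L → x ∈ L → ∃ λ t → (x , t) ∈ rest
  label-child e m with ∈-map⁻ proj₁ (subst (_ ∈_) (sym e) m)
  ... | (x , t) , m' , refl = t , m'

  child-label : ∀ {rest : List (Lit × Tab)} {L l t} → map proj₁ rest ≡ L → (l , t) ∈ rest → l ∈ L
  child-label e m = subst (_ ∈_) e (∈-map⁺ proj₁ m)

  ∈-singleton : ∀ {x : Lit} {l} → l ∈ x ∷ [] → l ≡ x
  ∈-singleton (here refl) = refl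

  ∈-pair : ∀ {l : Lit} {a b} → l ∈ a ∷ b ∷ [] → l ≡ a ⊎ l ≡ b
  ∈-pair (here refl) = inj₁ refl
  ∈-pair (there (here refl)) = inj₂ refl

  junction-node : ∀ {anc s f l t rest Hs} → Reach T anc (inner s ((l , t) ∷ rest)) → Junct f →
    InstOf s f (l ∷ map proj₁ rest) → ChildrenInterpolate anc s rest Hs → Interpolates anc (combine s Hs)
  junction-node {anc} {s} {rest = rest} r j (c , mc , μ , eq) ch with clauseShape s (os s) (Fs s) mc | j
  ... | shape-⊥ mp | j2 with ∷-injective eq
  ...   | refl , e = junction-interpolates s ch (λ m → ⊥-elim (no-label (child-label e m)))
                       (subst (SomeChildHolds s anc) (sym e) (CH.holds-⊥ (here refl) mp))
    where
    module CH = ChildHolds s r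
    no-label : ∀ {l : Lit} → l ∉ []
    no-label ()
  junction-node {anc} {s} r j (c , mc , μ , eq) ch | shape-∧₁ mp | j3 with ∷-injective eq
  ... | refl , e with label-child e (here refl)
  ...   | t₂ , m₂ = junction-interpolates s ch
          (λ m → subst (SharedArgsKnown s anc) (sym (∈-singleton (child-label e m)))
                   (definer-args-known r (here refl) (λ x i → Order.ord-child⊆ s mp ∧-left i λ ())))
          (subst (SomeChildHolds s anc) (sym e) (ChildHolds.holds-∧₁ s r (here refl) mp (there m₂)))
  junction-node {anc} {s} r j (c , mc , μ , eq) ch | shape-∧₂ mp | j4 with ∷-injective eq
  ... | refl , e with label-child e (here refl)
  ...   | t₂ , m₂ = junction-interpolates s ch
          (λ m → subst (SharedArgsKnown s anc) (sym (∈-singleton (child-label e m)))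
                   (definer-args-known r (here refl) (λ x i → Order.ord-child⊆ s mp ∧-right i λ ())))
          (subst (SomeChildHolds s anc) (sym e) (ChildHolds.holds-∧₂ s r (here refl) mp (there m₂)))
  junction-node {anc} {s} {rest = rest} r j (c , mc , μ , eq) ch | shape-∨ mp | j5 with ∷-injective eq
  ... | refl , e with label-child e (here refl) | label-child e (there (here refl))
  ...   | t₂ , m₂ | t₃ , m₃ = junction-interpolates s ch known
          (subst (SomeChildHolds s anc) (sym e) (ChildHolds.holds-∨ s r (here refl) mp (there m₂) (there m₃)))
    where
    known : ∀ {l t} → (l , t) ∈ rest → SharedArgsKnown s anc l
    known m with ∈-pair (child-label e m)
    ... | inj₁ refl = definer-args-known r (here refl) (λ x i → Order.ord-child⊆ s mp ∨-left i λ ())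
    ... | inj₂ refl = definer-args-known r (here refl) (λ x i → Order.ord-child⊆ s mp ∨-right i λ ())
  junction-node {anc} {s} r j (c , mc , μ , eq) ch | shape-∃R mp | j7 with ∷-injective eq
  ... | refl , e with label-child e (here refl)
  ...   | t₂ , m₂ = junction-interpolates s ch
          (λ m → subst (SharedArgsKnown s anc) (sym (∈-singleton (child-label e m)))
                   (∃R-args-known r (here refl) mp (there m₂)))
          (subst (SomeChildHolds s anc) (sym e) (ChildHolds.holds-skolemised s r (here refl) mp (there m₂) (inj₁ (refl , refl))))
  junction-node {anc} {s} r j (c , mc , μ , eq) ch | shape-∃D mp | j8 with ∷-injective eq
  ... | refl , e with label-child e (here refl)
  ...   | t₂ , m₂ = junction-interpolates s ch
          (λ m → subst (SharedArgsKnown s anc) (sym (∈-singleton (child-label e m)))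
                   (∃D-args-known r (here refl) mp (there m₂)))
          (subst (SomeChildHolds s anc) (sym e) (ChildHolds.holds-skolemised s r (here refl) mp (there m₂) (inj₂ (refl , refl))))

  root-node : ∀ {anc s l s' cs' H} → Reach T anc (inner s ((l , inner s' cs') ∷ [])) → InstOf s f1 (l ∷ []) →
    Interpolates ((l , s) ∷ anc) H → Interpolates anc H
  root-node {anc} {s} {s' = s'} {cs'} r (c , mc , μ , eq) i with clauseShape s (os s) (Fs s) mc
  ... | shape-root with ∷-injective eq
  ...   | refl , _ = single-child-interpolates s {s' = s'} {cs'} i (root-args-known s anc μ) (ChildHolds.holds-root s r (here refl))

  same-side-∀-node : ∀ {anc s l₁ t₁ R t₂ l₃ s₃ cs₃ H} →
    Reach T anc (inner s ((l₁ , t₁) ∷ (neg R , t₂) ∷ (l₃ , inner s₃ cs₃) ∷ [])) →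
    InstOf s f6 (l₁ ∷ neg R ∷ l₃ ∷ []) → (pos R , s) ∈ anc → Interpolates ((l₃ , s) ∷ anc) H → Interpolates anc H
  same-side-∀-node {anc} {s} {s₃ = s₃} {cs₃} r (c , mc , μ , eq) mR i with clauseShape s (os s) (Fs s) mc
  ... | shape-∀ mp with ∷-injective eq
  ...   | refl , e₂ with ∷-injective e₂
  ...     | refl , e₃ with ∷-injective e₃
  ...       | refl , _ = single-child-interpolates s {s' = s₃} {cs₃} i
                (∀-body-args-known r (here refl) mp (labelsSide anc mR refl))
                (ChildHolds.holds-∀ s r (here refl) mp (labelsSide anc mR refl) (there (there (here refl))))

  -- Form 6 at a node of side S whose ¬R is closed by the other side: the terms t₁..tₙ of R that
  -- do not occur on side S are abstracted to the variables v₁..vₙ of the quantifier.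
  module CrossSide (S : Side) {anc t₁ t₂ s₃ cs₃ H₃ ts vs tsR' H₃'} (μ : Var → Term) {p v Rp A}
    (mp : (p , all′ v Rp A) ∈ posList (Fs S))
    (r : Reach T anc (inner S ((neg (substA μ (Dat S (os S) p)) , t₁) ∷ (neg (substA μ Rp) , t₂) ∷
                                (pos (substA μ (Dat S (os S) (p ·1))) , inner s₃ cs₃) ∷ [])))
    (mR : (pos (substA μ Rp) , other S) ∈ anc)
    (i₃ : Interpolates ((pos (substA μ (Dat S (os S) (p ·1))) , S) ∷ anc) H₃)
    (gt : GTerms S (substA μ Rp) anc ts) (fr : Fresh vs ts H₃)
    (pw : Pointwise (ArgAbs (zip vs ts)) (args (substA μ Rp)) tsR') (ab₃ : Abs (zip vs ts) H₃ H₃') where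

    R R' : Atom
    R = substA μ Rp
    R' = proj₁ Rp , tsR'

    l₃ : Lit
    l₃ = pos (substA μ (Dat S (os S) (p ·1)))

    θ : Binding
    θ = zip vs ts

    θ-vars : map proj₁ θ ≡ vs
    θ-vars = map-proj₁-zip vs ts (proj₁ (proj₂ fr))

    θ-terms : map proj₂ θ ≡ ts
    θ-terms = map-proj₂-zip vs ts (proj₁ (proj₂ fr))

    abstracted⁻ : ∀ {t} → t ∈ map proj₂ θ → GArgAtom t R × ¬ OnSide S anc t
    abstracted⁻ m = to (proj₂ gt _) (subst (_ ∈_) θ-terms m)

    abstracted⁺ : ∀ {t} → GArgAtom t R → ¬ OnSide S anc t → t ∈ map proj₂ θ
    abstracted⁺ g n = subst (_ ∈_) (sym θ-terms) (from (proj₂ gt _) (g , n))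

    θ-ground : GroundRange θ
    θ-ground t m = proj₂ (proj₁ (abstracted⁻ m))

    θ-fresh : FreshFor θ H₃
    θ-fresh x m = proj₂ (proj₂ fr) x (subst (x ∈_) θ-vars m)

    R-ground : All Ground (args R)
    R-ground = label-ground r mR

    onSide-unless-abstracted : ∀ {t} → GArgAtom t R → t ∉ map proj₂ θ → OnSide S anc t
    onSide-unless-abstracted {t} g n with em {OnSide S anc t}
    ... | yes o = o
    ... | no o = ⊥-elim (n (abstracted⁺ g o))

    onSide-not-abstracted : ∀ {t} → OnSide S anc t → t ∉ map proj₂ θ
    onSide-not-abstracted o m = proj₂ (abstracted⁻ m) o

    vs-in-R' : ∀ x → x ∈ vs → var x ∈ tsR'
    vs-in-R' x i with ∈-zip⁺ˡ vs ts (proj₁ (proj₂ fr)) i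
    ... | t , mθ with pointwise-∈ˡ pw (proj₁ (proj₁ (abstracted⁻ (∈-proj₂ mθ))))
    ...   | t' , m' , inj₁ (v' , i' , refl)
      with unique-proj₂⇒injective θ (subst Unique (sym θ-terms) (proj₁ gt)) i' mθ
    ...     | refl = m'
    vs-in-R' x i | t , mθ | t' , m' , inj₂ (n , _) = ⊥-elim (n (∈-proj₂ mθ))

    quantified-RQFOT : All TArg tsR' × QuantOK vs R' × RQFOT H₃'
    quantified-RQFOT = ArgAbs-TArg pw (Ground⇒TArg R-ground) , (proj₁ fr , vs-in-R') , Abs-RQFOT θ-ground ab₃ (rqfot i₃)

    quantified-sentence : ∀ x → ¬ ((Any (x ∈ᵥ_) tsR' ⊎ FreeIn x H₃') × x ∉ vs)
    quantified-sentence x (inj₁ a , n) with ArgAbs-free pw a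
    ... | inj₁ a' = grounds-∉ᵥ R-ground a'
    ... | inj₂ i = n (subst (x ∈_) θ-vars i)
    quantified-sentence x (inj₂ f , n) with Abs-FreeIn⁻ ab₃ f
    ... | inj₁ f' = sentence i₃ x f'
    ... | inj₂ i = n (subst (x ∈_) θ-vars i)

    -- the arguments of R at positions outside v are constants or instances of x_p, hence on side S
    R-arg-onSide : ∀ t₀ → t₀ ∈ args Rp → t₀ ∉ map var v → OnSide S anc (substT μ t₀)
    R-arg-onSide t₀ m n with All.lookup (proj₁ (Order.quantAtom-RQFO S (inj₁ mp))) m
    ... | inj₁ (x , refl) = inj₂ (GArgLits⁺ (branch S anc) (definer-on-branch r (here refl))
            (substTs-vars-∈⁺ μ (os S p) x (Order.quantAtom-var⇒ord S (inj₁ mp) m (λ i → n (∈-map⁺ var i))) ,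
             substTs-ground-var μ (args Rp) x R-ground m))
    ... | inj₂ (c , refl) = inj₁ (DEF-GArg-∀ S (os S) (Fs S) mp (m , fnG []))

    top-covered : ∀ {s X} → Quant s Rp v X → CoveredIn s R' vs X
    top-covered q = Rp , v , q , refl , top-InIdx
      where
      top-InIdx : ∀ i → InIdx v (args Rp) i → InIdx vs tsR' i
      top-InIdx i (t₀ , e , n) with pointwise-nth pw (nth-substTs μ (args Rp) i e)
      ... | t' , e' , inj₁ (_ , i'' , refl) =
        ⊥-elim (onSide-not-abstracted (R-arg-onSide t₀ (nth-∈ (args Rp) i e) n) (∈-proj₂ i''))
      ... | t' , e' , inj₂ (_ , refl) =
        t' , e' , ground-∉-vars vs (All.lookup R-ground (nth-∈ (args R) i (nth-substTs μ (args Rp) i e)))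

    top-pred-other : PredIn plus (proj₁ Rp) (DEFs (other S))
    top-pred-other with proj₁ (RQFO-at (Fs S) (rqs S) mp)
    ... | n , e with original-label-pred r (subst (λ z → (pos (z , substTs μ (args Rp)) , other S) ∈ anc) e mR)
    ...   | R'' , v'' , q , e' = R'' , v'' , q , trans e' (sym e)

    inner-preds : ∀ {s R₀ w} → Quant s R₀ w H₃' → PredIn s (proj₁ R₀) DR × PredIn s (proj₁ R₀) (negQF DB)
    inner-preds {s} q with Abs-Quant⁻ ab₃ q
    ... | R₁ , q₁ , e₁ , _ = subst (λ z → PredIn s z DR × PredIn s z (negQF DB)) e₁ (preds i₃ s R₁ _ q₁)

    inner-covered : ∀ {s R₀ w X} → (∀ R v → Quant s R v H₃ → CoveredIn s R v X) → Quant s R₀ w H₃' → CoveredIn s R₀ w X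
    inner-covered cov q with Abs-Quant⁻ ab₃ q
    ... | R₁ , q₁ , e₁ , pw₁ with cov R₁ _ q₁
    ...   | R₂ , v₂ , q₂ , e₂ , ix = R₂ , v₂ , q₂ , trans e₂ e₁ ,
            (λ i z → ArgAbs-InIdx (λ x m w' → θ-fresh x m (Quant-OccIn q₁ w')) pw₁ (ix i z))

    quantified-shared : ∀ t → GArgAtom t R' ⊎ GArg t H₃' → ∀ S' → OnSide S' anc t
    quantified-shared t (inj₁ (m , g)) with ArgAbs-ground pw m g
    ... | m₀ , nθ = both-sides S {anc} (onSide-unless-abstracted (m₀ , g) nθ)
                      (inj₂ (GArgLits⁺ (branch (other S) anc) (labelsSide anc mR refl) (m₀ , g)))
    quantified-shared t (inj₂ g) with Abs-GArg⁻ ab₃ g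
    ... | g₃ , nθ = both-sides S {anc} own (onSide-other S {anc = anc} (shared i₃ t g₃ (other S)))
      where
      own : OnSide S anc t
      own with onSide-own S {anc = anc} (shared i₃ t g₃ S)
      ... | inj₂ o = o
      ... | inj₁ (mt , gt') with substTs-vars-∈⁻ μ (os S (p ·1)) t mt
      ...   | x , mx , refl with x ∈? v
      ...     | yes iv = onSide-unless-abstracted
                (substTs-∈⁺ μ (args Rp) (var x) (proj₂ (proj₂ (Order.quantAtom-RQFO S (inj₁ mp))) x iv) , gt') nθ
      ...     | no nv = inj₂ (GArgLits⁺ (branch S anc) (definer-on-branch r (here refl))
                (substTs-vars-∈⁺ μ (os S p) x (Order.quantBody-ord⇒ord S (inj₁ mp) mx nv) , gt'))

    module Semantics (M : Structure) (val : Term → Structure.D M) where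
      open Structure M using (D; inh)
      open Blocks M
      open Valued M val

      -- the tᵢ do not occur on side S, so sending them to ρ'(vᵢ) keeps the side-S premises true
      child-val : Env → Term → D
      child-val ρ' = rebind val ρ' θ

      child-val-interprets : ∀ ρ' → Interprets M (child-val ρ') θ ρ'
      child-val-interprets ρ' = rebind-∈ val ρ' θ (subst Unique (sym θ-terms) (proj₁ gt))

      abstracted⇔child : ∀ ρ ρ' → ⟦ H₃' ⟧ ρ' ⇔ Valued.⟦_⟧ M (child-val ρ') H₃ ρ
      abstracted⇔child ρ ρ' = mk⇔
        (λ h → move ρ' ρ (to abs (Agreement.⟦⟧-agree M val (child-val ρ') H₃' ρ' tas (λ t g → sym (off t g)) h)))
        (λ h → Agreement.⟦⟧-agree M (child-val ρ') val H₃' ρ' tas off (from abs (move ρ ρ' h)))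
        where
        move : ∀ ρ₁ ρ₂ → Valued.⟦_⟧ M (child-val ρ') H₃ ρ₁ → Valued.⟦_⟧ M (child-val ρ') H₃ ρ₂
        move ρ₁ ρ₂ = Valued.sentence-⟦⟧ M (child-val ρ') H₃ ρ₁ ρ₂ (sentence i₃)
        abs : Valued.⟦_⟧ M (child-val ρ') H₃' ρ' ⇔ Valued.⟦_⟧ M (child-val ρ') H₃ ρ'
        abs = Abs-⟦⟧ M (child-val ρ') ρ' θ-ground θ-fresh (child-val-interprets ρ') ab₃
        tas : TermArgs H₃'
        tas = RQFOT⇒TermArgs H₃' (proj₂ (proj₂ quantified-RQFOT))
        off : ∀ t → GArg t H₃' → child-val ρ' t ≡ val t
        off t g = rebind-∉ val ρ' θ t (proj₂ (Abs-GArg⁻ ab₃ g))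

      child-model : ∀ ρ → SideModel S anc M val ρ → ∀ ρ' → holdsᵃ ρ' R' → SideModel S ((l₃ , S) ∷ anc) M (child-val ρ') ρ
      child-model ρ (d , b) ρ' aR' = d₂ , subst (All _) (sym (branch-own S l₃ anc)) (l₃-holds ∷ b₂)
        where
        cv : Term → D
        cv = child-val ρ'
        off : ∀ {t} → OnSide S anc t → cv t ≡ val t
        off o = rebind-∉ val ρ' θ _ (onSide-not-abstracted o)
        d₂ : Valued.⟦_⟧ M cv (DEFs S) ρ
        d₂ = Agreement.⟦⟧-agree M val cv (DEFs S) ρ (DEF-TermArgs S (os S) (Fs S) (rqs S)) (λ t g → sym (off (inj₁ g))) d
        b₂ : All (Valued.holdsˡ M cv ρ) (branch S anc)
        b₂ = All.tabulate λ {l} ml → Agreement.holdsˡ-agree M val cv ρ l (label-ground r (branch-labels anc ml))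
               (λ t g → sym (off (inj₂ (GArgLits⁺ (branch S anc) ml g)))) (All.lookup b ml)
        R-holds : Valued.holdsᵃ M cv (λ _ → inh) R
        R-holds = Valued.holdsˡ-ground M cv ρ' _ (pos R) R-ground
          (to (ArgAbs-holdsᵃ M cv ρ' θ-ground (child-val-interprets ρ') pw)
            (to (Agreement.holdsᵃ-agree M val cv ρ' R' (proj₁ quantified-RQFOT)
                  (λ t (m , g) → sym (rebind-∉ val ρ' θ t (proj₂ (ArgAbs-ground pw m g))))) aR'))
        l₃-holds : Valued.holdsˡ M cv ρ l₃
        l₃-holds = let h , dh , g = ChildHolds.definer-premises S r M cv ρ (d₂ , b₂) (here refl) mp in
          ChildHolds.at-child S r M cv ρ (there (there (here refl)))
            (Unfold.unfold-∀ M cv S (os S) (Fs S) (rqs S) (oks S) ρ μ p v Rp A mp h dh g R-holds R-ground)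

      bound-env : Env → Env
      bound-env ρ = updates ρ vs (bindEnv val inh θ)

      bound-interprets : ∀ ρ → Interprets M val θ (bound-env ρ)
      bound-interprets ρ v t i =
        trans (updates-∈ ρ vs _ v (subst (v ∈_) θ-vars (∈-proj₁ i)))
              (bindEnv-∈ val inh θ (subst Unique (sym θ-vars) (proj₁ fr)) v t i)

      bound-atom : ∀ ρ → holdsᵃ (bound-env ρ) R' ⇔ holdsᵃ ρ R
      bound-atom ρ = mk⇔
        (λ a → holdsˡ-ground (bound-env ρ) ρ (pos R) R-ground (to abs a))
        (λ a → from abs (holdsˡ-ground ρ (bound-env ρ) (pos R) R-ground a))
        where
        abs : holdsᵃ (bound-env ρ) R' ⇔ holdsᵃ (bound-env ρ) R
        abs = ArgAbs-holdsᵃ M val (bound-env ρ) θ-ground (bound-interprets ρ) pw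

      bound-body : ∀ ρ → ⟦ H₃' ⟧ (bound-env ρ) ⇔ ⟦ H₃ ⟧ ρ
      bound-body ρ = mk⇔
        (λ h → sentence-⟦⟧ H₃ _ ρ (sentence i₃) (to abs h))
        (λ h → from abs (sentence-⟦⟧ H₃ ρ _ (sentence i₃) h))
        where
        abs : ⟦ H₃' ⟧ (bound-env ρ) ⇔ ⟦ H₃ ⟧ (bound-env ρ)
        abs = Abs-⟦⟧ M val (bound-env ρ) θ-ground θ-fresh (bound-interprets ρ) ab₃

      R-on-other-side : ∀ ρ → SideModel (other S) anc M val ρ → holdsᵃ ρ R
      R-on-other-side ρ (_ , b) = All.lookup b (labelsSide anc mR refl)

  crossQuantifier : Side → List Var → Atom → QF → QF
  crossQuantifier red = all′
  crossQuantifier blue = ex′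

  cross-interpolates : ∀ S {anc t₁ t₂ s₃ cs₃ H₃ ts vs H} (μ : Var → Term) {p v Rp A} →
    (p , all′ v Rp A) ∈ posList (Fs S) →
    Reach T anc (inner S ((neg (substA μ (Dat S (os S) p)) , t₁) ∷ (neg (substA μ Rp) , t₂) ∷
                          (pos (substA μ (Dat S (os S) (p ·1))) , inner s₃ cs₃) ∷ [])) →
    (pos (substA μ Rp) , other S) ∈ anc → Interpolates ((pos (substA μ (Dat S (os S) (p ·1))) , S) ∷ anc) H₃ →
    GTerms S (substA μ Rp) anc ts → Fresh vs ts H₃ → Abs (zip vs ts) (crossQuantifier S vs (substA μ Rp) H₃) H →
    Interpolates anc H
  cross-interpolates red {anc} {ts = ts} {vs} μ {p} {v} {Rp} mp r mR i₃ gt fr (absAll {A' = H₃'} pw ab₃) = record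
    { rqfot = C.quantified-RQFOT
    ; sentence = C.quantified-sentence
    ; preds = preds′
    ; covered⁺ = λ { R₀ w (inAll q) → C.inner-covered (covered⁺ i₃) q }
    ; covered⁻ = covered⁻′
    ; shared = C.quantified-shared
    ; implied = λ M val ρ sm → Blocks.AllV-intro M vs ρ λ ρ' _ → implied-instance M val ρ sm ρ'
    ; refutes = refutes′
    }
    where
    module C = CrossSide red μ mp r mR i₃ gt fr pw ab₃
    preds′ : ∀ s R₀ w → Quant s R₀ w (all′ vs C.R' H₃') → PredIn s (proj₁ R₀) DR × PredIn s (proj₁ R₀) (negQF DB)
    preds′ .minus .C.R' .vs qAll = (Rp , v , DEF-Quant-∀ red oF F mp , refl) , negQF-PredIn DB C.top-pred-other
    preds′ s R₀ w (inAll q) = C.inner-preds q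
    covered⁻′ : ∀ R₀ w → Quant minus R₀ w (all′ vs C.R' H₃') → CoveredIn minus R₀ w DR
    covered⁻′ .C.R' .vs qAll = C.top-covered (DEF-Quant-∀ red oF F mp)
    covered⁻′ R₀ w (inAll q) = C.inner-covered (covered⁻ i₃) q
    implied-instance : ∀ M val ρ → SideModel red anc M val ρ → ∀ ρ' →
      ¬ Valued.holdsᵃ M val ρ' C.R' ⊎ Valued.⟦_⟧ M val H₃' ρ'
    implied-instance M val ρ sm ρ' with em {Valued.holdsᵃ M val ρ' C.R'}
    ... | no n = inj₁ n
    ... | yes a = inj₂ (from (CS.abstracted⇔child ρ ρ') (implied i₃ M (CS.child-val ρ') ρ (CS.child-model ρ sm ρ' a)))
      where module CS = C.Semantics M val
    refutes′ : ∀ M val ρ → Valued.⟦_⟧ M val (all′ vs C.R' H₃') ρ → SideModel blue anc M val ρ → ⊥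
    refutes′ M val ρ h sm with Blocks.AllV-inst M vs ρ (bindEnv val (Structure.inh M) C.θ) h
    ... | inj₁ nr = nr (from (CS.bound-atom ρ) (CS.R-on-other-side ρ sm))
      where module CS = C.Semantics M val
    ... | inj₂ h' = refutes i₃ M val ρ (to (CS.bound-body ρ) h') sm
      where module CS = C.Semantics M val
  cross-interpolates blue {anc} {ts = ts} {vs} μ {p} {v} {Rp} mp r mR i₃ gt fr (absEx {A' = H₃'} pw ab₃) = record
    { rqfot = C.quantified-RQFOT
    ; sentence = C.quantified-sentence
    ; preds = preds′
    ; covered⁺ = covered⁺′
    ; covered⁻ = λ { R₀ w (inEx q) → C.inner-covered (covered⁻ i₃) q }
    ; shared = C.quantified-shared
    ; implied = λ M val ρ sm → let module CS = C.Semantics M val in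
        Blocks.ExV-intro M vs ρ (bindEnv val (Structure.inh M) C.θ)
          (from (CS.bound-atom ρ) (CS.R-on-other-side ρ sm) , from (CS.bound-body ρ) (implied i₃ M val ρ sm))
    ; refutes = λ M val ρ h sm → let module CS = C.Semantics M val
                                     ρ' , (a , h') , _ = Blocks.ExV-elim M vs ρ h in
        refutes i₃ M (CS.child-val ρ') ρ (to (CS.abstracted⇔child ρ ρ') h') (CS.child-model ρ sm ρ' a)
    }
    where
    module C = CrossSide blue μ mp r mR i₃ gt fr pw ab₃
    own-top : Quant plus Rp v (negQF DB)
    own-top = negQF-Quant (DEF-Quant-∀ blue oG (negQF G) mp)
    preds′ : ∀ s R₀ w → Quant s R₀ w (ex′ vs C.R' H₃') → PredIn s (proj₁ R₀) DR × PredIn s (proj₁ R₀) (negQF DB)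
    preds′ .plus .C.R' .vs qEx = C.top-pred-other , (Rp , v , own-top , refl)
    preds′ s R₀ w (inEx q) = C.inner-preds q
    covered⁺′ : ∀ R₀ w → Quant plus R₀ w (ex′ vs C.R' H₃') → CoveredIn plus R₀ w (negQF DB)
    covered⁺′ .C.R' .vs qEx = C.top-covered own-top
    covered⁺′ R₀ w (inEx q) = C.inner-covered (covered⁺ i₃) q

  cross-side-node : ∀ S {anc l₁ t₁ R t₂ l₃ s₃ cs₃ H₃ ts vs H} →
    Reach T anc (inner S ((l₁ , t₁) ∷ (neg R , t₂) ∷ (l₃ , inner s₃ cs₃) ∷ [])) →
    InstOf S f6 (l₁ ∷ neg R ∷ l₃ ∷ []) → (pos R , other S) ∈ anc → Interpolates ((l₃ , S) ∷ anc) H₃ →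
    GTerms S R anc ts → Fresh vs ts H₃ → Abs (zip vs ts) (crossQuantifier S vs R H₃) H → Interpolates anc H
  cross-side-node S r (c , mc , μ , eq) mR i₃ gt fr ab with clauseShape S (os S) (Fs S) mc
  ... | shape-∀ mp with ∷-injective eq
  ...   | refl , e₂ with ∷-injective e₂
  ...     | refl , e₃ with ∷-injective e₃
  ...       | refl , _ = cross-interpolates S μ mp r mR i₃ gt fr ab

  mutual
    aipol-interpolates : ∀ {anc s cs H} → Reach T anc (inner s cs) → Aip anc s cs H → Interpolates anc H
    aipol-interpolates r (aip1 inst rec) = root-node r inst (aipol-interpolates (child r (here refl)) rec)
    aipol-interpolates r (aipJ j inst rest) = junction-node r j inst (children-interpolate r there rest)
    aipol-interpolates r (aip6 inst mR rec) =
      same-side-∀-node r inst mR (aipol-interpolates (child r (there (there (here refl)))) rec)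
    aipol-interpolates r (aip6rb inst mR rec gt fr ab) =
      cross-side-node red r inst mR (aipol-interpolates (child r (there (there (here refl)))) rec) gt fr ab
    aipol-interpolates r (aip6br inst mR rec gt fr ab) =
      cross-side-node blue r inst mR (aipol-interpolates (child r (there (there (here refl)))) rec) gt fr ab

    children-interpolate : ∀ {anc s cs rest Hs} → Reach T anc (inner s cs) → (∀ {e} → e ∈ rest → e ∈ cs) →
      AipAll anc s rest Hs → ChildrenInterpolate anc s rest Hs
    children-interpolate r sub [] = []
    children-interpolate r sub (a ∷ as) =
      aipol-interpolates (child r (sub (here refl))) a ∷ children-interpolate r (λ m → sub (there m)) as

  weak-access-interpolant : ∀ {anc s cs H} → Reach T anc (inner s cs) → Interpolates anc H →
    WeakAI DR (branch red anc) (negQF DB) (branch blue anc) H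
  weak-access-interpolant {anc} {H = H} r i =
    rqfot i , sentence i , red-entails , blue-refuted , preds i , covered⁺ i , covered⁻ i ,
    (λ t g → shared i t g red , Sum.map₁ (negQF-GArg⁺ DB) (shared i t g blue))
    where
    tH : TermArgs H
    tH = RQFOT⇒TermArgs H (rqfot i)
    standard-branch : ∀ M ρ S → All (Sem.evalL M ρ) (branch S anc) → All (Valued.holdsˡ M (Standard.groundVal M) ρ) (branch S anc)
    standard-branch M ρ S b = All.tabulate λ {l} m →
      Standard.evalL⇒holdsˡ M ρ l (label-ground r (branch-labels anc m)) (All.lookup b m)
    red-entails : ∀ M ρ → Sem.⟦_⟧ M DR ρ → All (Sem.evalL M ρ) (branch red anc) → Sem.⟦_⟧ M H ρ
    red-entails M ρ d b = from (Standard.Sem⇔Valued M H ρ tH)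
      (implied i M (Standard.groundVal M) ρ
        (to (Standard.Sem⇔Valued M DR ρ (DEF-TermArgs red oF F rqF)) d , standard-branch M ρ red b))
    blue-refuted : ∀ M ρ → Sem.⟦_⟧ M H ρ → Sem.⟦_⟧ M (negQF DB) ρ ⊎ Any (λ l → ¬ Sem.evalL M ρ l) (branch blue anc)
    blue-refuted M ρ h with em {All (Sem.evalL M ρ) (branch blue anc)}
    ... | no nb = inj₂ (¬All⇒Any¬ (λ _ → em) (branch blue anc) nb)
    ... | yes b with em {Valued.⟦_⟧ M (Standard.groundVal M) DB ρ}
    ...   | yes d = ⊥-elim (refutes i M (Standard.groundVal M) ρ (to (Standard.Sem⇔Valued M H ρ tH) h)
                                  (d , standard-branch M ρ blue b))
    ...   | no nd = inj₁ (from (Standard.Sem⇔Valued M (negQF DB) ρ (negQF-TermArgs DB tDB))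
                              (Valued.¬⟦⟧⇒⟦negQF⟧ M (Standard.groundVal M) em DB ρ nd))
      where
      tDB : TermArgs DB
      tDB = DEF-TermArgs blue oG (negQF G) (negQF-RQFO G rqG)

lemma3 : ExcludedMiddle 0ℓ →
    (F G : QF) (oF oG : Ord) →
    RQFO F → Sentence F → RQFO G → Sentence G →
    OrdOK F oF → OrdOK (negQF G) oG →
    Entails F G →
    (T : Tab) → TableauDefs.ACI F G oF oG T →
    ∀ (anc : List (Lit × Side)) (s : Side) (cs : List (Lit × Tab)) →
    Reach T anc (inner s cs) →
    ∀ (H : QF) → TableauDefs.Aip F G oF oG anc s cs H →
    WeakAI (DEF red oF F) (branch red anc)
           (negQF (DEF blue oG (negQF G))) (branch blue anc) H
lemma3 em F G oF oG rqF senF rqG senG okF okG _ T aci anc s cs r H aip =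
  weak-access-interpolant r (aipol-interpolates r aip)
  where open Interpolation em F G oF oG rqF senF rqG senG okF okG T aci
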